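{- Let $p$ be a prime with $p\equiv 5$ or $11\pmod{12}$, and let $r$ be an integer with $1\le r\le p-1$ and $p\mid 3r+1$. Then for all integers $n\ge 0$ and all integers $k\ge j\ge 0$, \[ a_{p(k-j)+(p-4),\;pk+p}(pn+r)\equiv 0 \pmod p. \]
   Context: For positive integers $r,s$, $a_{r,s}(n)$ denotes the number of multicolored partitions of $n$ in which each even part may appear in one of $r$ colors and each odd part may appear in one of $s$ colors (copies of the same part size in different colors are distinct), with $a_{r,s}(0)=1$. Equivalently, for $|q|<1$, $\sum_{n\ge0}a_{r,s}(n)q^n = f_2^{s-r}/f_1^{s}$, where $f_m=\prod_{i\ge1}(1-q^{mi})$. -}

module Defs where

open import Data.Nat using (ℕ; zero; suc; _+_; _*_; _∸_; _<ᵇ_)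
open import Data.Nat.Base using (_%_)
open import Data.Bool using (Bool; true; false; if_then_else_)

colors : ℕ → ℕ → ℕ → ℕ
colors r s i = if (i % 2 Data.Nat.Base.≡ᵇ 0) then r else s

mutual
  -- Q r s fuel m n : number of multicolored partitions of n with parts in {1..m}
  -- (fuel ≥ n guarantees termination; each step removes a part of size ≥ 1)
  Q : ℕ → ℕ → ℕ → ℕ → ℕ → ℕ
  Q r s fuel zero n = if (n Data.Nat.Base.≡ᵇ 0) then 1 else 0
  Q r s fuel (suc m) n = R r s fuel (suc m) (colors r s (suc m)) n

  -- R r s fuel m c n : partitions of n with parts in {1..m-1} in all their colors,
  -- and parts of size m using only the first c of its colors
  R : ℕ → ℕ → ℕ → ℕ → ℕ → ℕ → ℕ
  R r s fuel zero c n = Q r s fuel zero n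
  R r s fuel (suc m) zero n = Q r s fuel m n
  R r s zero (suc m) (suc c) n = R r s zero (suc m) c n
  R r s (suc fuel) (suc m) (suc c) n =
    R r s (suc fuel) (suc m) c n
    + (if n <ᵇ suc m then 0 else R r s fuel (suc m) (suc c) (n ∸ suc m))

-- a_{r,s}(n): number of multicolored partitions of n where each even part
-- has r colors and each odd part has s colors; a_{r,s}(0) = 1.
a : ℕ → ℕ → ℕ → ℕ
a r s n = Q r s n n n

{-# OPTIONS --safe #-}
module Submission where

-- The generating function of a_{r,s} is f₂^(s-r) / f₁^s; for r = p(k-j) + p - 4 and s = pk + p this is
-- f₂⁴ · f₂^(pj) / f₁^(p(k+1)).  Modulo p every p-th power F^p is a series in q^p, so the coefficients of
-- q^(pn+r) vanish modulo p as soon as those of f₂⁴ = f₂ · f₂³ do.  By Euler's pentagonal theorem and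
-- Jacobi's identity f₁³ = Σ (-1)^k (2k+1) q^(k(k+1)/2), after pairing symmetric terms every contribution
-- to q^t in f₂⁴ is a multiple of some Y = 2k+1 with 12t + 4 = X² + 3Y².  For t ≡ r (mod p) we have
-- p ∣ 12t + 4, and since -3 is not a square modulo a prime p ≡ 2 (mod 3), p ∣ X² + 3Y² forces p ∣ Y.
--
-- All series identities are proved for truncations: the partitions into parts ≤ pn + r, finite
-- products (q^d;q^d)_L, and finite forms of Jacobi's and Euler's identities obtained from Rothe's
-- q-binomial theorem (Jacobi's through its derivative, computed with dual numbers), which agree with
-- the infinite ones below an explicit degree.

open import Algebra.Bundles using (CommutativeRing)
import Data.Nat as ℕ
open ℕ using (ℕ; zero; suc)

tri : ℕ → ℕ
tri zero    = 0
tri (suc a) = tri a ℕ.+ a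

module IntegerCoefficients {c ℓ} (R : CommutativeRing c ℓ) where
  import Algebra.Solver.Ring as RingSolver
  open import Algebra.Solver.Ring.AlmostCommutativeRing
    using (fromCommutativeRing; _-Raw-AlmostCommutative⟶_)
  open import Data.Nat as ℕ using (zero; suc)
  import Data.Nat.Properties as ℕ
  open import Data.Integer as ℤ using (ℤ; +_; -[1+_]; _⊖_)
  import Data.Integer.Properties as ℤ
  open import Data.Maybe using (Maybe; just; nothing)
  open import Relation.Binary.PropositionalEquality using (cong)
  open import Relation.Nullary using (yes; no)
  open CommutativeRing R
  open import Algebra.Properties.Ring ring
    using (-‿distribˡ-*; -‿distribʳ-*; -0#≈0#; -‿involutive; -‿+-comm)
  open import Algebra.Properties.CommutativeSemigroup +-commutativeSemigroup
    using (interchange)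
  open import Algebra.Properties.Semiring.Mult.TCOptimised semiring
    using (_×_; 1+×; ×-homo-+; ×1-homo-*)
  open import Relation.Binary.Reasoning.Setoid setoid

  -- The optimised _×_ has 1 × x = x, so the solver's constant con (+ 1) is 1# on the nose.
  ⟦_⟧ : ℤ → Carrier
  ⟦ + n ⟧      = n × 1#
  ⟦ -[1+ n ] ⟧ = - (suc n × 1#)

  private
    +-cancel-common : ∀ a m n → (a + m) - (a + n) ≈ m - n
    +-cancel-common a m n = begin
      (a + m) + - (a + n)    ≈⟨ +-congˡ (-‿+-comm a n) ⟨
      (a + m) + (- a + - n)  ≈⟨ interchange a m (- a) (- n) ⟩
      (a - a) + (m - n)      ≈⟨ +-congʳ (-‿inverseʳ a) ⟩
      0# + (m - n)           ≈⟨ +-identityˡ _ ⟩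
      m - n                  ∎

  ⟦⟧-homo-⊖ : ∀ m n → ⟦ m ⊖ n ⟧ ≈ m × 1# - n × 1#
  ⟦⟧-homo-⊖ zero    zero    = sym (-‿inverseʳ 0#)
  ⟦⟧-homo-⊖ zero    (suc n) = sym (+-identityˡ _)
  ⟦⟧-homo-⊖ (suc m) zero    = sym (trans (+-congˡ -0#≈0#) (+-identityʳ _))
  ⟦⟧-homo-⊖ (suc m) (suc n) = begin
    ⟦ suc m ⊖ suc n ⟧                ≡⟨ cong ⟦_⟧ (ℤ.[1+m]⊖[1+n]≡m⊖n m n) ⟩
    ⟦ m ⊖ n ⟧                        ≈⟨ ⟦⟧-homo-⊖ m n ⟩
    m × 1# - n × 1#                  ≈⟨ +-cancel-common 1# _ _ ⟨
    (1# + m × 1#) - (1# + n × 1#)    ≈⟨ +-cong (1+× m 1#) (-‿cong (1+× n 1#)) ⟨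
    suc m × 1# - suc n × 1#          ∎

  ⟦⟧-homo-+ : ∀ i j → ⟦ i ℤ.+ j ⟧ ≈ ⟦ i ⟧ + ⟦ j ⟧
  ⟦⟧-homo-+ (+ m)      (+ n)      = ×-homo-+ 1# m n
  ⟦⟧-homo-+ (+ m)      -[1+ n ]   = ⟦⟧-homo-⊖ m (suc n)
  ⟦⟧-homo-+ -[1+ m ]   (+ n)      = trans (⟦⟧-homo-⊖ n (suc m)) (+-comm _ _)
  ⟦⟧-homo-+ -[1+ m ]   -[1+ n ]   = begin
    - (suc (suc (m ℕ.+ n)) × 1#)           ≡⟨ cong (λ k → - (suc k × 1#)) (ℕ.+-suc m n) ⟨
    - ((suc m ℕ.+ suc n) × 1#)             ≈⟨ -‿cong (×-homo-+ 1# (suc m) (suc n)) ⟩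
    - (suc m × 1# + suc n × 1#)            ≈⟨ -‿+-comm _ _ ⟨
    - (suc m × 1#) + - (suc n × 1#)        ∎

  ⟦⟧-homo-neg : ∀ i → ⟦ ℤ.- i ⟧ ≈ - ⟦ i ⟧
  ⟦⟧-homo-neg (+ zero)  = sym -0#≈0#
  ⟦⟧-homo-neg (+ suc n) = refl
  ⟦⟧-homo-neg -[1+ n ]  = sym (-‿involutive _)

  private
    ⟦⟧-homo-*⁺ : ∀ m j → ⟦ + m ℤ.* j ⟧ ≈ ⟦ + m ⟧ * ⟦ j ⟧
    ⟦⟧-homo-*⁺ m (+ n) = begin
      ⟦ + m ℤ.* + n ⟧  ≡⟨ cong ⟦_⟧ (ℤ.pos-* m n) ⟨
      (m ℕ.* n) × 1#   ≈⟨ ×1-homo-* m n ⟩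
      ⟦ + m ⟧ * ⟦ + n ⟧ ∎
    ⟦⟧-homo-*⁺ m -[1+ n ] = begin
      ⟦ + m ℤ.* ℤ.- + suc n ⟧      ≡⟨ cong ⟦_⟧ (ℤ.neg-distribʳ-* (+ m) (+ suc n)) ⟨
      ⟦ ℤ.- (+ m ℤ.* + suc n) ⟧    ≈⟨ ⟦⟧-homo-neg (+ m ℤ.* + suc n) ⟩
      - ⟦ + m ℤ.* + suc n ⟧        ≈⟨ -‿cong (⟦⟧-homo-*⁺ m (+ suc n)) ⟩
      - (⟦ + m ⟧ * ⟦ + suc n ⟧)    ≈⟨ -‿distribʳ-* _ _ ⟩
      ⟦ + m ⟧ * ⟦ -[1+ n ] ⟧       ∎

  ⟦⟧-homo-* : ∀ i j → ⟦ i ℤ.* j ⟧ ≈ ⟦ i ⟧ * ⟦ j ⟧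
  ⟦⟧-homo-* (+ m)    j = ⟦⟧-homo-*⁺ m j
  ⟦⟧-homo-* -[1+ m ] j = begin
    ⟦ ℤ.- + suc m ℤ.* j ⟧        ≡⟨ cong ⟦_⟧ (ℤ.neg-distribˡ-* (+ suc m) j) ⟨
    ⟦ ℤ.- (+ suc m ℤ.* j) ⟧      ≈⟨ ⟦⟧-homo-neg (+ suc m ℤ.* j) ⟩
    - ⟦ + suc m ℤ.* j ⟧          ≈⟨ -‿cong (⟦⟧-homo-*⁺ (suc m) j) ⟩
    - (⟦ + suc m ⟧ * ⟦ j ⟧)      ≈⟨ -‿distribˡ-* _ _ ⟩
    ⟦ -[1+ m ] ⟧ * ⟦ j ⟧         ∎

  private
    homomorphism : ℤ.+-*-rawRing -Raw-AlmostCommutative⟶ fromCommutativeRing R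
    homomorphism = record
      { ⟦_⟧ = ⟦_⟧ ; +-homo = ⟦⟧-homo-+ ; *-homo = ⟦⟧-homo-* ; -‿homo = ⟦⟧-homo-neg
      ; 0-homo = refl ; 1-homo = refl }

    weakly-decide : ∀ i j → Maybe (⟦ i ⟧ ≈ ⟦ j ⟧)
    weakly-decide i j with i ℤ.≟ j
    ... | yes i≡j = just (reflexive (cong ⟦_⟧ i≡j))
    ... | no _    = nothing

  open RingSolver ℤ.+-*-rawRing (fromCommutativeRing R) homomorphism weakly-decide public
    using (solve; _:=_; _:+_; _:*_; :-_; _:-_; con)

module FiniteSums {c ℓ} (R : CommutativeRing c ℓ) where
  open import Data.Nat as ℕ using (ℕ; zero; suc)
  import Data.Nat.Properties as ℕ
  open import Data.Integer using (+_)
  open import Relation.Binary.PropositionalEquality as ≡ using (_≡_)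
  open CommutativeRing R public
  open import Algebra.Properties.CommutativeSemiring.Exp commutativeSemiring public
    using (_^_; ^-homo-*; ^-assocʳ; ^-distrib-*; ^-congˡ; ^-congʳ)
  open IntegerCoefficients R public
  open import Relation.Binary.Reasoning.Setoid setoid

  1^n≈1 : ∀ n → 1# ^ n ≈ 1#
  1^n≈1 zero    = refl
  1^n≈1 (suc n) = trans (*-identityˡ _) (1^n≈1 n)

  ∏ : ℕ → (ℕ → Carrier) → Carrier
  ∏ zero    f = 1#
  ∏ (suc n) f = ∏ n f * f n

  syntax ∏ n (λ i → e) = ∏[ i < n ] e

  ∏-cong : ∀ n {f g} → (∀ i → i ℕ.< n → f i ≈ g i) → ∏ n f ≈ ∏ n g
  ∏-cong zero    f≈g = refl
  ∏-cong (suc n) f≈g = *-cong (∏-cong n (λ i i<n → f≈g i (ℕ.m<n⇒m<1+n i<n))) (f≈g n ℕ.≤-refl)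

  ∏-const : ∀ n x → ∏[ i < n ] x ≈ x ^ n
  ∏-const zero    x = refl
  ∏-const (suc n) x = trans (*-congʳ (∏-const n x)) (*-comm _ x)

  ∏-distrib-* : ∀ n f g → ∏[ i < n ] (f i * g i) ≈ ∏ n f * ∏ n g
  ∏-distrib-* zero    f g = sym (*-identityˡ 1#)
  ∏-distrib-* (suc n) f g = trans (*-congʳ (∏-distrib-* n f g))
    (solve 4 (λ a b c d → (a :* b) :* (c :* d) := (a :* c) :* (b :* d)) refl _ _ _ _)

  ∏-^ : ∀ n f e → ∏ n f ^ e ≈ ∏[ i < n ] (f i ^ e)
  ∏-^ zero    f e = 1^n≈1 e
  ∏-^ (suc n) f e = trans (^-distrib-* _ _ e) (*-congʳ (∏-^ n f e))

  ∏-split : ∀ m n f → ∏ (m ℕ.+ n) f ≈ ∏ m f * ∏[ i < n ] f (m ℕ.+ i)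
  ∏-split m zero    f = trans (reflexive (≡.cong (λ k → ∏ k f) (ℕ.+-identityʳ m))) (sym (*-identityʳ _))
  ∏-split m (suc n) f = trans (reflexive (≡.cong (λ k → ∏ k f) (ℕ.+-suc m n)))
    (trans (*-congʳ (∏-split m n f)) (*-assoc _ _ _))

  ∏-front : ∀ n f → ∏ (suc n) f ≈ f 0 * ∏[ i < n ] f (suc i)
  ∏-front n f = trans (∏-split 1 n f) (*-congʳ (*-identityˡ (f 0)))

  antidiag : ℕ → (ℕ → ℕ → Carrier) → Carrier
  antidiag zero    F = F 0 0
  antidiag (suc n) F = F 0 (suc n) + antidiag n (λ a b → F (suc a) b)

  antidiag-cong : ∀ n {F G} → (∀ a b → a ℕ.+ b ≡ n → F a b ≈ G a b) → antidiag n F ≈ antidiag n G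
  antidiag-cong zero    F≈G = F≈G 0 0 ≡.refl
  antidiag-cong (suc n) F≈G = +-cong (F≈G 0 (suc n) ≡.refl) (antidiag-cong n (λ a b e → F≈G (suc a) b (≡.cong suc e)))

  antidiag-zero : ∀ n F → (∀ a b → a ℕ.+ b ≡ n → F a b ≈ 0#) → antidiag n F ≈ 0#
  antidiag-zero zero    F F≈0 = F≈0 0 0 ≡.refl
  antidiag-zero (suc n) F F≈0 = trans (+-cong (F≈0 0 (suc n) ≡.refl) (antidiag-zero n _ (λ a b e → F≈0 (suc a) b (≡.cong suc e))))
    (+-identityˡ 0#)

  antidiag-distrib-+ : ∀ n F G → antidiag n (λ a b → F a b + G a b) ≈ antidiag n F + antidiag n G
  antidiag-distrib-+ zero    F G = refl
  antidiag-distrib-+ (suc n) F G = trans (+-congˡ (antidiag-distrib-+ n _ _))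
    (solve 4 (λ a b c d → (a :+ b) :+ (c :+ d) := (a :+ c) :+ (b :+ d)) refl _ _ _ _)

  antidiag-*ʳ : ∀ n F x → antidiag n F * x ≈ antidiag n (λ a b → F a b * x)
  antidiag-*ʳ zero    F x = refl
  antidiag-*ʳ (suc n) F x = trans (distribʳ x _ _) (+-congˡ (antidiag-*ʳ n _ x))

  antidiag-*ˡ : ∀ n F x → x * antidiag n F ≈ antidiag n (λ a b → x * F a b)
  antidiag-*ˡ n F x = trans (*-comm x _) (trans (antidiag-*ʳ n F x) (antidiag-cong n (λ a b _ → *-comm _ _)))

  antidiag-last : ∀ n F → antidiag (suc n) F ≈ antidiag n (λ a b → F a (suc b)) + F (suc n) 0
  antidiag-last zero    F = refl
  antidiag-last (suc n) F = trans (+-congˡ (antidiag-last n (λ a b → F (suc a) b))) (sym (+-assoc _ _ _))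

  antidiag-swap : ∀ n F → antidiag n F ≈ antidiag n (λ a b → F b a)
  antidiag-swap zero    F = refl
  antidiag-swap (suc n) F = trans (+-congˡ (antidiag-swap n (λ a b → F (suc a) b)))
    (trans (+-comm _ _) (sym (antidiag-last n (λ a b → F b a))))

  antidiag-assoc : ∀ n (K : ℕ → ℕ → ℕ → Carrier) →
    antidiag n (λ a b → antidiag a (λ c d → K c d b)) ≈ antidiag n (λ a b → antidiag b (λ c d → K a c d))
  antidiag-assoc zero    K = refl
  antidiag-assoc (suc n) K = begin
      K 0 0 (suc n) + antidiag n (λ a b → K 0 (suc a) b + antidiag a (λ c d → K (suc c) d b))
    ≈⟨ +-congˡ (antidiag-distrib-+ n _ _) ⟩
      K 0 0 (suc n) + (antidiag n (λ a b → K 0 (suc a) b) + antidiag n (λ a b → antidiag a (λ c d → K (suc c) d b)))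
    ≈⟨ +-congˡ (+-congˡ (antidiag-assoc n (λ c d b → K (suc c) d b))) ⟩
      K 0 0 (suc n) + (antidiag n (λ a b → K 0 (suc a) b) + antidiag n (λ a b → antidiag b (λ c d → K (suc a) c d)))
    ≈⟨ +-assoc _ _ _ ⟨
      (K 0 0 (suc n) + antidiag n (λ a b → K 0 (suc a) b)) + antidiag n (λ a b → antidiag b (λ c d → K (suc a) c d))
    ∎

  antidiag-weighted : ∀ n F x → antidiag n (λ a b → F a b * (x ^ a * x ^ b)) ≈ antidiag n F * x ^ n
  antidiag-weighted zero    F x = *-congˡ (*-identityˡ 1#)
  antidiag-weighted (suc n) F x = begin
      F 0 (suc n) * (1# * x ^ suc n) + antidiag n (λ a b → F (suc a) b * (x ^ suc a * x ^ b))
    ≈⟨ +-cong (*-congˡ (*-identityˡ _)) (antidiag-cong n (λ a b _ →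
         solve 4 (λ f x xa xb → f :* ((x :* xa) :* xb) := (f :* x) :* (xa :* xb)) refl _ x _ _)) ⟩
      F 0 (suc n) * x ^ suc n + antidiag n (λ a b → (F (suc a) b * x) * (x ^ a * x ^ b))
    ≈⟨ +-congˡ (antidiag-weighted n _ x) ⟩
      F 0 (suc n) * x ^ suc n + antidiag n (λ a b → F (suc a) b * x) * x ^ n
    ≈⟨ +-congˡ (*-congʳ (antidiag-*ʳ n _ x)) ⟨
      F 0 (suc n) * x ^ suc n + antidiag n (λ a b → F (suc a) b) * x * x ^ n
    ≈⟨ solve 4 (λ f d x y → f :* (x :* y) :+ d :* x :* y := (f :+ d) :* (x :* y)) refl
         (F 0 (suc n)) (antidiag n (λ a b → F (suc a) b)) x (x ^ n) ⟩
      (F 0 (suc n) + antidiag n (λ a b → F (suc a) b)) * x ^ suc n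
    ∎

  -- The Gaussian binomial coefficient [a+b choose a] in base q.
  qbinom : Carrier → ℕ → ℕ → Carrier
  qbinom q zero    b       = 1#
  qbinom q (suc a) zero    = 1#
  qbinom q (suc a) (suc b) = qbinom q (suc a) b + q ^ suc b * qbinom q a (suc b)

  qbinom-zeroʳ : ∀ q a → qbinom q a 0 ≈ 1#
  qbinom-zeroʳ q zero    = refl
  qbinom-zeroʳ q (suc a) = refl

  qbinom-cong : ∀ {q q′} → q ≈ q′ → ∀ a b → qbinom q a b ≈ qbinom q′ a b
  qbinom-cong q≈q′ zero    b       = refl
  qbinom-cong q≈q′ (suc a) zero    = refl
  qbinom-cong q≈q′ (suc a) (suc b) =
    +-cong (qbinom-cong q≈q′ (suc a) b) (*-cong (^-congˡ (suc b) q≈q′) (qbinom-cong q≈q′ a (suc b)))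

  rothe-term : Carrier → Carrier → Carrier → ℕ → ℕ → Carrier
  rothe-term q x y a b = qbinom q a b * q ^ tri a * y ^ a * x ^ b

  private
    rothe-pascal : ∀ q x y a b →
      rothe-term q x y (suc a) b * x + rothe-term q x y a (suc b) * y * (q ^ a * q ^ suc b)
        ≈ rothe-term q x y (suc a) (suc b)
    rothe-pascal q x y a b = begin
        B₁ * q ^ (tri a ℕ.+ a) * (y * y ^ a) * x ^ b * x + B₂ * q ^ tri a * y ^ a * (x * x ^ b) * y * (q ^ a * (q * q ^ b))
      ≈⟨ +-congʳ (*-congʳ (*-congʳ (*-congʳ (*-congˡ (^-homo-* q (tri a) a))))) ⟩
        B₁ * (q ^ tri a * q ^ a) * (y * y ^ a) * x ^ b * x + B₂ * q ^ tri a * y ^ a * (x * x ^ b) * y * (q ^ a * (q * q ^ b))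
      ≈⟨ solve 10 (λ B₁ B₂ qT qa qb q ya y xb x →
            B₁ :* (qT :* qa) :* (y :* ya) :* xb :* x :+ B₂ :* qT :* ya :* (x :* xb) :* y :* (qa :* (q :* qb))
            := (B₁ :+ q :* qb :* B₂) :* (qT :* qa) :* (y :* ya) :* (x :* xb)) refl
            B₁ B₂ (q ^ tri a) (q ^ a) (q ^ b) q (y ^ a) y (x ^ b) x ⟩
        (B₁ + q ^ suc b * B₂) * (q ^ tri a * q ^ a) * (y * y ^ a) * (x * x ^ b)
      ≈⟨ *-congʳ (*-congʳ (*-congˡ (^-homo-* q (tri a) a))) ⟨
        (B₁ + q ^ suc b * B₂) * q ^ (tri a ℕ.+ a) * (y * y ^ a) * (x * x ^ b)
      ∎
      where
      B₁ B₂ : Carrier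
      B₁ = qbinom q (suc a) b
      B₂ = qbinom q a (suc b)

    -- The two summands of the inductive step, re-indexed so that Pascal's rule for qbinom merges them termwise.
    rothe-x rothe-y : Carrier → Carrier → Carrier → ℕ → ℕ → Carrier
    rothe-x q x y a zero    = 0#
    rothe-x q x y a (suc b) = rothe-term q x y a b * x
    rothe-y q x y zero    b = 0#
    rothe-y q x y (suc a) b = rothe-term q x y a b * y * (q ^ a * q ^ b)

    rothe-x+y : ∀ q x y n a b → a ℕ.+ b ≡ suc n → rothe-x q x y a b + rothe-y q x y a b ≈ rothe-term q x y a b
    rothe-x+y q x y n zero    (suc b) _ = solve 2 (λ xb x → con (+ 1) :* con (+ 1) :* con (+ 1) :* xb :* x :+ con (+ 0)
                                                  := con (+ 1) :* con (+ 1) :* con (+ 1) :* (x :* xb)) refl (x ^ b) x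
    rothe-x+y q x y n (suc a) zero    _ = begin
        0# + qbinom q a 0 * q ^ tri a * y ^ a * 1# * y * (q ^ a * 1#)
      ≈⟨ +-congˡ (*-congʳ (*-congʳ (*-congʳ (*-congʳ (*-congʳ (qbinom-zeroʳ q a)))))) ⟩
        0# + 1# * q ^ tri a * y ^ a * 1# * y * (q ^ a * 1#)
      ≈⟨ solve 4 (λ qT ya y qa → con (+ 0) :+ con (+ 1) :* qT :* ya :* con (+ 1) :* y :* (qa :* con (+ 1))
                     := con (+ 1) :* (qT :* qa) :* (y :* ya) :* con (+ 1)) refl (q ^ tri a) (y ^ a) y (q ^ a) ⟩
        1# * (q ^ tri a * q ^ a) * (y * y ^ a) * 1#
      ≈⟨ *-congʳ (*-congʳ (*-congˡ (^-homo-* q (tri a) a))) ⟨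
        1# * q ^ (tri a ℕ.+ a) * (y * y ^ a) * 1#
      ∎
    rothe-x+y q x y n (suc a) (suc b) _ = rothe-pascal q x y a b

  rothe : ∀ q x y n → ∏[ i < n ] (x + y * q ^ i) ≈ antidiag n (rothe-term q x y)
  rothe q x y zero    = solve 0 (con (+ 1) := con (+ 1) :* con (+ 1) :* con (+ 1) :* con (+ 1)) refl
  rothe q x y (suc n) = begin
      ∏[ i < n ] (x + y * q ^ i) * (x + y * q ^ n)
    ≈⟨ *-congʳ (rothe q x y n) ⟩
      antidiag n F * (x + y * q ^ n)
    ≈⟨ solve 4 (λ d x y z → d :* (x :+ y :* z) := d :* x :+ d :* y :* z) refl (antidiag n F) x y (q ^ n) ⟩
      antidiag n F * x + antidiag n F * y * q ^ n
    ≈⟨ +-cong (antidiag-*ʳ n F x) (*-congʳ (antidiag-*ʳ n F y)) ⟩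
      antidiag n (λ a b → F a b * x) + antidiag n (λ a b → F a b * y) * q ^ n
    ≈⟨ +-congˡ (antidiag-weighted n (λ a b → F a b * y) q) ⟨
      antidiag n (λ a b → F a b * x) + antidiag n (λ a b → F a b * y * (q ^ a * q ^ b))
    ≈⟨ +-cong (+-identityʳ _) (+-identityˡ _) ⟨
      (antidiag n (λ a b → Gˣ a (suc b)) + Gˣ (suc n) 0) + (Gʸ 0 (suc n) + antidiag n (λ a b → Gʸ (suc a) b))
    ≈⟨ +-congʳ (antidiag-last n Gˣ) ⟨
      antidiag (suc n) Gˣ + antidiag (suc n) Gʸ
    ≈⟨ antidiag-distrib-+ (suc n) Gˣ Gʸ ⟨
      antidiag (suc n) (λ a b → Gˣ a b + Gʸ a b)
    ≈⟨ antidiag-cong (suc n) (rothe-x+y q x y n) ⟩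
      antidiag (suc n) F
    ∎
    where
    F Gˣ Gʸ : ℕ → ℕ → Carrier
    F  = rothe-term q x y
    Gˣ = rothe-x q x y
    Gʸ = rothe-y q x y

  qint : Carrier → ℕ → Carrier
  qint q zero    = 0#
  qint q (suc m) = 1# + q * qint q m

  qint-+ : ∀ q m n → qint q (m ℕ.+ n) ≈ qint q m + q ^ m * qint q n
  qint-+ q zero    n = solve 1 (λ z → z := con (+ 0) :+ con (+ 1) :* z) refl (qint q n)
  qint-+ q (suc m) n = trans (+-congˡ (*-congˡ (qint-+ q m n)))
    (solve 4 (λ q a b c → con (+ 1) :+ q :* (a :+ b :* c) := con (+ 1) :+ q :* a :+ q :* b :* c) refl
      q (qint q m) (q ^ m) (qint q n))

  qfac : Carrier → ℕ → Carrier
  qfac q m = ∏[ i < m ] qint q (suc i)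

  qbinom-qfac : ∀ q a b → qbinom q a b * (qfac q a * qfac q b) ≈ qfac q (a ℕ.+ b)
  qbinom-qfac q zero    b    = trans (*-identityˡ _) (*-identityˡ _)
  qbinom-qfac q (suc a) zero = trans (*-identityˡ _) (trans (*-identityʳ _)
    (reflexive (≡.cong (qfac q) (≡.sym (ℕ.+-identityʳ (suc a))))))
  qbinom-qfac q (suc a) (suc b) = begin
      (B₁ + q ^ suc b * B₂) * (qfac q a * qint q (suc a) * (qfac q b * qint q (suc b)))
    ≈⟨ solve 7 (λ B₁ B₂ qsb fa ia fb ib →
          (B₁ :+ qsb :* B₂) :* (fa :* ia :* (fb :* ib))
          := B₁ :* (fa :* ia :* fb) :* ib :+ B₂ :* (fa :* (fb :* ib)) :* (qsb :* ia)) refl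
          B₁ B₂ (q ^ suc b) (qfac q a) (qint q (suc a)) (qfac q b) (qint q (suc b)) ⟩
      B₁ * (qfac q (suc a) * qfac q b) * qint q (suc b) + B₂ * (qfac q a * qfac q (suc b)) * (q ^ suc b * qint q (suc a))
    ≈⟨ +-cong (*-congʳ (qbinom-qfac q (suc a) b)) (*-congʳ (qbinom-qfac q a (suc b))) ⟩
      qfac q (suc a ℕ.+ b) * qint q (suc b) + qfac q (a ℕ.+ suc b) * (q ^ suc b * qint q (suc a))
    ≡⟨ ≡.cong (λ k → qfac q (suc a ℕ.+ b) * qint q (suc b) + qfac q k * (q ^ suc b * qint q (suc a))) (ℕ.+-suc a b) ⟩
      qfac q (suc a ℕ.+ b) * qint q (suc b) + qfac q (suc a ℕ.+ b) * (q ^ suc b * qint q (suc a))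
    ≈⟨ distribˡ _ _ _ ⟨
      qfac q (suc a ℕ.+ b) * (qint q (suc b) + q ^ suc b * qint q (suc a))
    ≈⟨ *-congˡ (qint-+ q (suc b) (suc a)) ⟨
      qfac q (suc a ℕ.+ b) * qint q (suc b ℕ.+ suc a)
    ≡⟨ ≡.cong (λ k → qfac q (suc a ℕ.+ b) * qint q k) (≡.trans (ℕ.+-comm (suc b) (suc a)) (ℕ.+-suc (suc a) b)) ⟩
      qfac q (suc a ℕ.+ b) * qint q (suc (suc a ℕ.+ b))
    ≡⟨ ≡.cong (λ k → qfac q (suc k)) (ℕ.+-suc a b) ⟨
      qfac q (suc a ℕ.+ suc b)
    ∎
    where
    B₁ B₂ : Carrier
    B₁ = qbinom q (suc a) b
    B₂ = qbinom q a (suc b)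

  poch : Carrier → ℕ → Carrier
  poch q m = ∏[ i < m ] (1# - q ^ suc i)

  poch-cong : ∀ {q q′} → q ≈ q′ → ∀ m → poch q m ≈ poch q′ m
  poch-cong q≈q′ m = ∏-cong m (λ i _ → +-congˡ (-‿cong (^-congˡ (suc i) q≈q′)))

  private
    qint-geometric : ∀ q m → (1# - q) * qint q m ≈ 1# - q ^ m
    qint-geometric q zero    = solve 1 (λ q → (con (+ 1) :- q) :* con (+ 0) := con (+ 1) :- con (+ 1)) refl q
    qint-geometric q (suc m) = begin
        (1# - q) * (1# + q * qint q m)
      ≈⟨ solve 2 (λ q i → (con (+ 1) :- q) :* (con (+ 1) :+ q :* i) := con (+ 1) :- q :+ q :* ((con (+ 1) :- q) :* i))
           refl q (qint q m) ⟩
        1# - q + q * ((1# - q) * qint q m)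
      ≈⟨ +-congˡ (*-congˡ (qint-geometric q m)) ⟩
        1# - q + q * (1# - q ^ m)
      ≈⟨ solve 2 (λ q z → con (+ 1) :- q :+ q :* (con (+ 1) :- z) := con (+ 1) :- q :* z) refl q (q ^ m) ⟩
        1# - q ^ suc m
      ∎

    poch-qfac : ∀ q m → poch q m ≈ (1# - q) ^ m * qfac q m
    poch-qfac q m = trans (∏-cong m (λ i _ → sym (qint-geometric q (suc i))))
      (trans (∏-distrib-* m _ _) (*-congʳ (∏-const m (1# - q))))

  qbinom-poch : ∀ q a b → qbinom q a b * (poch q a * poch q b) ≈ poch q (a ℕ.+ b)
  qbinom-poch q a b = begin
      qbinom q a b * (poch q a * poch q b)
    ≈⟨ *-congˡ (*-cong (poch-qfac q a) (poch-qfac q b)) ⟩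
      qbinom q a b * ((1# - q) ^ a * qfac q a * ((1# - q) ^ b * qfac q b))
    ≈⟨ solve 5 (λ B pa fa pb fb → B :* (pa :* fa :* (pb :* fb)) := (pa :* pb) :* (B :* (fa :* fb))) refl
         (qbinom q a b) ((1# - q) ^ a) (qfac q a) ((1# - q) ^ b) (qfac q b) ⟩
      ((1# - q) ^ a * (1# - q) ^ b) * (qbinom q a b * (qfac q a * qfac q b))
    ≈⟨ *-cong (^-homo-* (1# - q) a b) (sym (qbinom-qfac q a b)) ⟨
      (1# - q) ^ (a ℕ.+ b) * qfac q (a ℕ.+ b)
    ≈⟨ poch-qfac q (a ℕ.+ b) ⟨
      poch q (a ℕ.+ b)
    ∎

  private
    differences-step : ∀ q s n k i →
      q ^ (s ℕ.* suc n ℕ.+ k) - q ^ (s ℕ.* suc i) ≈ q ^ s * (q ^ (s ℕ.* n ℕ.+ k) - q ^ (s ℕ.* i))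
    differences-step q s n k i = begin
        q ^ (s ℕ.* suc n ℕ.+ k) - q ^ (s ℕ.* suc i)
      ≡⟨ ≡.cong₂ (λ u v → q ^ u - q ^ v) (≡.trans (≡.cong (ℕ._+ k) (ℕ.*-suc s n)) (ℕ.+-assoc s (s ℕ.* n) k)) (ℕ.*-suc s i) ⟩
        q ^ (s ℕ.+ (s ℕ.* n ℕ.+ k)) - q ^ (s ℕ.+ s ℕ.* i)
      ≈⟨ +-cong (^-homo-* q s _) (-‿cong (^-homo-* q s _)) ⟩
        q ^ s * q ^ (s ℕ.* n ℕ.+ k) - q ^ s * q ^ (s ℕ.* i)
      ≈⟨ solve 3 (λ a b c → a :* b :- a :* c := a :* (b :- c)) refl (q ^ s) (q ^ (s ℕ.* n ℕ.+ k)) (q ^ (s ℕ.* i)) ⟩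
        q ^ s * (q ^ (s ℕ.* n ℕ.+ k) - q ^ (s ℕ.* i))
      ∎

    tri-power-step : ∀ q s n → q ^ (s ℕ.* tri (suc n)) * (q ^ s) ^ suc n ≈ q ^ (s ℕ.* tri (suc (suc n)))
    tri-power-step q s n = begin
        q ^ (s ℕ.* tri (suc n)) * (q ^ s) ^ suc n
      ≈⟨ *-congˡ (^-assocʳ q s (suc n)) ⟩
        q ^ (s ℕ.* tri (suc n)) * q ^ (s ℕ.* suc n)
      ≈⟨ ^-homo-* q (s ℕ.* tri (suc n)) (s ℕ.* suc n) ⟨
        q ^ (s ℕ.* tri (suc n) ℕ.+ s ℕ.* suc n)
      ≡⟨ ≡.cong (q ^_) (ℕ.*-distribˡ-+ s (tri (suc n)) (suc n)) ⟨
        q ^ (s ℕ.* tri (suc (suc n)))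
      ∎

  ∏-differences-of-powers : ∀ q s k n →
    ∏[ i < suc n ] (q ^ (s ℕ.* n ℕ.+ k) - q ^ (s ℕ.* i)) ≈
    (- 1#) ^ suc n * q ^ (s ℕ.* tri (suc n)) * ∏[ j < suc n ] (1# - q ^ (s ℕ.* j ℕ.+ k))
  ∏-differences-of-powers q s k zero = begin
      1# * (q ^ (s ℕ.* 0 ℕ.+ k) - q ^ (s ℕ.* 0))
    ≈⟨ *-congˡ (+-congˡ (-‿cong q^s0≈1)) ⟩
      1# * (q ^ (s ℕ.* 0 ℕ.+ k) - 1#)
    ≈⟨ solve 1 (λ x → con (+ 1) :* (x :- con (+ 1)) := :- con (+ 1) :* con (+ 1) :* con (+ 1) :* (con (+ 1) :* (con (+ 1) :- x)))
         refl (q ^ (s ℕ.* 0 ℕ.+ k)) ⟩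
      - 1# * 1# * 1# * (1# * (1# - q ^ (s ℕ.* 0 ℕ.+ k)))
    ≈⟨ *-congʳ (*-congˡ q^s0≈1) ⟨
      - 1# * 1# * q ^ (s ℕ.* 0) * (1# * (1# - q ^ (s ℕ.* 0 ℕ.+ k)))
    ∎
    where
    q^s0≈1 : q ^ (s ℕ.* 0) ≈ 1#
    q^s0≈1 = ^-congʳ q (ℕ.*-zeroʳ s)
  ∏-differences-of-powers q s k (suc n) = begin
      ∏[ i < suc (suc n) ] (X - q ^ (s ℕ.* i))
    ≈⟨ ∏-front (suc n) (λ i → X - q ^ (s ℕ.* i)) ⟩
      (X - q ^ (s ℕ.* 0)) * ∏[ i < suc n ] (X - q ^ (s ℕ.* suc i))
    ≈⟨ *-cong (+-congˡ (-‿cong (^-congʳ q (ℕ.*-zeroʳ s)))) (∏-cong (suc n) (λ i _ → differences-step q s n k i)) ⟩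
      (X - 1#) * ∏[ i < suc n ] (q ^ s * (q ^ (s ℕ.* n ℕ.+ k) - q ^ (s ℕ.* i)))
    ≈⟨ *-congˡ (trans (∏-distrib-* (suc n) (λ _ → q ^ s) _) (*-cong (∏-const (suc n) (q ^ s)) (∏-differences-of-powers q s k n))) ⟩
      (X - 1#) * ((q ^ s) ^ suc n * (σ * t * P))
    ≈⟨ solve 5 (λ X qs σ t P → (X :- con (+ 1)) :* (qs :* (σ :* t :* P)) := :- con (+ 1) :* σ :* (t :* qs) :* (P :* (con (+ 1) :- X)))
         refl X ((q ^ s) ^ suc n) σ t P ⟩
      - 1# * σ * (t * (q ^ s) ^ suc n) * (P * (1# - X))
    ≈⟨ *-congʳ (*-congˡ (tri-power-step q s n)) ⟩
      - 1# * σ * q ^ (s ℕ.* tri (suc (suc n))) * (P * (1# - X))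
    ∎
    where
    X σ t P : Carrier
    X = q ^ (s ℕ.* suc n ℕ.+ k)
    σ = (- 1#) ^ suc n
    t = q ^ (s ℕ.* tri (suc n))
    P = ∏[ j < suc n ] (1# - q ^ (s ℕ.* j ℕ.+ k))

  ∏-factor-power : ∀ q e m (g h : ℕ → ℕ) → (∀ j → g j ≡ e ℕ.+ h j) →
    ∏[ j < m ] (q ^ e - q ^ g j) ≈ (q ^ e) ^ m * ∏[ j < m ] (1# - q ^ h j)
  ∏-factor-power q e m g h g≡e+h = begin
      ∏[ j < m ] (q ^ e - q ^ g j)
    ≈⟨ ∏-cong m (λ j _ → +-congˡ (-‿cong (trans (^-congʳ q (g≡e+h j)) (^-homo-* q e (h j))))) ⟩
      ∏[ j < m ] (q ^ e - q ^ e * q ^ h j)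
    ≈⟨ ∏-cong m (λ j _ → solve 2 (λ a b → a :- a :* b := a :* (con (+ 1) :- b)) refl (q ^ e) (q ^ h j)) ⟩
      ∏[ j < m ] (q ^ e * (1# - q ^ h j))
    ≈⟨ ∏-distrib-* m _ _ ⟩
      ∏[ j < m ] (q ^ e) * ∏[ j < m ] (1# - q ^ h j)
    ≈⟨ *-congʳ (∏-const m (q ^ e)) ⟩
      (q ^ e) ^ m * ∏[ j < m ] (1# - q ^ h j)
    ∎

  poch-by-residue-mod-3 : ∀ q m →
    ∏[ j < m ] (1# - q ^ (3 ℕ.* j ℕ.+ 1)) * ∏[ j < m ] (1# - q ^ (3 ℕ.* j ℕ.+ 2)) * ∏[ j < m ] (1# - q ^ (3 ℕ.* j ℕ.+ 3))
    ≈ poch q (3 ℕ.* m)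
  poch-by-residue-mod-3 q zero    = solve 0 (con (+ 1) :* con (+ 1) :* con (+ 1) := con (+ 1)) refl
  poch-by-residue-mod-3 q (suc m) = begin
      P 1 * f 1 * (P 2 * f 2) * (P 3 * f 3)
    ≈⟨ solve 6 (λ a b c d e f → a :* b :* (c :* d) :* (e :* f) := a :* c :* e :* b :* d :* f) refl (P 1) (f 1) (P 2) (f 2) (P 3) (f 3) ⟩
      P 1 * P 2 * P 3 * f 1 * f 2 * f 3
    ≈⟨ *-congʳ (*-congʳ (*-congʳ (poch-by-residue-mod-3 q m))) ⟩
      poch q (3 ℕ.* m) * f 1 * f 2 * f 3
    ≡⟨ ≡.cong₂ (λ u v → poch q (3 ℕ.* m) * (1# - q ^ u) * (1# - q ^ v) * f 3) (ℕ.+-comm (3 ℕ.* m) 1) (ℕ.+-comm (3 ℕ.* m) 2) ⟩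
      poch q (3 ℕ.* m) * (1# - q ^ suc (3 ℕ.* m)) * (1# - q ^ suc (suc (3 ℕ.* m))) * f 3
    ≡⟨ ≡.cong (λ u → poch q (3 ℕ.* m) * (1# - q ^ suc (3 ℕ.* m)) * (1# - q ^ suc (suc (3 ℕ.* m))) * (1# - q ^ u)) (ℕ.+-comm (3 ℕ.* m) 3) ⟩
      poch q (3 ℕ.+ 3 ℕ.* m)
    ≡⟨ ≡.cong (poch q) (ℕ.*-suc 3 m) ⟨
      poch q (3 ℕ.* suc m)
    ∎
    where
    P : ℕ → Carrier
    P r = ∏[ j < m ] (1# - q ^ (3 ℕ.* j ℕ.+ r))
    f : ℕ → Carrier
    f r = 1# - q ^ (3 ℕ.* m ℕ.+ r)

module Derivative where
  open import Algebra using (CommutativeRing)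
  open import Algebra.Structures using (IsCommutativeRing)
  open import Data.Nat as ℕ using (ℕ; zero; suc)
  import Data.Nat.Properties as ℕ
  open import Data.Integer using (+_)
  open import Data.Product using (_×_; _,_; proj₁; proj₂)
  open import Relation.Binary.PropositionalEquality as ≡ using (_≡_)

  module DualNumbers {c ℓ} (R : CommutativeRing c ℓ) where
    open CommutativeRing R
    open IntegerCoefficients R

    infixr 4 _+ε_
    record Dual : Set c where
      constructor _+ε_
      field
        value deriv : Carrier
    open Dual public

    infix  4 _≈ᴰ_
    infixl 6 _+ᴰ_
    infixl 7 _*ᴰ_

    _≈ᴰ_ : Dual → Dual → Set ℓ
    x ≈ᴰ y = (value x ≈ value y) × (deriv x ≈ deriv y)

    _+ᴰ_ _*ᴰ_ : Dual → Dual → Dual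
    x +ᴰ y = value x + value y +ε deriv x + deriv y
    x *ᴰ y = value x * value y +ε value x * deriv y + deriv x * value y

    -ᴰ_ : Dual → Dual
    -ᴰ x = - value x +ε - deriv x

    dual-isCommutativeRing : IsCommutativeRing _≈ᴰ_ _+ᴰ_ _*ᴰ_ -ᴰ_ (0# +ε 0#) (1# +ε 0#)
    dual-isCommutativeRing = record
      { isRing = record
        { +-isAbelianGroup = record
          { isGroup = record
            { isMonoid = record
              { isSemigroup = record
                { isMagma = record
                  { isEquivalence = record
                    { refl  = refl , refl
                    ; sym   = λ (p , q) → sym p , sym q
                    ; trans = λ (p , q) (p′ , q′) → trans p p′ , trans q q′ }
                  ; ∙-cong = λ (p , q) (p′ , q′) → +-cong p p′ , +-cong q q′ }
                ; assoc = λ _ _ _ → +-assoc _ _ _ , +-assoc _ _ _ }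
              ; identity = (λ _ → +-identityˡ _ , +-identityˡ _) , (λ _ → +-identityʳ _ , +-identityʳ _) }
            ; inverse = (λ _ → -‿inverseˡ _ , -‿inverseˡ _) , (λ _ → -‿inverseʳ _ , -‿inverseʳ _)
            ; ⁻¹-cong = λ (p , q) → -‿cong p , -‿cong q }
          ; comm = λ _ _ → +-comm _ _ , +-comm _ _ }
        ; *-cong = λ (p , q) (p′ , q′) → *-cong p p′ , +-cong (*-cong p q′) (*-cong q p′)
        ; *-assoc = λ x y z → *-assoc _ _ _ ,
            solve 6 (λ a b c d e f → (a :* c) :* f :+ (a :* d :+ b :* c) :* e := a :* (c :* f :+ d :* e) :+ b :* (c :* e))
              refl (value x) (deriv x) (value y) (deriv y) (value z) (deriv z)
        ; *-identity =
            (λ x → *-identityˡ _ , solve 2 (λ a b → con (+ 1) :* b :+ con (+ 0) :* a := b) refl (value x) (deriv x)) ,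
            (λ x → *-identityʳ _ , solve 2 (λ a b → a :* con (+ 0) :+ b :* con (+ 1) := b) refl (value x) (deriv x))
        ; distrib =
            (λ x y z → distribˡ _ _ _ ,
               solve 6 (λ a b c d e f → a :* (d :+ f) :+ b :* (c :+ e) := (a :* d :+ b :* c) :+ (a :* f :+ b :* e))
                 refl (value x) (deriv x) (value y) (deriv y) (value z) (deriv z)) ,
            (λ x y z → distribʳ _ _ _ ,
               solve 6 (λ a b c d e f → (c :+ e) :* b :+ (d :+ f) :* a := (c :* b :+ d :* a) :+ (e :* b :+ f :* a))
                 refl (value x) (deriv x) (value y) (deriv y) (value z) (deriv z)) }
      ; *-comm = λ x y → *-comm _ _ ,
          solve 4 (λ a b c d → a :* d :+ b :* c := c :* b :+ d :* a) refl (value x) (deriv x) (value y) (deriv y) }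

    dualRing : CommutativeRing c ℓ
    dualRing = record { isCommutativeRing = dual-isCommutativeRing }

  module RotheDerivative {c ℓ} (R : CommutativeRing c ℓ) where
    open DualNumbers R
    open FiniteSums R
    open import Algebra.Properties.Semiring.Mult.TCOptimised semiring using (1+×)
    private
      module D = FiniteSums dualRing
    open import Relation.Binary.Reasoning.Setoid setoid

    const : Carrier → Dual
    const r = r +ε 0#

    value-∏ : ∀ n f → value (D.∏ n f) ≈ ∏[ i < n ] value (f i)
    value-∏ zero    f = refl
    value-∏ (suc n) f = *-congʳ (value-∏ n f)

    deriv-antidiag : ∀ n F → deriv (D.antidiag n F) ≈ antidiag n (λ a b → deriv (F a b))
    deriv-antidiag zero    F = refl
    deriv-antidiag (suc n) F = +-congˡ (deriv-antidiag n _)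

    const-^ : ∀ r n → D._^_ (const r) n ≈ᴰ const (r ^ n)
    const-^ r zero    = refl , refl
    const-^ r (suc n) = let (v , d) = const-^ r n in
      *-congˡ v , trans (+-cong (*-congˡ d) (*-congˡ v))
                    (solve 2 (λ r x → r :* con (+ 0) :+ con (+ 0) :* x := con (+ 0)) refl r (r ^ n))

    const-qbinom : ∀ q a b → D.qbinom (const q) a b ≈ᴰ const (qbinom q a b)
    const-qbinom q zero    b       = refl , refl
    const-qbinom q (suc a) zero    = refl , refl
    const-qbinom q (suc a) (suc b) =
      let (v₁ , d₁) = const-qbinom q (suc a) b ; (v₂ , d₂) = const-qbinom q a (suc b) ; (v₃ , d₃) = const-^ q (suc b) in
      +-cong v₁ (*-cong v₃ v₂) ,
      trans (+-cong d₁ (+-cong (*-cong v₃ d₂) (*-cong d₃ v₂)))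
        (solve 2 (λ u v → con (+ 0) :+ (u :* con (+ 0) :+ con (+ 0) :* v) := con (+ 0)) refl (q ^ suc b) (qbinom q a (suc b)))

    self-^ : ∀ r n → D._^_ (r +ε r) n ≈ᴰ (r ^ n +ε ⟦ + n ⟧ * r ^ n)
    self-^ r zero    = refl , sym (zeroˡ _)
    self-^ r (suc n) = let (v , d) = self-^ r n in
      *-congˡ v , trans (+-cong (*-congˡ d) (*-congˡ v))
        (trans (solve 3 (λ r x k → r :* (k :* x) :+ r :* x := (con (+ 1) :+ k) :* (r :* x)) refl r (r ^ n) ⟦ + n ⟧)
          (*-congʳ (sym (1+× n 1#))))

    rothe-deriv : ∀ q r y n →
      deriv (D.∏[ i < n ] ((r +ε r) D.+ const y D.* D._^_ (const q) i)) ≈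
      antidiag n (λ a b → qbinom q a b * q ^ tri a * y ^ a * (⟦ + b ⟧ * r ^ b))
    rothe-deriv q r y n = begin
        deriv (D.∏[ i < n ] ((r +ε r) D.+ const y D.* D._^_ (const q) i))
      ≈⟨ proj₂ (D.rothe (const q) (r +ε r) (const y) n) ⟩
        deriv (D.antidiag n (D.rothe-term (const q) (r +ε r) (const y)))
      ≈⟨ deriv-antidiag n _ ⟩
        antidiag n (λ a b → deriv (D.rothe-term (const q) (r +ε r) (const y) a b))
      ≈⟨ antidiag-cong n (λ a b _ → term a b) ⟩
        antidiag n (λ a b → qbinom q a b * q ^ tri a * y ^ a * (⟦ + b ⟧ * r ^ b))
      ∎
      where
      term : ∀ a b → deriv (D.rothe-term (const q) (r +ε r) (const y) a b) ≈
                     qbinom q a b * q ^ tri a * y ^ a * (⟦ + b ⟧ * r ^ b)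
      term a b =
        let (B₁ , B₂) = const-qbinom q a b ; (Q₁ , Q₂) = const-^ q (tri a)
            (Y₁ , Y₂) = const-^ y a ; (X₁ , X₂) = self-^ r b in
        trans (+-cong (*-cong (*-cong (*-cong B₁ Q₁) Y₁) X₂)
                      (*-cong (+-cong (*-cong (*-cong B₁ Q₁) Y₂) (*-cong (+-cong (*-cong B₁ Q₂) (*-cong B₂ Q₁)) Y₁)) X₁))
          (solve 5 (λ u v w k s → u :* v :* w :* (k :* s) :+ (u :* v :* con (+ 0) :+ (u :* con (+ 0) :+ con (+ 0) :* v) :* w) :* s
                     := u :* v :* w :* (k :* s)) refl (qbinom q a b) (q ^ tri a) (y ^ a) ⟦ + b ⟧ (r ^ b))

    private
      deriv-∏-vanishing : ∀ m k f → value (f m) ≈ 0# →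
        deriv (D.∏ (m ℕ.+ suc k) f) ≈ ∏[ i < m ] value (f i) * (deriv (f m) * ∏[ i < k ] value (f (m ℕ.+ suc i)))
      deriv-∏-vanishing m k f fm≈0 = begin
          deriv (D.∏ (m ℕ.+ suc k) f)
        ≈⟨ proj₂ (D.∏-split m (suc k) f) ⟩
          deriv (X D.* D.∏[ i < suc k ] f (m ℕ.+ i))
        ≈⟨ proj₂ (D.*-congˡ {X} (D.∏-front k (λ i → f (m ℕ.+ i)))) ⟩
          deriv (X D.* (f (m ℕ.+ 0) D.* W))
        ≈⟨ +-cong (*-congˡ (+-congʳ (*-congʳ f₀≈0))) (*-congˡ (*-congʳ f₀≈0)) ⟩
          value X * (0# * deriv W + deriv (f (m ℕ.+ 0)) * value W) + deriv X * (0# * value W)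
        ≈⟨ solve 5 (λ x w e v x′ → x :* (con (+ 0) :* w :+ e :* v) :+ x′ :* (con (+ 0) :* v) := x :* (e :* v))
             refl (value X) (deriv W) (deriv (f (m ℕ.+ 0))) (value W) (deriv X) ⟩
          value X * (deriv (f (m ℕ.+ 0)) * value W)
        ≈⟨ *-cong (value-∏ m f) (*-cong (reflexive (≡.cong (λ j → deriv (f j)) (ℕ.+-identityʳ m))) (value-∏ k _)) ⟩
          ∏[ i < m ] value (f i) * (deriv (f m) * ∏[ i < k ] value (f (m ℕ.+ suc i)))
        ∎
        where
        X W : Dual
        X = D.∏ m f
        W = D.∏[ i < k ] f (m ℕ.+ suc i)
        f₀≈0 : value (f (m ℕ.+ 0)) ≈ 0#
        f₀≈0 = trans (reflexive (≡.cong (λ j → value (f j)) (ℕ.+-identityʳ m))) fm≈0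

    -- At x = r + εr the ε-part of Rothe's identity is r·∂ₓ of both sides at x = r; on the left only the
    -- derivative of the vanishing factor i = L survives.
    rothe-at-root : ∀ q r y L → r + y * q ^ L ≈ 0# →
      ∏[ i < L ] (r + y * q ^ i) * (r * ∏[ i < L ] (r + y * q ^ (L ℕ.+ suc i)))
      ≈ antidiag (L ℕ.+ suc L) (λ a b → qbinom q a b * q ^ tri a * y ^ a * (⟦ + b ⟧ * r ^ b))
    rothe-at-root q r y L root = begin
        ∏[ i < L ] (r + y * q ^ i) * (r * ∏[ i < L ] (r + y * q ^ (L ℕ.+ suc i)))
      ≈⟨ *-cong (∏-cong L (λ i _ → value-f i)) (*-cong (deriv-f L) (∏-cong L (λ i _ → value-f (L ℕ.+ suc i)))) ⟨
        ∏[ i < L ] value (f i) * (deriv (f L) * ∏[ i < L ] value (f (L ℕ.+ suc i)))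
      ≈⟨ deriv-∏-vanishing L L f (trans (value-f L) root) ⟨
        deriv (D.∏ (L ℕ.+ suc L) f)
      ≈⟨ rothe-deriv q r y (L ℕ.+ suc L) ⟩
        antidiag (L ℕ.+ suc L) (λ a b → qbinom q a b * q ^ tri a * y ^ a * (⟦ + b ⟧ * r ^ b))
      ∎
      where
      f : ℕ → Dual
      f i = (r +ε r) D.+ const y D.* D._^_ (const q) i
      value-f : ∀ i → value (f i) ≈ r + y * q ^ i
      value-f i = +-congˡ (*-congˡ (proj₁ (const-^ q i)))
      deriv-f : ∀ i → deriv (f i) ≈ r
      deriv-f i = let (v , d) = const-^ q i in
        trans (+-congˡ (+-cong (*-congˡ d) (*-congˡ v)))
          (solve 3 (λ r y u → r :+ (y :* con (+ 0) :+ con (+ 0) :* u) := r) refl r y (q ^ i))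

module Exponents where
  open import Data.Nat
  open import Data.Nat.Properties
  open import Data.Nat.Tactic.RingSolver using (solve-∀)
  open import Data.Product using (Σ; _,_; _×_)
  open import Data.Sum using (_⊎_; inj₁; inj₂)
  open import Data.Empty using (⊥-elim)
  open import Relation.Binary using (tri<; tri≈; tri>)
  open import Relation.Binary.PropositionalEquality
  open import Relation.Nullary using (yes; no)

  2*tri+n≡n*n : ∀ n → 2 * tri n + n ≡ n * n
  2*tri+n≡n*n zero    = refl
  2*tri+n≡n*n (suc n) = begin
    2 * (tri n + n) + suc n        ≡⟨ lemma₁ (tri n) n ⟩
    (2 * tri n + n) + (2 * n + 1)  ≡⟨ cong (_+ (2 * n + 1)) (2*tri+n≡n*n n) ⟩
    n * n + (2 * n + 1)            ≡⟨ lemma₂ n ⟩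
    suc n * suc n                  ∎
    where
    open ≡-Reasoning
    lemma₁ : ∀ t n → 2 * (t + n) + suc n ≡ (2 * t + n) + (2 * n + 1)
    lemma₁ = solve-∀
    lemma₂ : ∀ n → n * n + (2 * n + 1) ≡ suc n * suc n
    lemma₂ = solve-∀

  tri-+ : ∀ m n → tri (m + n) ≡ tri m + tri n + m * n
  tri-+ m zero = begin
    tri (m + 0)            ≡⟨ cong tri (+-identityʳ m) ⟩
    tri m                  ≡⟨ lemma m (tri m) ⟩
    tri m + 0 + m * 0      ∎
    where
    open ≡-Reasoning
    lemma : ∀ m t → t ≡ t + 0 + m * 0
    lemma = solve-∀
  tri-+ m (suc n) = begin
    tri (m + suc n)                  ≡⟨ cong tri (+-suc m n) ⟩
    tri (m + n) + (m + n)            ≡⟨ cong (_+ (m + n)) (tri-+ m n) ⟩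
    tri m + tri n + m * n + (m + n)  ≡⟨ lemma m n (tri m) (tri n) ⟩
    tri m + (tri n + n) + m * suc n  ∎
    where
    open ≡-Reasoning
    lemma : ∀ m n tm tn → tm + tn + m * n + (m + n) ≡ tm + (tn + n) + m * suc n
    lemma = solve-∀

  8*tri+1≡odd² : ∀ k → 8 * tri (suc k) + 1 ≡ suc (2 * k) * suc (2 * k)
  8*tri+1≡odd² k = begin
    8 * (tri k + k) + 1                  ≡⟨ lemma₁ k (tri k) ⟩
    4 * (2 * tri k + k) + (4 * k + 1)    ≡⟨ cong (λ z → 4 * z + (4 * k + 1)) (2*tri+n≡n*n k) ⟩
    4 * (k * k) + (4 * k + 1)            ≡⟨ lemma₂ k ⟩
    suc (2 * k) * suc (2 * k)            ∎
    where
    open ≡-Reasoning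
    lemma₁ : ∀ k t → 8 * (t + k) + 1 ≡ 4 * (2 * t + k) + (4 * k + 1)
    lemma₁ = solve-∀
    lemma₂ : ∀ k → 4 * (k * k) + (4 * k + 1) ≡ suc (2 * k) * suc (2 * k)
    lemma₂ = solve-∀

  jacobi-exponent : ℕ → ℕ → ℕ → ℕ
  jacobi-exponent L a b = tri a + L * b

  jacobi-offset : ℕ → ℕ
  jacobi-offset L = tri L + (L + L * L)

  euler-step : ℕ → ℕ
  euler-step L = suc (suc (3 * L))

  euler-exponent : ℕ → ℕ → ℕ → ℕ
  euler-exponent L a b = 3 * tri a + euler-step L * b

  euler-offset : ℕ → ℕ
  euler-offset L = 3 * tri (suc L) + euler-step L * suc L

  private
    open ≡-Reasoning

    jacobi-exponent-short : ∀ a k → jacobi-exponent (a + k) a (suc (a + k + k)) ≡ jacobi-offset (a + k) + tri (suc k)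
    jacobi-exponent-short a k = sym (begin
      tri (a + k) + ((a + k) + (a + k) * (a + k)) + (tri k + k)
        ≡⟨ cong (λ z → z + ((a + k) + (a + k) * (a + k)) + (tri k + k)) (tri-+ a k) ⟩
      tri a + tri k + a * k + ((a + k) + (a + k) * (a + k)) + (tri k + k)
        ≡⟨ lemma₁ a k (tri a) (tri k) ⟩
      tri a + (2 * tri k + k) + (a * k + (a + k) + (a + k) * (a + k))
        ≡⟨ cong (λ z → tri a + z + (a * k + (a + k) + (a + k) * (a + k))) (2*tri+n≡n*n k) ⟩
      tri a + k * k + (a * k + (a + k) + (a + k) * (a + k))
        ≡⟨ lemma₂ a k (tri a) ⟩
      tri a + (a + k) * suc (a + k + k) ∎)
      where
      lemma₁ : ∀ a k ta tk → ta + tk + a * k + ((a + k) + (a + k) * (a + k)) + (tk + k)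
                           ≡ ta + (2 * tk + k) + (a * k + (a + k) + (a + k) * (a + k))
      lemma₁ = solve-∀
      lemma₂ : ∀ a k ta → ta + k * k + (a * k + (a + k) + (a + k) * (a + k)) ≡ ta + (a + k) * suc (a + k + k)
      lemma₂ = solve-∀

    jacobi-exponent-long : ∀ b k → jacobi-exponent (b + k) (suc (b + k + k)) b ≡ jacobi-offset (b + k) + tri (suc k)
    jacobi-exponent-long b k = begin
      tri (suc (b + k + k)) + (b + k) * b
        ≡⟨ cong (λ z → tri z + (b + k) * b) (lemma₁ b k) ⟩
      tri (b + (k + suc k)) + (b + k) * b
        ≡⟨ cong (_+ (b + k) * b) (tri-+ b (k + suc k)) ⟩
      tri b + tri (k + suc k) + b * (k + suc k) + (b + k) * b
        ≡⟨ cong (λ z → tri b + z + b * (k + suc k) + (b + k) * b) (tri-+ k (suc k)) ⟩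
      tri b + (tri k + (tri k + k) + k * suc k) + b * (k + suc k) + (b + k) * b
        ≡⟨ lemma₂ b k (tri b) (tri k) ⟩
      tri b + tri k + b * k + ((b + k) + (b + k) * (b + k)) + (tri k + k)
        ≡⟨ cong (λ z → z + ((b + k) + (b + k) * (b + k)) + (tri k + k)) (tri-+ b k) ⟨
      tri (b + k) + ((b + k) + (b + k) * (b + k)) + (tri k + k) ∎
      where
      lemma₁ : ∀ b k → suc (b + k + k) ≡ b + (k + suc k)
      lemma₁ = solve-∀
      lemma₂ : ∀ b k tb tk → tb + (tk + (tk + k) + k * suc k) + b * (k + suc k) + (b + k) * b
                           ≡ tb + tk + b * k + ((b + k) + (b + k) * (b + k)) + (tk + k)
      lemma₂ = solve-∀

    euler-exponent-long : ∀ b k → euler-exponent (b + k) (suc (suc (b + k + k))) b ≡ euler-offset (b + k) + (3 * tri (suc k) + suc k)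
    euler-exponent-long b k = begin
      3 * tri (suc (suc (b + k + k))) + euler-step (b + k) * b
        ≡⟨ cong (λ z → 3 * tri z + euler-step (b + k) * b) (lemma₁ b k) ⟩
      3 * tri (suc b + suc k + k) + euler-step (b + k) * b
        ≡⟨ cong (λ z → 3 * z + euler-step (b + k) * b) (tri-+ (suc b + suc k) k) ⟩
      3 * (tri (suc b + suc k) + tri k + (suc b + suc k) * k) + euler-step (b + k) * b
        ≡⟨ cong (λ z → 3 * (z + tri k + (suc b + suc k) * k) + euler-step (b + k) * b) (tri-+ (suc b) (suc k)) ⟩
      3 * ((tri b + b) + (tri k + k) + suc b * suc k + tri k + (suc b + suc k) * k) + euler-step (b + k) * b
        ≡⟨ lemma₂ b k (tri b) (tri k) ⟩
      3 * ((tri b + b) + tri k + suc b * k) + euler-step (b + k) * suc (b + k) + (3 * (tri k + k) + suc k)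
        ≡⟨ cong (λ z → 3 * z + euler-step (b + k) * suc (b + k) + (3 * (tri k + k) + suc k)) (tri-+ (suc b) k) ⟨
      3 * tri (suc b + k) + euler-step (b + k) * suc (b + k) + (3 * (tri k + k) + suc k) ∎
      where
      lemma₁ : ∀ b k → suc (suc (b + k + k)) ≡ suc b + suc k + k
      lemma₁ = solve-∀
      lemma₂ : ∀ b k tb tk → 3 * ((tb + b) + (tk + k) + suc b * suc k + tk + (suc b + suc k) * k) + suc (suc (3 * (b + k))) * b
                           ≡ 3 * ((tb + b) + tk + suc b * k) + suc (suc (3 * (b + k))) * suc (b + k) + (3 * (tk + k) + suc k)
      lemma₂ = solve-∀

    euler-exponent-short : ∀ a k → euler-exponent (a + k) a (suc (suc (a + k + k))) ≡ euler-offset (a + k) + (3 * tri (suc k) + 2 * suc k)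
    euler-exponent-short a k = sym (begin
      3 * tri (suc a + k) + euler-step (a + k) * suc (a + k) + (3 * (tri k + k) + 2 * suc k)
        ≡⟨ cong (λ z → 3 * z + euler-step (a + k) * suc (a + k) + (3 * (tri k + k) + 2 * suc k)) (tri-+ (suc a) k) ⟩
      3 * ((tri a + a) + tri k + suc a * k) + euler-step (a + k) * suc (a + k) + (3 * (tri k + k) + 2 * suc k)
        ≡⟨ lemma₁ a k (tri a) (tri k) ⟩
      3 * tri a + 3 * (2 * tri k + k) + rest a k
        ≡⟨ cong (λ z → 3 * tri a + 3 * z + rest a k) (2*tri+n≡n*n k) ⟩
      3 * tri a + 3 * (k * k) + rest a k
        ≡⟨ lemma₂ a k (tri a) ⟩
      3 * tri a + euler-step (a + k) * suc (suc (a + k + k)) ∎)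
      where
      rest : ℕ → ℕ → ℕ
      rest a k = 3 * a + 3 * suc a * k + suc (suc (3 * (a + k))) * suc (a + k) + 2 * suc k
      lemma₁ : ∀ a k ta tk → 3 * ((ta + a) + tk + suc a * k) + suc (suc (3 * (a + k))) * suc (a + k) + (3 * (tk + k) + 2 * suc k)
                           ≡ 3 * ta + 3 * (2 * tk + k) + (3 * a + 3 * suc a * k + suc (suc (3 * (a + k))) * suc (a + k) + 2 * suc k)
      lemma₁ = solve-∀
      lemma₂ : ∀ a k ta → 3 * ta + 3 * (k * k) + (3 * a + 3 * suc a * k + suc (suc (3 * (a + k))) * suc (a + k) + 2 * suc k)
                        ≡ 3 * ta + suc (suc (3 * (a + k))) * suc (suc (a + k + k))
      lemma₂ = solve-∀

  private
    half-bound : ∀ {x k L K} → x + k ≡ L → x < K → K + K ≤ L → K ≤ k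
    half-bound {x} {k} {L} {K} x+k≡L x<K 2K≤L with K ≤? k
    ... | yes K≤k = K≤k
    ... | no  K≰k = ⊥-elim (<-irrefl refl (≤-trans (subst (_< K + K) x+k≡L (+-mono-< x<K (≰⇒> K≰k))) 2K≤L))

    beyond-half : ∀ {b K L} {A : Set} → b < K → K + K ≤ L → L < b → A
    beyond-half {b} {K} b<K 2K≤L L<b = ⊥-elim (<-irrefl refl (<-trans b<K (≤-<-trans (≤-trans (m≤m+n K K) 2K≤L) L<b)))

    odd-gap : ∀ a k → suc (a + k + k) ≡ a + suc (2 * k)
    odd-gap = solve-∀

    split-odd-sum : ∀ L a b → a + b ≡ L + suc L →
      (Σ ℕ λ k → a + k ≡ L × b ≡ suc (a + k + k)) ⊎ (Σ ℕ λ k → b + k ≡ L × a ≡ suc (b + k + k))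
    split-odd-sum L a b a+b≡ with a ≤? L
    ... | yes a≤L = inj₁ (L ∸ a , m+[n∸m]≡n a≤L , +-cancelˡ-≡ a b _ (trans a+b≡ (sym lemma)))
      where
      lemma : a + suc (a + (L ∸ a) + (L ∸ a)) ≡ L + suc L
      lemma = begin
        a + suc (a + (L ∸ a) + (L ∸ a))  ≡⟨ cong (λ z → a + suc (z + (L ∸ a))) (m+[n∸m]≡n a≤L) ⟩
        a + suc (L + (L ∸ a))            ≡⟨ shuffle a L (L ∸ a) ⟩
        L + suc (a + (L ∸ a))            ≡⟨ cong (λ z → L + suc z) (m+[n∸m]≡n a≤L) ⟩
        L + suc L                        ∎
        where
        shuffle : ∀ a L d → a + suc (L + d) ≡ L + suc (a + d)
        shuffle = solve-∀
    ... | no a≰L = inj₂ (k , b+k≡L , a≡)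
      where
      k : ℕ
      k = a ∸ suc L
      L+k≡a : suc L + k ≡ a
      L+k≡a = m+[n∸m]≡n (≰⇒> a≰L)
      shuffle : ∀ L k b → suc L + k + b ≡ suc L + (b + k)
      shuffle = solve-∀
      b+k≡L : b + k ≡ L
      b+k≡L = +-cancelˡ-≡ (suc L) (b + k) L (trans (sym (shuffle L k b)) (trans (cong (_+ b) L+k≡a) (trans a+b≡ (+-comm L (suc L)))))
      a≡ : a ≡ suc (b + k + k)
      a≡ = trans (sym L+k≡a) (cong (λ z → suc (z + k)) (sym b+k≡L))

    split-even-sum : ∀ L a b → a + b ≡ suc L + suc L →
      (a ≡ suc L × b ≡ suc L) ⊎ ((Σ ℕ λ k → b + k ≡ L × a ≡ suc (suc (b + k + k)))
                               ⊎ (Σ ℕ λ k → a + k ≡ L × b ≡ suc (suc (a + k + k))))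
    split-even-sum L a b a+b≡ with <-cmp a (suc L)
    ... | tri≈ _ a≡ _ = inj₁ (a≡ , +-cancelˡ-≡ a b (suc L) (trans a+b≡ (cong (_+ suc L) (sym a≡))))
    ... | tri< a< _ _ = inj₂ (inj₂ (k , a+k≡L , b≡))
      where
      k : ℕ
      k = L ∸ a
      a+k≡L : a + k ≡ L
      a+k≡L = m+[n∸m]≡n (≤-pred a<)
      shuffle : ∀ a k → a + suc (suc (a + k + k)) ≡ suc (a + k) + suc (a + k)
      shuffle = solve-∀
      b≡ : b ≡ suc (suc (a + k + k))
      b≡ = +-cancelˡ-≡ a b _ (trans a+b≡ (trans (cong (λ z → suc z + suc z) (sym a+k≡L)) (sym (shuffle a k))))
    ... | tri> _ _ a> = inj₂ (inj₁ (k , b+k≡L , a≡))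
      where
      k : ℕ
      k = a ∸ suc (suc L)
      L+k≡a : suc (suc L) + k ≡ a
      L+k≡a = m+[n∸m]≡n a>
      shuffle : ∀ L k b → suc (suc L) + k + b ≡ suc L + suc (b + k)
      shuffle = solve-∀
      b+k≡L : b + k ≡ L
      b+k≡L = suc-injective (+-cancelˡ-≡ (suc L) (suc (b + k)) (suc L) (trans (sym (shuffle L k b)) (trans (cong (_+ b) L+k≡a) a+b≡)))
      a≡ : a ≡ suc (suc (b + k + k))
      a≡ = trans (sym L+k≡a) (cong (λ z → suc (suc (z + k))) (sym b+k≡L))

  record JacobiTerm (L a b : ℕ) : Set where
    field
      k             : ℕ
      exponent      : jacobi-exponent L a b ≡ jacobi-offset L + tri (suc k)
      exponent-swap : jacobi-exponent L b a ≡ jacobi-offset L + tri (suc k)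
      far           : ∀ K → K + K ≤ L → a < K ⊎ b < K → K ≤ k
      gap           : b ≡ a + suc (2 * k) ⊎ a ≡ b + suc (2 * k)

  jacobiTerm : ∀ L a b → a + b ≡ L + suc L → JacobiTerm L a b
  jacobiTerm L a b a+b≡ with split-odd-sum L a b a+b≡
  ... | inj₁ (k , a+k≡L , refl) = record
    { k = k
    ; exponent = subst (λ L → jacobi-exponent L a (suc (a + k + k)) ≡ jacobi-offset L + tri (suc k)) a+k≡L (jacobi-exponent-short a k)
    ; exponent-swap = subst (λ L → jacobi-exponent L (suc (a + k + k)) a ≡ jacobi-offset L + tri (suc k)) a+k≡L (jacobi-exponent-long a k)
    ; far = λ where
        K 2K≤L (inj₁ a<K) → half-bound a+k≡L a<K 2K≤L
        K 2K≤L (inj₂ b<K) → beyond-half b<K 2K≤L (subst (λ L → L < suc (a + k + k)) a+k≡L (s≤s (m≤m+n (a + k) k)))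
    ; gap = inj₁ (odd-gap a k) }
  ... | inj₂ (k , b+k≡L , refl) = record
    { k = k
    ; exponent = subst (λ L → jacobi-exponent L (suc (b + k + k)) b ≡ jacobi-offset L + tri (suc k)) b+k≡L (jacobi-exponent-long b k)
    ; exponent-swap = subst (λ L → jacobi-exponent L b (suc (b + k + k)) ≡ jacobi-offset L + tri (suc k)) b+k≡L (jacobi-exponent-short b k)
    ; far = λ where
        K 2K≤L (inj₂ b<K) → half-bound b+k≡L b<K 2K≤L
        K 2K≤L (inj₁ a<K) → beyond-half a<K 2K≤L (subst (λ L → L < suc (b + k + k)) b+k≡L (s≤s (m≤m+n (b + k) k)))
    ; gap = inj₂ (odd-gap b k) }

  private
    pentagonal-square₁ : ∀ k → 24 * (3 * tri (suc k) + suc k) + 1 ≡ (5 + 6 * k) * (5 + 6 * k)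
    pentagonal-square₁ k = begin
      24 * (3 * (tri k + k) + suc k) + 1   ≡⟨ lemma₁ k (tri k) ⟩
      36 * (2 * tri k + k) + (60 * k + 25) ≡⟨ cong (λ z → 36 * z + (60 * k + 25)) (2*tri+n≡n*n k) ⟩
      36 * (k * k) + (60 * k + 25)         ≡⟨ lemma₂ k ⟩
      (5 + 6 * k) * (5 + 6 * k)            ∎
      where
      lemma₁ : ∀ k t → 24 * (3 * (t + k) + suc k) + 1 ≡ 36 * (2 * t + k) + (60 * k + 25)
      lemma₁ = solve-∀
      lemma₂ : ∀ k → 36 * (k * k) + (60 * k + 25) ≡ (5 + 6 * k) * (5 + 6 * k)
      lemma₂ = solve-∀

    pentagonal-square₂ : ∀ k → 24 * (3 * tri (suc k) + 2 * suc k) + 1 ≡ (7 + 6 * k) * (7 + 6 * k)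
    pentagonal-square₂ k = begin
      24 * (3 * (tri k + k) + 2 * suc k) + 1 ≡⟨ lemma₁ k (tri k) ⟩
      36 * (2 * tri k + k) + (84 * k + 49)   ≡⟨ cong (λ z → 36 * z + (84 * k + 49)) (2*tri+n≡n*n k) ⟩
      36 * (k * k) + (84 * k + 49)           ≡⟨ lemma₂ k ⟩
      (7 + 6 * k) * (7 + 6 * k)              ∎
      where
      lemma₁ : ∀ k t → 24 * (3 * (t + k) + 2 * suc k) + 1 ≡ 36 * (2 * t + k) + (84 * k + 49)
      lemma₁ = solve-∀
      lemma₂ : ∀ k → 36 * (k * k) + (84 * k + 49) ≡ (7 + 6 * k) * (7 + 6 * k)
      lemma₂ = solve-∀

  record EulerTerm (L a b : ℕ) : Set where
    field
      s X        : ℕ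
      exponent   : euler-exponent L a b ≡ euler-offset L + s
      far        : ∀ K → K + K ≤ L → a < K ⊎ b < K → K ≤ s
      pentagonal : 24 * s + 1 ≡ X * X

  eulerTerm : ∀ L a b → a + b ≡ suc L + suc L → EulerTerm L a b
  eulerTerm L a b a+b≡ with split-even-sum L a b a+b≡
  ... | inj₁ (refl , refl) = record
    { s = 0 ; X = 1 ; exponent = sym (+-identityʳ _)
    ; far = λ where
        K 2K≤L (inj₁ a<K) → beyond-half a<K 2K≤L (n<1+n L)
        K 2K≤L (inj₂ b<K) → beyond-half b<K 2K≤L (n<1+n L)
    ; pentagonal = refl }
  ... | inj₂ (inj₁ (k , b+k≡L , refl)) = record
    { s = 3 * tri (suc k) + suc k ; X = 5 + 6 * k
    ; exponent = subst (λ L → euler-exponent L (suc (suc (b + k + k))) b ≡ euler-offset L + (3 * tri (suc k) + suc k))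
                 b+k≡L (euler-exponent-long b k)
    ; far = λ where
        K 2K≤L (inj₂ b<K) → ≤-trans (≤-trans (half-bound b+k≡L b<K 2K≤L) (n≤1+n k)) (m≤n+m (suc k) _)
        K 2K≤L (inj₁ a<K) → beyond-half a<K 2K≤L
          (subst (λ L → L < suc (suc (b + k + k))) b+k≡L (s≤s (≤-trans (m≤m+n (b + k) k) (n≤1+n _))))
    ; pentagonal = pentagonal-square₁ k }
  ... | inj₂ (inj₂ (k , a+k≡L , refl)) = record
    { s = 3 * tri (suc k) + 2 * suc k ; X = 7 + 6 * k
    ; exponent = subst (λ L → euler-exponent L a (suc (suc (a + k + k))) ≡ euler-offset L + (3 * tri (suc k) + 2 * suc k))
                 a+k≡L (euler-exponent-short a k)
    ; far = λ where
        K 2K≤L (inj₁ a<K) → ≤-trans (≤-trans (half-bound a+k≡L a<K 2K≤L) (n≤1+n k))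
                                    (≤-trans (m≤m+n (suc k) _) (m≤n+m _ (3 * tri (suc k))))
        K 2K≤L (inj₂ b<K) → beyond-half b<K 2K≤L
          (subst (λ L → L < suc (suc (a + k + k))) a+k≡L (s≤s (≤-trans (m≤m+n (a + k) k) (n≤1+n _))))
    ; pentagonal = pentagonal-square₂ k }

module FiniteJacobiEuler {c ℓ} (R : CommutativeRing c ℓ) where
  open import Data.Nat as ℕ using (ℕ; suc)
  import Data.Nat.Properties as ℕ
  open import Data.Nat.Tactic.RingSolver using (solve-∀)
  open import Data.Integer using (+_)
  open import Relation.Binary.PropositionalEquality as ≡ using (_≡_)
  open Derivative
  open Exponents
  open FiniteSums R
  open RotheDerivative R using (rothe-at-root)
  open import Relation.Binary.Reasoning.Setoid setoid

  private
    x+-y≈x-y : ∀ x y → x + - 1# * y ≈ x - y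
    x+-y≈x-y = solve 2 (λ x y → x :+ :- con (+ 1) :* y := x :- y) refl

    jacobi-lower-half : ∀ Q L′ → let L = suc L′ in
      ∏[ i < L ] (Q ^ L + - 1# * Q ^ i) ≈ (- 1#) ^ L * Q ^ tri L * poch Q L
    jacobi-lower-half Q L′ = begin
        ∏[ i < suc L′ ] (Q ^ suc L′ + - 1# * Q ^ i)
      ≈⟨ ∏-cong (suc L′) (λ i _ → trans (x+-y≈x-y _ _)
           (+-cong (^-congʳ Q (≡.sym (one-step L′))) (-‿cong (^-congʳ Q (≡.sym (ℕ.*-identityˡ i)))))) ⟩
        ∏[ i < suc L′ ] (Q ^ (1 ℕ.* L′ ℕ.+ 1) - Q ^ (1 ℕ.* i))
      ≈⟨ ∏-differences-of-powers Q 1 1 L′ ⟩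
        (- 1#) ^ suc L′ * Q ^ (1 ℕ.* tri (suc L′)) * ∏[ j < suc L′ ] (1# - Q ^ (1 ℕ.* j ℕ.+ 1))
      ≈⟨ *-cong (*-congˡ (^-congʳ Q (ℕ.*-identityˡ (tri (suc L′)))))
                (∏-cong (suc L′) (λ j _ → +-congˡ (-‿cong (^-congʳ Q (one-step j))))) ⟩
        (- 1#) ^ suc L′ * Q ^ tri (suc L′) * poch Q (suc L′)
      ∎
      where
      one-step : ∀ n → 1 ℕ.* n ℕ.+ 1 ≡ suc n
      one-step = solve-∀

    jacobi-upper-half : ∀ Q L → ∏[ i < L ] (Q ^ L + - 1# * Q ^ (L ℕ.+ suc i)) ≈ Q ^ (L ℕ.* L) * poch Q L
    jacobi-upper-half Q L = begin
        ∏[ i < L ] (Q ^ L + - 1# * Q ^ (L ℕ.+ suc i))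
      ≈⟨ ∏-cong L (λ i _ → x+-y≈x-y _ _) ⟩
        ∏[ i < L ] (Q ^ L - Q ^ (L ℕ.+ suc i))
      ≈⟨ ∏-factor-power Q L L (λ i → L ℕ.+ suc i) suc (λ _ → ≡.refl) ⟩
        (Q ^ L) ^ L * poch Q L
      ≈⟨ *-congʳ (^-assocʳ Q L L) ⟩
        Q ^ (L ℕ.* L) * poch Q L
      ∎

  jacobi-finite : ∀ Q L′ → let L = suc L′ ; P = poch Q L in
    (- 1#) ^ L * Q ^ jacobi-offset L * (P * P * P) ≈
    antidiag (L ℕ.+ suc L) (λ a b → (P * qbinom Q a b) * (((- 1#) ^ a * ⟦ + b ⟧) * Q ^ jacobi-exponent L a b))
  jacobi-finite Q L′ = begin
      σ * Q ^ jacobi-offset L * (P * P * P)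
    ≈⟨ *-congʳ (*-congˡ (trans (^-homo-* Q (tri L) (L ℕ.+ L ℕ.* L)) (*-congˡ (^-homo-* Q L (L ℕ.* L))))) ⟩
      σ * (Q ^ tri L * (Q ^ L * Q ^ (L ℕ.* L))) * (P * P * P)
    ≈⟨ solve 5 (λ p s a b c → s :* (a :* (b :* c)) :* (p :* p :* p) := p :* (s :* a :* p :* (b :* (c :* p)))) refl
         P σ (Q ^ tri L) (Q ^ L) (Q ^ (L ℕ.* L)) ⟩
      P * (σ * Q ^ tri L * P * (Q ^ L * (Q ^ (L ℕ.* L) * P)))
    ≈⟨ *-congˡ (*-cong (jacobi-lower-half Q L′) (*-congˡ (jacobi-upper-half Q L))) ⟨
      P * (∏[ i < L ] (Q ^ L + - 1# * Q ^ i) * (Q ^ L * ∏[ i < L ] (Q ^ L + - 1# * Q ^ (L ℕ.+ suc i))))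
    ≈⟨ *-congˡ (rothe-at-root Q (Q ^ L) (- 1#) L (trans (x+-y≈x-y _ _) (-‿inverseʳ (Q ^ L)))) ⟩
      P * antidiag (L ℕ.+ suc L) F
    ≈⟨ antidiag-*ˡ (L ℕ.+ suc L) F P ⟩
      antidiag (L ℕ.+ suc L) (λ a b → P * F a b)
    ≈⟨ antidiag-cong (L ℕ.+ suc L) (λ a b _ → regroup a b) ⟩
      antidiag (L ℕ.+ suc L) (λ a b → (P * qbinom Q a b) * (((- 1#) ^ a * ⟦ + b ⟧) * Q ^ jacobi-exponent L a b))
    ∎
    where
    L : ℕ
    L = suc L′
    P σ : Carrier
    P = poch Q L
    σ = (- 1#) ^ L
    F : ℕ → ℕ → Carrier
    F a b = qbinom Q a b * Q ^ tri a * (- 1#) ^ a * (⟦ + b ⟧ * (Q ^ L) ^ b)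
    regroup : ∀ a b → P * F a b ≈ (P * qbinom Q a b) * (((- 1#) ^ a * ⟦ + b ⟧) * Q ^ jacobi-exponent L a b)
    regroup a b = begin
        P * (qbinom Q a b * Q ^ tri a * (- 1#) ^ a * (⟦ + b ⟧ * (Q ^ L) ^ b))
      ≈⟨ solve 6 (λ p B t σ n r → p :* (B :* t :* σ :* (n :* r)) := (p :* B) :* ((σ :* n) :* (t :* r))) refl
           P (qbinom Q a b) (Q ^ tri a) ((- 1#) ^ a) ⟦ + b ⟧ ((Q ^ L) ^ b) ⟩
        (P * qbinom Q a b) * (((- 1#) ^ a * ⟦ + b ⟧) * (Q ^ tri a * (Q ^ L) ^ b))
      ≈⟨ *-congˡ (*-congˡ (trans (*-congˡ (^-assocʳ Q L b)) (sym (^-homo-* Q (tri a) (L ℕ.* b))))) ⟩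
        (P * qbinom Q a b) * (((- 1#) ^ a * ⟦ + b ⟧) * Q ^ jacobi-exponent L a b)
      ∎

  private
    euler-factor : Carrier → ℕ → ℕ → Carrier
    euler-factor Q L i = Q ^ euler-step L + - 1# * (Q ^ 3) ^ i

    euler-factor≈ : ∀ Q L i → euler-factor Q L i ≈ Q ^ euler-step L - Q ^ (3 ℕ.* i)
    euler-factor≈ Q L i = trans (x+-y≈x-y _ _) (+-congˡ (-‿cong (^-assocʳ Q 3 i)))

    euler-residue : Carrier → ℕ → ℕ → Carrier
    euler-residue Q M r = ∏[ j < M ] (1# - Q ^ (3 ℕ.* j ℕ.+ r))

    euler-lower-half : ∀ Q L → ∏ (suc L) (euler-factor Q L) ≈ (- 1#) ^ suc L * Q ^ (3 ℕ.* tri (suc L)) * euler-residue Q (suc L) 2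
    euler-lower-half Q L = trans (∏-cong (suc L) (λ i _ → trans (euler-factor≈ Q L i) (+-congʳ (^-congʳ Q (ℕ.+-comm 2 (3 ℕ.* L))))))
                                 (∏-differences-of-powers Q 3 2 L)

    euler-upper-half : ∀ Q L → ∏[ j < suc L ] euler-factor Q L (suc L ℕ.+ j) ≈ (Q ^ euler-step L) ^ suc L * euler-residue Q (suc L) 1
    euler-upper-half Q L = trans (∏-cong (suc L) (λ j _ → euler-factor≈ Q L (suc L ℕ.+ j)))
      (∏-factor-power Q (euler-step L) (suc L) (λ j → 3 ℕ.* (suc L ℕ.+ j)) (λ j → 3 ℕ.* j ℕ.+ 1) (shift L))
      where
      shift : ∀ L j → 3 ℕ.* (suc L ℕ.+ j) ≡ suc (suc (3 ℕ.* L)) ℕ.+ (3 ℕ.* j ℕ.+ 1)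
      shift = solve-∀

    poch-cube≈ : ∀ Q M → poch (Q ^ 3) M ≈ euler-residue Q M 3
    poch-cube≈ Q M = ∏-cong M (λ i _ → +-congˡ (-‿cong (trans (^-assocʳ Q 3 (suc i)) (^-congʳ Q (three-steps i)))))
      where
      three-steps : ∀ i → 3 ℕ.* suc i ≡ 3 ℕ.* i ℕ.+ 3
      three-steps = solve-∀

  -- A finite form of Euler's pentagonal number theorem: Rothe's theorem in base Q³ at x = Q^(3L+2), y = -1.
  euler-finite : ∀ Q L → let M = suc L ; P₃ = poch (Q ^ 3) M in
    (- 1#) ^ M * Q ^ euler-offset L * poch Q (3 ℕ.* M) ≈
    antidiag (M ℕ.+ M) (λ a b → (P₃ * qbinom (Q ^ 3) a b) * ((- 1#) ^ a * Q ^ euler-exponent L a b))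
  euler-finite Q L = begin
      σ * Q ^ euler-offset L * poch Q (3 ℕ.* M)
    ≈⟨ *-cong (*-congˡ (trans (^-homo-* Q (3 ℕ.* tri M) (euler-step L ℕ.* M)) (*-congˡ (sym (^-assocʳ Q (euler-step L) M)))))
              (sym (poch-by-residue-mod-3 Q M)) ⟩
      σ * (Q ^ (3 ℕ.* tri M) * x ^ M) * (P 1 * P 2 * P 3)
    ≈⟨ solve 6 (λ s a b p₁ p₂ p₃ → s :* (a :* b) :* (p₁ :* p₂ :* p₃) := p₃ :* (s :* a :* p₂ :* (b :* p₁))) refl
         σ (Q ^ (3 ℕ.* tri M)) (x ^ M) (P 1) (P 2) (P 3) ⟩
      P 3 * (σ * Q ^ (3 ℕ.* tri M) * P 2 * (x ^ M * P 1))
    ≈⟨ *-cong (poch-cube≈ Q M) (*-cong (euler-lower-half Q L) (euler-upper-half Q L)) ⟨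
      P₃ * (∏ M (euler-factor Q L) * ∏[ j < M ] euler-factor Q L (M ℕ.+ j))
    ≈⟨ *-congˡ (∏-split M M (euler-factor Q L)) ⟨
      P₃ * ∏ (M ℕ.+ M) (euler-factor Q L)
    ≈⟨ *-congˡ (rothe Q₃ x (- 1#) (M ℕ.+ M)) ⟩
      P₃ * antidiag (M ℕ.+ M) (rothe-term Q₃ x (- 1#))
    ≈⟨ antidiag-*ˡ (M ℕ.+ M) (rothe-term Q₃ x (- 1#)) P₃ ⟩
      antidiag (M ℕ.+ M) (λ a b → P₃ * rothe-term Q₃ x (- 1#) a b)
    ≈⟨ antidiag-cong (M ℕ.+ M) (λ a b _ → regroup a b) ⟩
      antidiag (M ℕ.+ M) (λ a b → (P₃ * qbinom Q₃ a b) * ((- 1#) ^ a * Q ^ euler-exponent L a b))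
    ∎
    where
    M : ℕ
    M = suc L
    Q₃ x P₃ σ : Carrier
    Q₃ = Q ^ 3
    x  = Q ^ euler-step L
    P₃ = poch Q₃ M
    σ  = (- 1#) ^ M
    P : ℕ → Carrier
    P = euler-residue Q M
    regroup : ∀ a b → P₃ * rothe-term Q₃ x (- 1#) a b ≈ (P₃ * qbinom Q₃ a b) * ((- 1#) ^ a * Q ^ euler-exponent L a b)
    regroup a b = begin
        P₃ * (qbinom Q₃ a b * Q₃ ^ tri a * (- 1#) ^ a * x ^ b)
      ≈⟨ solve 5 (λ p B t σ r → p :* (B :* t :* σ :* r) := (p :* B) :* (σ :* (t :* r))) refl
           P₃ (qbinom Q₃ a b) (Q₃ ^ tri a) ((- 1#) ^ a) (x ^ b) ⟩
        (P₃ * qbinom Q₃ a b) * ((- 1#) ^ a * (Q₃ ^ tri a * x ^ b))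
      ≈⟨ *-congˡ (*-congˡ (trans (*-cong (^-assocʳ Q 3 (tri a)) (^-assocʳ Q (euler-step L) b))
                                  (sym (^-homo-* Q (3 ℕ.* tri a) (euler-step L ℕ.* b))))) ⟩
        (P₃ * qbinom Q₃ a b) * ((- 1#) ^ a * Q ^ euler-exponent L a b)
      ∎

module PowerSeries where
  open import Algebra using (CommutativeRing)
  open import Algebra.Structures using (IsCommutativeRing)
  open import Data.Bool using (if_then_else_)
  open import Data.Nat as ℕ using (ℕ; zero; suc; _<_; s≤s; _<ᵇ_)
  import Data.Nat.Properties as ℕ
  open import Data.Integer as ℤ using (ℤ; +_)
  import Data.Integer.Properties as ℤ
  open import Data.Product using (_,_)
  open import Level using (0ℓ)
  open import Relation.Binary.PropositionalEquality as ≡ using (_≡_)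

  module Z = FiniteSums ℤ.+-*-commutativeRing

  Series : Set
  Series = ℕ → ℤ

  infix 4 _≈ₛ_
  record _≈ₛ_ (f g : Series) : Set where
    constructor mk
    field at : ∀ n → f n ≡ g n
  open _≈ₛ_ public

  infixl 6 _+ₛ_
  infixl 7 _*ₛ_

  _+ₛ_ : Series → Series → Series
  (f +ₛ g) n = f n ℤ.+ g n

  -ₛ_ : Series → Series
  (-ₛ f) n = ℤ.- f n

  0ₛ : Series
  0ₛ _ = + 0

  C : ℤ → Series
  C c zero    = c
  C c (suc n) = + 0

  1ₛ : Series
  1ₛ = C (+ 1)

  _*ₛ_ : Series → Series → Series
  (f *ₛ g) n = Z.antidiag n (λ a b → f a ℤ.* g b)

  private
    *ₛ-cong : ∀ {f f′ g g′} → f ≈ₛ f′ → g ≈ₛ g′ → f *ₛ g ≈ₛ f′ *ₛ g′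
    *ₛ-cong f≈ g≈ = mk λ n → Z.antidiag-cong n (λ a b _ → ≡.cong₂ ℤ._*_ (at f≈ a) (at g≈ b))

    *ₛ-assoc : ∀ f g h → (f *ₛ g) *ₛ h ≈ₛ f *ₛ (g *ₛ h)
    *ₛ-assoc f g h = mk λ n → ≡.trans (Z.antidiag-cong n (λ a b _ → Z.antidiag-*ʳ a _ (h b)))
      (≡.trans (Z.antidiag-cong n (λ a b _ → Z.antidiag-cong a (λ c d _ → ℤ.*-assoc (f c) (g d) (h b))))
      (≡.trans (Z.antidiag-assoc n (λ c d b → f c ℤ.* (g d ℤ.* h b)))
      (Z.antidiag-cong n (λ a b _ → ≡.sym (Z.antidiag-*ˡ b _ (f a))))))

    *ₛ-comm : ∀ f g → f *ₛ g ≈ₛ g *ₛ f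
    *ₛ-comm f g = mk λ n → ≡.trans (Z.antidiag-swap n _) (Z.antidiag-cong n (λ a b _ → ℤ.*-comm (f b) (g a)))

    *ₛ-identityˡ : ∀ f → 1ₛ *ₛ f ≈ₛ f
    *ₛ-identityˡ f = mk λ where
      zero    → ℤ.*-identityˡ (f 0)
      (suc n) → ≡.trans (≡.cong₂ ℤ._+_ (ℤ.*-identityˡ (f (suc n))) (Z.antidiag-zero n _ (λ a b _ → ℤ.*-zeroˡ (f b))))
                        (ℤ.+-identityʳ _)

    *ₛ-distribˡ : ∀ f g h → f *ₛ (g +ₛ h) ≈ₛ f *ₛ g +ₛ f *ₛ h
    *ₛ-distribˡ f g h = mk λ n → ≡.trans (Z.antidiag-cong n (λ a b _ → ℤ.*-distribˡ-+ (f a) (g b) (h b))) (Z.antidiag-distrib-+ n _ _)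

    series-isCommutativeRing : IsCommutativeRing _≈ₛ_ _+ₛ_ _*ₛ_ -ₛ_ 0ₛ 1ₛ
    series-isCommutativeRing = record
      { isRing = record
        { +-isAbelianGroup = record
          { isGroup = record
            { isMonoid = record
              { isSemigroup = record
                { isMagma = record
                  { isEquivalence = record
                    { refl  = mk λ _ → ≡.refl
                    ; sym   = λ e → mk λ n → ≡.sym (at e n)
                    ; trans = λ e e′ → mk λ n → ≡.trans (at e n) (at e′ n) }
                  ; ∙-cong = λ e e′ → mk λ n → ≡.cong₂ ℤ._+_ (at e n) (at e′ n) }
                ; assoc = λ f g h → mk λ n → ℤ.+-assoc (f n) (g n) (h n) }
              ; identity = (λ f → mk λ n → ℤ.+-identityˡ (f n)) , (λ f → mk λ n → ℤ.+-identityʳ (f n)) }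
            ; inverse = (λ f → mk λ n → ℤ.+-inverseˡ (f n)) , (λ f → mk λ n → ℤ.+-inverseʳ (f n))
            ; ⁻¹-cong = λ e → mk λ n → ≡.cong ℤ.-_ (at e n) }
          ; comm = λ f g → mk λ n → ℤ.+-comm (f n) (g n) }
        ; *-cong = *ₛ-cong
        ; *-assoc = *ₛ-assoc
        ; *-identity = *ₛ-identityˡ , (λ f → mk λ n → ≡.trans (at (*ₛ-comm f 1ₛ) n) (at (*ₛ-identityˡ f) n))
        ; distrib = *ₛ-distribˡ , (λ f g h → mk λ n → ≡.trans (at (*ₛ-comm (g +ₛ h) f) n)
                      (≡.trans (at (*ₛ-distribˡ f g h) n) (≡.cong₂ ℤ._+_ (at (*ₛ-comm f g) n) (at (*ₛ-comm f h) n)))) }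
      ; *-comm = *ₛ-comm }

  series : CommutativeRing 0ℓ 0ℓ
  series = record { isCommutativeRing = series-isCommutativeRing }

  module S = FiniteSums series

  antidiag-coeff : ∀ n F m → S.antidiag n F m ≡ Z.antidiag n (λ a b → F a b m)
  antidiag-coeff zero    F m = ≡.refl
  antidiag-coeff (suc n) F m = ≡.cong (λ z → F 0 (suc n) m ℤ.+ z) (antidiag-coeff n (λ a b → F (suc a) b) m)

  ∏-constant-term : ∀ n f → S.∏ n f 0 ≡ Z.∏ n (λ i → f i 0)
  ∏-constant-term zero    f = ≡.refl
  ∏-constant-term (suc n) f = ≡.cong (ℤ._* f n 0) (∏-constant-term n f)

  C-+ : ∀ x y → C x S.+ C y ≈ₛ C (x ℤ.+ y)
  C-+ x y = mk λ where
    zero    → ≡.refl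
    (suc n) → ≡.refl

  C-neg : ∀ x → S.- C x ≈ₛ C (ℤ.- x)
  C-neg x = mk λ where
    zero    → ≡.refl
    (suc n) → ≡.refl

  C-* : ∀ x y → C x S.* C y ≈ₛ C (x ℤ.* y)
  C-* x y = mk λ where
    zero    → ≡.refl
    (suc n) → ≡.trans (≡.cong₂ ℤ._+_ (ℤ.*-zeroʳ x) (Z.antidiag-zero n _ (λ a b _ → ℤ.*-zeroˡ (C y b)))) ≡.refl

  C-^ : ∀ c n → C c S.^ n ≈ₛ C (c Z.^ n)
  C-^ c zero    = S.refl
  C-^ c (suc n) = S.trans (S.*-congˡ {C c} (C-^ c n)) (C-* c (c Z.^ n))

  ⟦+⟧≈C : ∀ n → S.⟦ + n ⟧ ≈ₛ C (+ n)
  ⟦+⟧≈C zero    = mk λ where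
    zero    → ≡.refl
    (suc n) → ≡.refl
  ⟦+⟧≈C (suc n) = S.trans (1+× n S.1#) (S.trans (S.+-congˡ {S.1#} (⟦+⟧≈C n)) (C-+ (+ 1) (+ n)))
    where open import Algebra.Properties.Semiring.Mult.TCOptimised S.semiring using (1+×)

  shift : ℕ → Series → Series
  shift zero    f n       = f n
  shift (suc k) f zero    = + 0
  shift (suc k) f (suc n) = shift k f n

  shift-cong : ∀ k {f g} → f ≈ₛ g → shift k f ≈ₛ shift k g
  shift-cong zero    f≈g = f≈g
  shift-cong (suc k) f≈g = mk λ where
    zero    → ≡.refl
    (suc n) → at (shift-cong k f≈g) n

  shift-below : ∀ k f n → n < k → shift k f n ≡ + 0
  shift-below (suc k) f zero    _         = ≡.refl
  shift-below (suc k) f (suc n) (s≤s n<k) = shift-below k f n n<k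

  shift-at : ∀ k f n → shift k f (k ℕ.+ n) ≡ f n
  shift-at zero    f n = ≡.refl
  shift-at (suc k) f n = shift-at k f n

  shift-if : ∀ k f n → shift k f n ≡ (if n <ᵇ k then + 0 else f (n ℕ.∸ k))
  shift-if zero    f n       = ≡.refl
  shift-if (suc k) f zero    = ≡.refl
  shift-if (suc k) f (suc n) = shift-if k f n

  q : Series
  q = shift 1 1ₛ

  q*-shift : ∀ f → q S.* f ≈ₛ shift 1 f
  q*-shift f = mk λ where
    zero    → ≡.refl
    (suc n) → ≡.trans (ℤ.+-identityˡ _) (at (S.*-identityˡ f) n)

  q^*-shift : ∀ k f → q S.^ k S.* f ≈ₛ shift k f
  q^*-shift zero    f = S.*-identityˡ f
  q^*-shift (suc k) f = S.trans (S.*-assoc q (q S.^ k) f)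
    (S.trans (S.*-congˡ {q} (q^*-shift k f)) (S.trans (q*-shift (shift k f)) shift-suc))
    where
    shift-suc : shift 1 (shift k f) ≈ₛ shift (suc k) f
    shift-suc = mk λ where
      zero    → ≡.refl
      (suc n) → ≡.refl

  q^-shift : ∀ k → q S.^ k ≈ₛ shift k 1ₛ
  q^-shift k = S.trans (S.sym (S.*-identityʳ (q S.^ k))) (q^*-shift k 1ₛ)

  ^-constant-term : ∀ f n → (f S.^ n) 0 ≡ f 0 Z.^ n
  ^-constant-term f zero    = ≡.refl
  ^-constant-term f (suc n) = ≡.cong (f 0 ℤ.*_) (^-constant-term f n)

  factor : ℕ → Series
  factor i = S.1# S.- q S.^ suc i

module Truncation where
  open import Data.Nat as ℕ using (ℕ; zero; suc; _<_; _≤_; z≤n; s≤s)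
  import Data.Nat.Properties as ℕ
  open import Data.Integer as ℤ using (ℤ; +_)
  import Data.Integer.Properties as ℤ
  open import Data.Sum using (_⊎_; inj₁; inj₂)
  open import Data.Product using (Σ; _×_; _,_)
  open import Relation.Binary.PropositionalEquality as ≡ using (_≡_)
  open import Relation.Nullary using (yes; no)
  open import Relation.Binary.Bundles using (Setoid)
  open import Level using (0ℓ)
  open PowerSeries

  infix 4 _≈[<_]_
  _≈[<_]_ : Series → ℕ → Series → Set
  f ≈[< N ] g = ∀ n → n < N → f n ≡ g n

  module _ {N : ℕ} where

    ≈ₛ⇒≈[<] : ∀ {f g} → f ≈ₛ g → f ≈[< N ] g
    ≈ₛ⇒≈[<] f≈g n _ = at f≈g n

    ≈[<]-refl : ∀ {f} → f ≈[< N ] f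
    ≈[<]-refl n _ = ≡.refl

    ≈[<]-sym : ∀ {f g} → f ≈[< N ] g → g ≈[< N ] f
    ≈[<]-sym f≈g n n<N = ≡.sym (f≈g n n<N)

    ≈[<]-trans : ∀ {f g h} → f ≈[< N ] g → g ≈[< N ] h → f ≈[< N ] h
    ≈[<]-trans f≈g g≈h n n<N = ≡.trans (f≈g n n<N) (g≈h n n<N)

    ≈[<]-*ʳ : ∀ {f g} h → f ≈[< N ] g → f S.* h ≈[< N ] g S.* h
    ≈[<]-*ʳ h f≈g n n<N = Z.antidiag-cong n λ a b a+b≡n →
      ≡.cong (ℤ._* h b) (f≈g a (ℕ.≤-<-trans (ℕ.m≤m+n a b) (≡.subst (_< N) (≡.sym a+b≡n) n<N)))

    ≈[<]-*ˡ : ∀ {f g} h → f ≈[< N ] g → h S.* f ≈[< N ] h S.* g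
    ≈[<]-*ˡ {f} {g} h f≈g = ≈[<]-trans (≈ₛ⇒≈[<] (S.*-comm h f)) (≈[<]-trans (≈[<]-*ʳ h f≈g) (≈ₛ⇒≈[<] (S.*-comm g h)))

    ≈[<]-* : ∀ {f g f′ g′} → f ≈[< N ] g → f′ ≈[< N ] g′ → f S.* f′ ≈[< N ] g S.* g′
    ≈[<]-* {g = g} {f′ = f′} f≈g f′≈g′ = ≈[<]-trans (≈[<]-*ʳ f′ f≈g) (≈[<]-*ˡ g f′≈g′)

    ≈[<]-antidiag : ∀ n F G → (∀ a b → a ℕ.+ b ≡ n → F a b ≈[< N ] G a b) → S.antidiag n F ≈[< N ] S.antidiag n G
    ≈[<]-antidiag n F G F≈G m m<N = ≡.trans (antidiag-coeff n F m)
      (≡.trans (Z.antidiag-cong n (λ a b e → F≈G a b e m m<N)) (≡.sym (antidiag-coeff n G m)))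

    ≈[<]-∏-1 : ∀ k f → (∀ i → i < k → f i ≈[< N ] S.1#) → S.∏ k f ≈[< N ] S.1#
    ≈[<]-∏-1 zero    f f≈1 = ≈[<]-refl
    ≈[<]-∏-1 (suc k) f f≈1 = ≈[<]-trans (≈[<]-* (≈[<]-∏-1 k f (λ i i<k → f≈1 i (ℕ.m<n⇒m<1+n i<k))) (f≈1 k ℕ.≤-refl))
      (≈ₛ⇒≈[<] (S.*-identityˡ S.1#))

    ≈[<]⇒-≈[<]0 : ∀ {f g} → f ≈[< N ] g → f S.- g ≈[< N ] S.0#
    ≈[<]⇒-≈[<]0 {g = g} f≈g n n<N = ≡.trans (≡.cong (ℤ._- g n) (f≈g n n<N)) (ℤ.+-inverseʳ (g n))

    -≈[<]0⇒≈[<] : ∀ {f g} → f S.- g ≈[< N ] S.0# → f ≈[< N ] g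
    -≈[<]0⇒≈[<] {f} {g} f-g≈0 n n<N = begin
      f n                    ≡⟨ ℤ.+-identityʳ (f n) ⟨
      f n ℤ.+ + 0            ≡⟨ ≡.cong (λ z → f n ℤ.+ z) (ℤ.+-inverseˡ (g n)) ⟨
      f n ℤ.+ (ℤ.- g n ℤ.+ g n) ≡⟨ ℤ.+-assoc (f n) (ℤ.- g n) (g n) ⟨
      f n ℤ.- g n ℤ.+ g n    ≡⟨ ≡.cong (ℤ._+ g n) (f-g≈0 n n<N) ⟩
      + 0 ℤ.+ g n            ≡⟨ ℤ.+-identityˡ (g n) ⟩
      g n                    ∎
      where open ≡.≡-Reasoning

    ≈[<]-cancel-unit : ∀ U Y → U 0 ≡ + 1 → U S.* Y ≈[< N ] S.0# → Y ≈[< N ] S.0#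
    ≈[<]-cancel-unit U Y U₀≡1 UY≈0 n n<N = below n n<N n ℕ.≤-refl
      where
      open ≡.≡-Reasoning
      below : ∀ m → m < N → ∀ k → k ≤ m → Y k ≡ + 0
      below zero    0<N .zero z≤n = begin
        Y 0             ≡⟨ ℤ.*-identityˡ (Y 0) ⟨
        + 1 ℤ.* Y 0     ≡⟨ ≡.cong (ℤ._* Y 0) U₀≡1 ⟨
        U 0 ℤ.* Y 0     ≡⟨ UY≈0 0 0<N ⟩
        + 0             ∎
      below (suc m) m<N k k≤m with ℕ.m≤n⇒m<n∨m≡n k≤m
      ... | inj₁ k<m    = below m (ℕ.<-trans (ℕ.n<1+n m) m<N) k (ℕ.≤-pred k<m)
      ... | inj₂ ≡.refl = begin
        Y (suc m)                                              ≡⟨ ℤ.*-identityʳ _ ⟨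
        Y (suc m) ℤ.* + 1                                      ≡⟨ ≡.cong (Y (suc m) ℤ.*_) U₀≡1 ⟨
        Y (suc m) ℤ.* U 0                                      ≡⟨ ℤ.+-identityˡ _ ⟨
        + 0 ℤ.+ Y (suc m) ℤ.* U 0                              ≡⟨ ≡.cong (ℤ._+ (Y (suc m) ℤ.* U 0)) (Z.antidiag-zero m _ earlier) ⟨
        Z.antidiag m (λ a b → Y a ℤ.* U (suc b)) ℤ.+ Y (suc m) ℤ.* U 0 ≡⟨ Z.antidiag-last m (λ a b → Y a ℤ.* U b) ⟨
        (Y S.* U) (suc m)                                      ≡⟨ at (S.*-comm Y U) (suc m) ⟩
        (U S.* Y) (suc m)                                      ≡⟨ UY≈0 (suc m) m<N ⟩
        + 0                                                    ∎
        where
        earlier : ∀ a b → a ℕ.+ b ≡ m → Y a ℤ.* U (suc b) ≡ + 0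
        earlier a b a+b≡m = ≡.cong (ℤ._* U (suc b))
          (below m (ℕ.<-trans (ℕ.n<1+n m) m<N) a (≡.subst (a ≤_) a+b≡m (ℕ.m≤m+n a b)))

  ≈[<]-setoid : ℕ → Setoid 0ℓ 0ℓ
  ≈[<]-setoid N = record
    { Carrier = Series ; _≈_ = _≈[< N ]_
    ; isEquivalence = record { refl = ≈[<]-refl ; sym = ≈[<]-sym ; trans = ≈[<]-trans } }

  module ≈[<]-Reasoning (N : ℕ) where
    open import Relation.Binary.Reasoning.Setoid (≈[<]-setoid N) public

  ≈[<]-weaken : ∀ {N M f g} → M ≤ N → f ≈[< N ] g → f ≈[< M ] g
  ≈[<]-weaken M≤N f≈g n n<M = f≈g n (ℕ.<-≤-trans n<M M≤N)

  ≈[<]0-* : ∀ {s t f g} → f ≈[< s ] S.0# → g ≈[< t ] S.0# → f S.* g ≈[< s ℕ.+ t ] S.0#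
  ≈[<]0-* {s} {t} {f} {g} f≈0 g≈0 n n<s+t = Z.antidiag-zero n _ vanish
    where
    vanish : ∀ x y → x ℕ.+ y ≡ n → f x ℤ.* g y ≡ + 0
    vanish x y x+y≡n with x ℕ.<? s
    ... | yes x<s = ≡.cong (ℤ._* g y) (f≈0 x x<s)
    ... | no  x≮s = ≡.trans (≡.cong (f x ℤ.*_) (g≈0 y y<t)) (ℤ.*-zeroʳ (f x))
      where
      y<t : y < t
      y<t = ℕ.+-cancelˡ-< s y t (ℕ.≤-<-trans (ℕ.+-monoˡ-≤ y (ℕ.≮⇒≥ x≮s)) (≡.subst (_< s ℕ.+ t) (≡.sym x+y≡n) n<s+t))

  ≈[<]-unshift : ∀ k {N f g} → shift k f ≈[< k ℕ.+ N ] shift k g → f ≈[< N ] g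
  ≈[<]-unshift k {N} {f} {g} f≈g n n<N =
    ≡.trans (≡.sym (shift-at k f n)) (≡.trans (f≈g (k ℕ.+ n) (ℕ.+-monoʳ-< k n<N)) (shift-at k g n))

  ≈[<]-cancel-q^ : ∀ k {N} f g → q S.^ k S.* f ≈[< k ℕ.+ N ] q S.^ k S.* g → f ≈[< N ] g
  ≈[<]-cancel-q^ k f g f≈g = ≈[<]-unshift k
    (≈[<]-trans (≈ₛ⇒≈[<] (S.sym (q^*-shift k f))) (≈[<]-trans f≈g (≈ₛ⇒≈[<] (q^*-shift k g))))

  ≈[<]1-*-monomial : ∀ {N M} X c E → X ≈[< N ] S.1# → M ≤ N ℕ.+ E → X S.* (c S.* q S.^ E) ≈[< M ] c S.* q S.^ E
  ≈[<]1-*-monomial X c E X≈1 M≤N+E = -≈[<]0⇒≈[<] (≈[<]-weaken M≤N+E (≈[<]-trans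
    (≈ₛ⇒≈[<] (S.solve 2 (λ x y → x S.:* y S.:- y S.:= (x S.:- S.con (+ 1)) S.:* y) S.refl X (c S.* q S.^ E)))
    (≈[<]0-* (≈[<]⇒-≈[<]0 X≈1) (≈[<]-trans (≈ₛ⇒≈[<] (S.trans (S.*-comm c (q S.^ E)) (q^*-shift E c))) (shift-below E c)))))

  *-monomial-≈[<] : ∀ {M} X c E → M ≤ E → X S.* (c S.* q S.^ E) ≈[< M ] c S.* q S.^ E
  *-monomial-≈[<] X c E M≤E = ≈[<]-weaken M≤E (≈[<]-trans (vanishes X)
    (≈[<]-sym (≈[<]-trans (≈ₛ⇒≈[<] (S.sym (S.*-identityˡ (c S.* q S.^ E)))) (vanishes S.1#))))
    where
    vanishes : ∀ Y → Y S.* (c S.* q S.^ E) ≈[< E ] S.0#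
    vanishes Y = ≈[<]-trans (≈ₛ⇒≈[<] (S.trans (S.trans (S.sym (S.*-assoc Y c (q S.^ E))) (S.*-comm (Y S.* c) (q S.^ E)))
                                               (q^*-shift E (Y S.* c))))
                            (shift-below E (Y S.* c))

  module PochhammerTruncation (d : ℕ) (1≤d : 1 ≤ d) where

    Q : Series
    Q = q S.^ d

    P : ℕ → Series
    P = S.poch Q

    Q^≈shift : ∀ e → Q S.^ e ≈ₛ shift (d ℕ.* e) S.1#
    Q^≈shift e = S.trans (S.^-assocʳ q d e) (q^-shift (d ℕ.* e))

    1-Q^≈[<]1 : ∀ e → S.1# S.- Q S.^ e ≈[< d ℕ.* e ] S.1#
    1-Q^≈[<]1 e n n<de = ≡.trans (≡.cong (λ z → S.1# n ℤ.- z) (≡.trans (at (Q^≈shift e) n) (shift-below (d ℕ.* e) S.1# n n<de)))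
      (ℤ.+-identityʳ (S.1# n))

    P-constant-term : ∀ m → P m 0 ≡ + 1
    P-constant-term m = ≡.trans (∏-constant-term m _)
      (≡.trans (Z.∏-cong m (λ i _ → 1-Q^≈[<]1 (suc i) 0 0<d*suc-i)) (≡.trans (Z.∏-const m (+ 1)) (Z.1^n≈1 m)))
      where
      0<d*suc-i : ∀ {i} → 0 < d ℕ.* suc i
      0<d*suc-i = ℕ.<-≤-trans (s≤s z≤n) (ℕ.*-mono-≤ 1≤d (s≤s z≤n))

    P-stable : ∀ m j → m ≤ j → P j ≈[< d ℕ.* suc m ] P m
    P-stable m j m≤j = ≡.subst (λ j → P j ≈[< d ℕ.* suc m ] P m) (ℕ.m+[n∸m]≡n m≤j) (≈[<]-trans
      (≈ₛ⇒≈[<] (S.∏-split m (j ℕ.∸ m) _))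
      (≈[<]-trans (≈[<]-*ˡ (P m) (≈[<]-∏-1 (j ℕ.∸ m) _ (λ i _ →
                     ≈[<]-weaken (ℕ.*-monoʳ-≤ d (s≤s (ℕ.m≤m+n m i))) (1-Q^≈[<]1 (suc (m ℕ.+ i))))))
                  (≈ₛ⇒≈[<] (S.*-identityʳ (P m)))))

    P*qbinom≈[<]1 : ∀ m a b L → m ≤ a → m ≤ b → m ≤ L → P L S.* S.qbinom Q a b ≈[< d ℕ.* suc m ] S.1#
    P*qbinom≈[<]1 m a b L m≤a m≤b m≤L = -≈[<]0⇒≈[<] (≈[<]-cancel-unit (U S.* U) (X S.- S.1#) U²₀≡1 U²[X-1]≈0)
      where
      U X : Series
      U = P m
      X = P L S.* S.qbinom Q a b
      U²₀≡1 : (U S.* U) 0 ≡ + 1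
      U²₀≡1 = ≡.cong₂ ℤ._*_ (P-constant-term m) (P-constant-term m)
      XU²≈U² : X S.* (U S.* U) ≈[< d ℕ.* suc m ] U S.* U
      XU²≈U² = ≈[<]-trans (≈[<]-*ˡ X (≈[<]-* (≈[<]-sym (P-stable m a m≤a)) (≈[<]-sym (P-stable m b m≤b))))
        (≈[<]-trans (≈ₛ⇒≈[<] (S.trans (S.*-assoc (P L) (S.qbinom Q a b) _) (S.*-congˡ {P L} (S.qbinom-poch Q a b))))
        (≈[<]-* (P-stable m L m≤L) (P-stable m (a ℕ.+ b) (ℕ.≤-trans m≤a (ℕ.m≤m+n a b)))))
      U²[X-1]≈0 : (U S.* U) S.* (X S.- S.1#) ≈[< d ℕ.* suc m ] S.0#
      U²[X-1]≈0 = ≈[<]-trans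
        (≈ₛ⇒≈[<] (S.solve 2 (λ u x → (u S.:* u) S.:* (x S.:- S.con (+ 1)) S.:= x S.:* (u S.:* u) S.:- u S.:* u) S.refl U X))
        (≈[<]⇒-≈[<]0 XU²≈U²)

  NearOrFar : ℕ → Series → ℕ → Set
  NearOrFar N X e = (Σ ℕ λ M → X ≈[< M ] S.1# × N ≤ M ℕ.+ e) ⊎ N ≤ e

  near-or-far-*-monomial : ∀ {N} X c e → NearOrFar N X e → X S.* (c S.* q S.^ e) ≈[< N ] c S.* q S.^ e
  near-or-far-*-monomial X c e (inj₁ (M , X≈1 , N≤M+e)) = ≈[<]1-*-monomial X c e X≈1 N≤M+e
  near-or-far-*-monomial X c e (inj₂ N≤e)                = *-monomial-≈[<] X c e N≤e

  antidiag-≈[<]-monomials : ∀ {N} n (X c : ℕ → ℕ → Series) (e : ℕ → ℕ → ℕ) →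
    (∀ a b → a ℕ.+ b ≡ n → NearOrFar N (X a b) (e a b)) →
    S.antidiag n (λ a b → X a b S.* (c a b S.* q S.^ e a b)) ≈[< N ] S.antidiag n (λ a b → c a b S.* q S.^ e a b)
  antidiag-≈[<]-monomials n X c e near-or-far = ≈[<]-antidiag n _ _ λ a b a+b≡n →
    near-or-far-*-monomial (X a b) (c a b) (e a b) (near-or-far a b a+b≡n)

  antidiag-monomials-offset : ∀ n (c : ℕ → ℕ → Series) (e s : ℕ → ℕ → ℕ) o →
    (∀ a b → a ℕ.+ b ≡ n → e a b ≡ o ℕ.+ s a b) →
    S.antidiag n (λ a b → c a b S.* q S.^ e a b) ≈ₛ q S.^ o S.* S.antidiag n (λ a b → c a b S.* q S.^ s a b)
  antidiag-monomials-offset n c e s o e≡o+s = S.trans (S.antidiag-cong n λ a b a+b≡n → S.trans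
      (S.*-congˡ {c a b} (S.trans (S.^-congʳ q (e≡o+s a b a+b≡n)) (S.^-homo-* q o (s a b))))
      (S.solve 3 (λ c x y → c S.:* (x S.:* y) S.:= x S.:* (c S.:* y)) S.refl (c a b) (q S.^ o) (q S.^ s a b)))
    (S.sym (S.antidiag-*ˡ n (λ a b → c a b S.* q S.^ s a b) (q S.^ o)))

module TruncatedJacobiEuler where
  open import Data.Nat as ℕ using (ℕ; suc; _<_; _≤_; _∸_)
  import Data.Nat.Properties as ℕ
  open import Data.Integer using (+_)
  open import Data.Product using (_,_)
  open import Data.Sum using (_⊎_; inj₁; inj₂)
  open import Relation.Binary.PropositionalEquality as ≡ using (_≡_)
  open import Relation.Nullary using (yes; no)
  open Exponents
  open PowerSeries
  open Truncation

  private
    scaled : ∀ d {o K e} → o ℕ.+ K ≤ e → d ℕ.* o ℕ.+ d ℕ.* K ≤ d ℕ.* e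
    scaled d {o} {K} {e} o+K≤e = ≡.subst (_≤ d ℕ.* e) (ℕ.*-distribˡ-+ d o K) (ℕ.*-monoʳ-≤ d o+K≤e)

    near-or-far : ∀ d K a b o e {X} → o ≤ e → (a < K ⊎ b < K → o ℕ.+ K ≤ e) →
                  (K ≤ a → K ≤ b → X ≈[< d ℕ.* suc K ] S.1#) → NearOrFar (d ℕ.* o ℕ.+ d ℕ.* K) X (d ℕ.* e)
    near-or-far d K a b o e o≤e far X≈1 with K ℕ.≤? a | K ℕ.≤? b
    ... | yes K≤a | yes K≤b = inj₁ (d ℕ.* suc K , X≈1 K≤a K≤b ,
      ≡.subst (d ℕ.* o ℕ.+ d ℕ.* K ≤_) (ℕ.+-comm (d ℕ.* e) (d ℕ.* suc K)) (ℕ.+-mono-≤ (ℕ.*-monoʳ-≤ d o≤e) (ℕ.*-monoʳ-≤ d (ℕ.n≤1+n K))))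
    ... | no K≰a | _        = inj₂ (scaled d (far (inj₁ (ℕ.≰⇒> K≰a))))
    ... | yes _  | no K≰b   = inj₂ (scaled d (far (inj₂ (ℕ.≰⇒> K≰b))))

  sign : ℕ → Series
  sign a = (S.- S.1#) S.^ a

  module TruncatedJacobi (d : ℕ) (1≤d : 1 ≤ d) (L′ K : ℕ) (2K≤L : K ℕ.+ K ≤ suc L′) where
    open PochhammerTruncation d 1≤d
    open FiniteJacobiEuler series using (jacobi-finite)

    L n : ℕ
    L = suc L′
    n = L ℕ.+ suc L

    reduced : ℕ → ℕ → ℕ
    reduced a b = jacobi-exponent L a b ∸ jacobi-offset L

    jacobi-sum : Series
    jacobi-sum = S.antidiag n (λ a b → (sign a S.* S.⟦ + b ⟧) S.* q S.^ (d ℕ.* reduced a b))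

    private
      X c : ℕ → ℕ → Series
      X a b = P L S.* S.qbinom Q a b
      c a b = sign a S.* S.⟦ + b ⟧

      offset≤exponent : ∀ a b → a ℕ.+ b ≡ n → jacobi-offset L ≤ jacobi-exponent L a b
      offset≤exponent a b a+b≡ = ≡.subst (jacobi-offset L ≤_) (≡.sym (JacobiTerm.exponent (jacobiTerm L a b a+b≡))) (ℕ.m≤m+n _ _)

      exponent≡ : ∀ a b → a ℕ.+ b ≡ n → d ℕ.* jacobi-exponent L a b ≡ d ℕ.* jacobi-offset L ℕ.+ d ℕ.* reduced a b
      exponent≡ a b a+b≡ = ≡.trans (≡.cong (d ℕ.*_) (≡.sym (ℕ.m+[n∸m]≡n (offset≤exponent a b a+b≡)))) (ℕ.*-distribˡ-+ d _ _)

      term-bound : ∀ a b → a ℕ.+ b ≡ n → NearOrFar (d ℕ.* jacobi-offset L ℕ.+ d ℕ.* K) (X a b) (d ℕ.* jacobi-exponent L a b)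
      term-bound a b a+b≡ = near-or-far d K a b (jacobi-offset L) (jacobi-exponent L a b) (offset≤exponent a b a+b≡) far′
        (λ K≤a K≤b → P*qbinom≈[<]1 K a b L K≤a K≤b (ℕ.≤-trans (ℕ.m≤m+n K K) 2K≤L))
        where
        open JacobiTerm (jacobiTerm L a b a+b≡)
        far′ : a < K ⊎ b < K → jacobi-offset L ℕ.+ K ≤ jacobi-exponent L a b
        far′ a<K⊎b<K = ≡.subst (jacobi-offset L ℕ.+ K ≤_) (≡.sym exponent)
          (ℕ.+-monoʳ-≤ (jacobi-offset L) (ℕ.≤-trans (far K 2K≤L a<K⊎b<K) (ℕ.m≤n+m k (tri k))))

    jacobi-truncated : sign L S.* (P L S.* P L S.* P L) ≈[< d ℕ.* K ] jacobi-sum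
    jacobi-truncated = ≈[<]-cancel-q^ (d ℕ.* jacobi-offset L) _ jacobi-sum (begin
        q S.^ (d ℕ.* jacobi-offset L) S.* (sign L S.* (P L S.* P L S.* P L))
      ≈⟨ ≈ₛ⇒≈[<] (S.solve 3 (λ x s c → x S.:* (s S.:* c) S.:= s S.:* x S.:* c) S.refl _ (sign L) (P L S.* P L S.* P L)) ⟩
        sign L S.* q S.^ (d ℕ.* jacobi-offset L) S.* (P L S.* P L S.* P L)
      ≈⟨ ≈ₛ⇒≈[<] (S.*-congʳ (S.*-congˡ {sign L} (S.^-assocʳ q d (jacobi-offset L)))) ⟨
        sign L S.* Q S.^ jacobi-offset L S.* (P L S.* P L S.* P L)
      ≈⟨ ≈ₛ⇒≈[<] (jacobi-finite Q L′) ⟩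
        S.antidiag n (λ a b → X a b S.* (c a b S.* Q S.^ jacobi-exponent L a b))
      ≈⟨ ≈ₛ⇒≈[<] (S.antidiag-cong n λ a b _ → S.*-congˡ {X a b} (S.*-congˡ {c a b} (S.^-assocʳ q d (jacobi-exponent L a b)))) ⟩
        S.antidiag n (λ a b → X a b S.* (c a b S.* q S.^ (d ℕ.* jacobi-exponent L a b)))
      ≈⟨ antidiag-≈[<]-monomials n X c (λ a b → d ℕ.* jacobi-exponent L a b) term-bound ⟩
        S.antidiag n (λ a b → c a b S.* q S.^ (d ℕ.* jacobi-exponent L a b))
      ≈⟨ ≈ₛ⇒≈[<] (antidiag-monomials-offset n c _ (λ a b → d ℕ.* reduced a b) (d ℕ.* jacobi-offset L) exponent≡) ⟩
        q S.^ (d ℕ.* jacobi-offset L) S.* jacobi-sum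
      ∎)
      where open ≈[<]-Reasoning (d ℕ.* jacobi-offset L ℕ.+ d ℕ.* K)

  module TruncatedEuler (d : ℕ) (1≤d : 1 ≤ d) (L K : ℕ) (2K≤L : K ℕ.+ K ≤ L) where
    open PochhammerTruncation d 1≤d
    private
      module P₃ = PochhammerTruncation (3 ℕ.* d) (ℕ.≤-trans 1≤d (ℕ.m≤n*m d 3))
    open FiniteJacobiEuler series using (euler-finite)

    M n : ℕ
    M = suc L
    n = M ℕ.+ M

    reduced : ℕ → ℕ → ℕ
    reduced a b = euler-exponent L a b ∸ euler-offset L

    euler-sum : Series
    euler-sum = S.antidiag n (λ a b → sign a S.* q S.^ (d ℕ.* reduced a b))

    private
      X c : ℕ → ℕ → Series
      X a b = S.poch (Q S.^ 3) M S.* S.qbinom (Q S.^ 3) a b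
      c a b = sign a

      Q³≈ : Q S.^ 3 ≈ₛ P₃.Q
      Q³≈ = S.trans (S.^-assocʳ q d 3) (S.^-congʳ q (ℕ.*-comm d 3))

      offset≤exponent : ∀ a b → a ℕ.+ b ≡ n → euler-offset L ≤ euler-exponent L a b
      offset≤exponent a b a+b≡ = ≡.subst (euler-offset L ≤_) (≡.sym (EulerTerm.exponent (eulerTerm L a b a+b≡))) (ℕ.m≤m+n _ _)

      exponent≡ : ∀ a b → a ℕ.+ b ≡ n → d ℕ.* euler-exponent L a b ≡ d ℕ.* euler-offset L ℕ.+ d ℕ.* reduced a b
      exponent≡ a b a+b≡ = ≡.trans (≡.cong (d ℕ.*_) (≡.sym (ℕ.m+[n∸m]≡n (offset≤exponent a b a+b≡)))) (ℕ.*-distribˡ-+ d _ _)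

      term-bound : ∀ a b → a ℕ.+ b ≡ n → NearOrFar (d ℕ.* euler-offset L ℕ.+ d ℕ.* K) (X a b) (d ℕ.* euler-exponent L a b)
      term-bound a b a+b≡ = near-or-far d K a b (euler-offset L) (euler-exponent L a b) (offset≤exponent a b a+b≡) far′ λ K≤a K≤b →
        ≈[<]-weaken (ℕ.*-monoˡ-≤ (suc K) (ℕ.m≤n*m d 3))
          (≈[<]-trans (≈ₛ⇒≈[<] (S.*-cong (S.poch-cong Q³≈ M) (S.qbinom-cong Q³≈ a b)))
                      (P₃.P*qbinom≈[<]1 K a b M K≤a K≤b (ℕ.≤-trans (ℕ.≤-trans (ℕ.m≤m+n K K) 2K≤L) (ℕ.n≤1+n L))))
        where
        open EulerTerm (eulerTerm L a b a+b≡)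
        far′ : a < K ⊎ b < K → euler-offset L ℕ.+ K ≤ euler-exponent L a b
        far′ a<K⊎b<K = ≡.subst (euler-offset L ℕ.+ K ≤_) (≡.sym exponent) (ℕ.+-monoʳ-≤ (euler-offset L) (far K 2K≤L a<K⊎b<K))

    euler-truncated : sign M S.* S.poch Q (3 ℕ.* M) ≈[< d ℕ.* K ] euler-sum
    euler-truncated = ≈[<]-cancel-q^ (d ℕ.* euler-offset L) _ euler-sum (begin
        q S.^ (d ℕ.* euler-offset L) S.* (sign M S.* S.poch Q (3 ℕ.* M))
      ≈⟨ ≈ₛ⇒≈[<] (S.solve 3 (λ x s c → x S.:* (s S.:* c) S.:= s S.:* x S.:* c) S.refl _ (sign M) (S.poch Q (3 ℕ.* M))) ⟩
        sign M S.* q S.^ (d ℕ.* euler-offset L) S.* S.poch Q (3 ℕ.* M)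
      ≈⟨ ≈ₛ⇒≈[<] (S.*-congʳ (S.*-congˡ {sign M} (S.^-assocʳ q d (euler-offset L)))) ⟨
        sign M S.* Q S.^ euler-offset L S.* S.poch Q (3 ℕ.* M)
      ≈⟨ ≈ₛ⇒≈[<] (euler-finite Q L) ⟩
        S.antidiag n (λ a b → X a b S.* (c a b S.* Q S.^ euler-exponent L a b))
      ≈⟨ ≈ₛ⇒≈[<] (S.antidiag-cong n λ a b _ → S.*-congˡ {X a b} (S.*-congˡ {c a b} (S.^-assocʳ q d (euler-exponent L a b)))) ⟩
        S.antidiag n (λ a b → X a b S.* (c a b S.* q S.^ (d ℕ.* euler-exponent L a b)))
      ≈⟨ antidiag-≈[<]-monomials n X c (λ a b → d ℕ.* euler-exponent L a b) term-bound ⟩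
        S.antidiag n (λ a b → c a b S.* q S.^ (d ℕ.* euler-exponent L a b))
      ≈⟨ ≈ₛ⇒≈[<] (antidiag-monomials-offset n c _ (λ a b → d ℕ.* reduced a b) (d ℕ.* euler-offset L) exponent≡) ⟩
        q S.^ (d ℕ.* euler-offset L) S.* euler-sum
      ∎)
      where open ≈[<]-Reasoning (d ℕ.* euler-offset L ℕ.+ d ℕ.* K)

module Partitions where
  open import Data.Bool using (Bool; true; false; if_then_else_)
  open import Data.Nat as ℕ using (ℕ; zero; suc; _≤_; z≤n; _<ᵇ_; _∸_)
  import Data.Nat.Properties as ℕ
  open import Data.Integer as ℤ using (ℤ; +_)
  import Data.Integer.Properties as ℤ
  open import Relation.Binary.PropositionalEquality as ≡ using (_≡_)
  open import Defs
  open PowerSeries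

  module PartitionSeries (r s : ℕ) where

    mutual
      Q-fuel : ∀ f g m n → n ≤ f → n ≤ g → Q r s f m n ≡ Q r s g m n
      Q-fuel f g zero    n _ _ = ≡.refl
      Q-fuel f g (suc m) n n≤f n≤g = R-fuel f g (suc m) (colors r s (suc m)) n n≤f n≤g

      R-fuel : ∀ f g m c n → n ≤ f → n ≤ g → R r s f m c n ≡ R r s g m c n
      R-fuel f g zero c n _ _ = ≡.refl
      R-fuel f g (suc m) zero n n≤f n≤g = Q-fuel f g m n n≤f n≤g
      R-fuel zero zero (suc m) (suc c) n _ _ = ≡.refl
      R-fuel zero (suc g) (suc m) (suc c) .zero z≤n n≤g =
        ≡.trans (R-fuel zero (suc g) (suc m) c 0 z≤n n≤g) (≡.sym (ℕ.+-identityʳ _))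
      R-fuel (suc f) zero (suc m) (suc c) .zero n≤f z≤n =
        ≡.trans (ℕ.+-identityʳ _) (R-fuel (suc f) zero (suc m) c 0 n≤f z≤n)
      R-fuel (suc f) (suc g) (suc m) (suc c) n n≤f n≤g =
        ≡.cong₂ ℕ._+_ (R-fuel (suc f) (suc g) (suc m) c n n≤f n≤g)
          (≡.cong (λ z → if n <ᵇ suc m then 0 else z) (R-fuel f g (suc m) (suc c) (n ∸ suc m) (remaining f n≤f) (remaining g n≤g)))
        where
        remaining : ∀ f → n ≤ suc f → n ∸ suc m ≤ f
        remaining f n≤f = ℕ.≤-trans (ℕ.∸-monoˡ-≤ (suc m) n≤f) (ℕ.m∸n≤m f m)

    -- Q r s f m n counts the partitions of n into parts ≤ m as soon as the fuel f is at least n;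
    -- in particular partitions n n ≡ + a r s n.
    partitions : ℕ → Series
    partitions m n = + Q r s n m n

    partitions-with : ℕ → ℕ → Series
    partitions-with m c n = + R r s n m c n

    partitions-≤0 : partitions 0 ≈ₛ S.1#
    partitions-≤0 = mk λ where
      zero    → ≡.refl
      (suc n) → ≡.refl

    one-more-color : ∀ m c → partitions-with (suc m) (suc c) S.- shift (suc m) (partitions-with (suc m) (suc c)) ≈ₛ partitions-with (suc m) c
    one-more-color m c = mk coeff
      where
      cancel : ∀ n b → + (R r s (suc n) (suc m) c (suc n) ℕ.+ (if b then 0 else R r s n (suc m) (suc c) (n ∸ m)))
                       ℤ.- (if b then + 0 else partitions-with (suc m) (suc c) (n ∸ m)) ≡ + R r s (suc n) (suc m) c (suc n)
      cancel n true  = ≡.trans (≡.cong (λ z → + z ℤ.- + 0) (ℕ.+-identityʳ _)) (ℤ.+-identityʳ _)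
      cancel n false = begin
        + (X ℕ.+ R r s n (suc m) (suc c) (n ∸ m)) ℤ.- Y
          ≡⟨ ≡.cong (λ z → + (X ℕ.+ z) ℤ.- Y) (R-fuel n (n ∸ m) (suc m) (suc c) (n ∸ m) (ℕ.m∸n≤m n m) ℕ.≤-refl) ⟩
        + (X ℕ.+ R r s (n ∸ m) (suc m) (suc c) (n ∸ m)) ℤ.- Y   ≡⟨ ≡.cong (ℤ._- Y) (ℤ.pos-+ X _) ⟩
        + X ℤ.+ Y ℤ.- Y                                          ≡⟨ ℤ.+-assoc (+ X) Y (ℤ.- Y) ⟩
        + X ℤ.+ (Y ℤ.- Y)                                        ≡⟨ ≡.cong (λ z → + X ℤ.+ z) (ℤ.+-inverseʳ Y) ⟩
        + X ℤ.+ + 0                                              ≡⟨ ℤ.+-identityʳ (+ X) ⟩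
        + X                                                      ∎
        where
        open ≡.≡-Reasoning
        X : ℕ
        X = R r s (suc n) (suc m) c (suc n)
        Y : ℤ
        Y = partitions-with (suc m) (suc c) (n ∸ m)
      coeff : ∀ n → (partitions-with (suc m) (suc c) S.- shift (suc m) (partitions-with (suc m) (suc c))) n ≡ partitions-with (suc m) c n
      coeff zero    = ℤ.+-identityʳ _
      coeff (suc n) = ≡.trans (≡.cong (λ z → partitions-with (suc m) (suc c) (suc n) ℤ.- z) (shift-if (suc m) _ (suc n)))
                              (cancel n (n <ᵇ m))

    factor*-≈shift : ∀ i f → factor i S.* f ≈ₛ f S.- shift (suc i) f
    factor*-≈shift i f = S.trans (S.solve 2 (λ x g → (S.con (+ 1) S.:- x) S.:* g S.:= g S.:- x S.:* g) S.refl (q S.^ suc i) f)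
      (S.+-congˡ {f} (S.-‿cong (q^*-shift (suc i) f)))

    remove-colors : ∀ m c → factor m S.^ c S.* partitions-with (suc m) c ≈ₛ partitions m
    remove-colors m zero    = S.*-identityˡ (partitions-with (suc m) zero)
    remove-colors m (suc c) = S.trans (S.*-congʳ (S.*-comm (factor m) (factor m S.^ c)))
      (S.trans (S.*-assoc (factor m S.^ c) (factor m) _)
      (S.trans (S.*-congˡ {factor m S.^ c} (S.trans (factor*-≈shift m _) (one-more-color m c))) (remove-colors m c)))

    euler-product : ℕ → Series
    euler-product M = S.∏[ i < M ] (factor i S.^ colors r s (suc i))

    euler-product*partitions : ∀ M → euler-product M S.* partitions M ≈ₛ S.1#
    euler-product*partitions zero    = S.trans (S.*-identityˡ (partitions 0)) partitions-≤0
    euler-product*partitions (suc M) = S.trans (S.*-assoc (euler-product M) _ (partitions (suc M)))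
      (S.trans (S.*-congˡ {euler-product M} (remove-colors M (colors r s (suc M)))) (euler-product*partitions M))

module Primes where
  open import Data.Nat as ℕ using (ℕ; zero; suc; _≤_; _<_; s≤s; z≤n; _∸_)
  import Data.Nat.Properties as ℕ
  import Data.Nat.Divisibility as ℕ
  open import Data.Nat.Primality using (Prime; euclidsLemma; prime⇒nonTrivial)
  open import Data.Integer as ℤ using (ℤ; +_; ∣_∣)
  import Data.Integer.Properties as ℤ
  open import Data.Integer.Divisibility.Signed
    using (∣ᵤ⇒∣; ∣⇒∣ᵤ; _∣?_; ∣-refl; ∣m∣n⇒∣m+n; ∣m∣n⇒∣m-n; ∣n⇒∣m*n; ∣m⇒∣m*n)
    renaming (_∣_ to _∣ℤ_)
  open import Data.Sum using (_⊎_; inj₁; inj₂; [_,_]′)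
  open import Function using (id; _∘_)
  open import Data.Empty using (⊥-elim)
  open import Relation.Nullary using (¬_; yes; no)
  open import Relation.Binary.PropositionalEquality as ≡ using (_≡_)
  open PowerSeries using (module Z)

  open Z using (solve; _:=_; _:+_; _:*_; :-_; _:-_; con; _^_)

  module PrimeDivisibility (p : ℕ) (p-prime : Prime p) where

    p∣_ : ℤ → Set
    p∣ x = + p ∣ℤ x

    1<p : 1 < p
    1<p = ℕ.nonTrivial⇒n>1 p {{prime⇒nonTrivial p-prime}}

    p≡2+p-2 : p ≡ suc (suc (p ∸ 2))
    p≡2+p-2 = ≡.sym (ℕ.m+[n∸m]≡n 1<p)

    p∣-cong : ∀ {x y} → x ≡ y → p∣ x → p∣ y
    p∣-cong ≡.refl p∣x = p∣x

    p∣0 : p∣ (+ 0)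
    p∣0 = ∣ᵤ⇒∣ (ℕ._∣0 p)

    p∣-* : ∀ x y → p∣ (x ℤ.* y) → p∣ x ⊎ p∣ y
    p∣-* x y p∣xy with euclidsLemma ∣ x ∣ ∣ y ∣ p-prime (≡.subst (p ℕ.∣_) (ℤ.abs-* x y) (∣⇒∣ᵤ p∣xy))
    ... | inj₁ p∣x = inj₁ (∣ᵤ⇒∣ p∣x)
    ... | inj₂ p∣y = inj₂ (∣ᵤ⇒∣ p∣y)

    p∤-below : ∀ n → 1 ≤ n → n < p → ¬ p∣ (+ n)
    p∤-below n 1≤n n<p p∣n = ℕ.<-irrefl ≡.refl (ℕ.<-≤-trans n<p (ℕ.∣⇒≤ {{ℕ.>-nonZero 1≤n}} (∣⇒∣ᵤ p∣n)))

    p∣-^ : ∀ x n → p∣ (x ^ n) → p∣ x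
    p∣-^ x zero    p∣1 = ⊥-elim (p∤-below 1 ℕ.≤-refl 1<p p∣1)
    p∣-^ x (suc n) p∣x^n with p∣-* x (x ^ n) p∣x^n
    ... | inj₁ p∣x   = p∣x
    ... | inj₂ p∣x^n = p∣-^ x n p∣x^n

    p∣-antidiag : ∀ n F → (∀ a b → a ℕ.+ b ≡ n → p∣ F a b) → p∣ Z.antidiag n F
    p∣-antidiag zero    F p∣F = p∣F 0 0 ≡.refl
    p∣-antidiag (suc n) F p∣F = ∣m∣n⇒∣m+n (p∣F 0 (suc n) ≡.refl) (p∣-antidiag n _ (λ a b e → p∣F (suc a) b (≡.cong suc e)))

    private
      qint-1 : ∀ k → Z.qint (+ 1) k ≡ + k
      qint-1 zero    = ≡.refl
      qint-1 (suc k) = ≡.cong (λ z → + 1 ℤ.+ z) (≡.trans (ℤ.*-identityˡ _) (qint-1 k))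

      p∤factorial : ∀ a → a < p → ¬ p∣ Z.qfac (+ 1) a
      p∤factorial zero    a<p p∣1 = p∤-below 1 ℕ.≤-refl 1<p p∣1
      p∤factorial (suc a) a<p p∣a! with p∣-* (Z.qfac (+ 1) a) (Z.qint (+ 1) (suc a)) p∣a!
      ... | inj₁ p∣ = p∤factorial a (ℕ.<-trans (ℕ.n<1+n a) a<p) p∣
      ... | inj₂ p∣ = p∤-below (suc a) (s≤s z≤n) a<p (p∣-cong (qint-1 (suc a)) p∣)

      p∣p! : p∣ Z.qfac (+ 1) p
      p∣p! = ≡.subst (λ n → p∣ Z.qfac (+ 1) n) (≡.sym p≡2+p-2)
        (∣n⇒∣m*n (Z.qfac (+ 1) (suc (p ∸ 2))) (p∣-cong (≡.sym (≡.trans (qint-1 _) (≡.cong +_ (≡.sym p≡2+p-2)))) ∣-refl))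

    p∣binomial : ∀ a b → suc a ℕ.+ suc b ≡ p → p∣ Z.qbinom (+ 1) (suc a) (suc b)
    p∣binomial a b a+b≡p =
      [ id , (λ p∣a!b! → ⊥-elim ([ p∤a! , p∤b! ]′ (p∣-* a! b! p∣a!b!))) ]′ (p∣-* binom (a! ℤ.* b!) p∣product)
      where
      binom a! b! : ℤ
      binom = Z.qbinom (+ 1) (suc a) (suc b)
      a! = Z.qfac (+ 1) (suc a)
      b! = Z.qfac (+ 1) (suc b)
      p∣product : p∣ (binom ℤ.* (a! ℤ.* b!))
      p∣product = p∣-cong (≡.sym (Z.qbinom-qfac (+ 1) (suc a) (suc b))) (≡.subst (λ n → p∣ Z.qfac (+ 1) n) (≡.sym a+b≡p) p∣p!)
      p∤a! : ¬ p∣ a!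
      p∤a! = p∤factorial (suc a) (≡.subst (suc a <_) a+b≡p (ℕ.m<m+n (suc a) (s≤s z≤n)))
      p∤b! : ¬ p∣ b!
      p∤b! = p∤factorial (suc b) (≡.subst (suc b <_) a+b≡p (ℕ.m<n+m (suc b) (s≤s z≤n)))

    frobenius : ∀ x y → p∣ ((x ℤ.+ y) ^ p ℤ.- x ^ p ℤ.- y ^ p)
    frobenius x y = ≡.subst (λ n → p∣ ((x ℤ.+ y) ^ n ℤ.- x ^ n ℤ.- y ^ n)) (≡.sym p≡2+p-2) (p∣-cong middle≡ p∣middle)
      where
      n : ℕ
      n = p ∸ 2
      F : ℕ → ℕ → ℤ
      F = Z.rothe-term (+ 1) x y
      middle : ℤ
      middle = Z.antidiag n (λ a b → F (suc a) (suc b))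
      p∣middle : p∣ middle
      p∣middle = p∣-antidiag n _ λ a b a+b≡n → ∣m⇒∣m*n (x ^ suc b) (∣m⇒∣m*n (y ^ suc a) (∣m⇒∣m*n ((+ 1) ^ tri (suc a))
        (p∣binomial a b (≡.trans (ℕ.+-suc (suc a) b) (≡.trans (≡.cong (λ k → suc (suc k)) a+b≡n) (≡.sym p≡2+p-2))))))
      expand : (x ℤ.+ y) ^ suc (suc n) ≡ F 0 (suc (suc n)) ℤ.+ (middle ℤ.+ F (suc (suc n)) 0)
      expand = ≡.trans (≡.sym (Z.∏-const (suc (suc n)) (x ℤ.+ y)))
        (≡.trans (Z.∏-cong (suc (suc n)) (λ i _ →
                   ≡.cong (λ z → x ℤ.+ z) (≡.trans (≡.sym (ℤ.*-identityʳ y)) (≡.cong (y ℤ.*_) (≡.sym (Z.1^n≈1 i))))))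
        (≡.trans (Z.rothe (+ 1) x y (suc (suc n))) (≡.cong (λ z → F 0 (suc (suc n)) ℤ.+ z) (Z.antidiag-last n (λ a b → F (suc a) b)))))
      first : F 0 (suc (suc n)) ≡ x ^ suc (suc n)
      first = solve 1 (λ u → con (+ 1) :* con (+ 1) :* con (+ 1) :* u := u) ≡.refl (x ^ suc (suc n))
      last : F (suc (suc n)) 0 ≡ y ^ suc (suc n)
      last = ≡.trans (≡.cong (λ z → + 1 ℤ.* z ℤ.* y ^ suc (suc n) ℤ.* + 1) (Z.1^n≈1 (tri (suc (suc n)))))
               (solve 1 (λ u → con (+ 1) :* con (+ 1) :* u :* con (+ 1) := u) ≡.refl (y ^ suc (suc n)))
      middle≡ : middle ≡ (x ℤ.+ y) ^ suc (suc n) ℤ.- x ^ suc (suc n) ℤ.- y ^ suc (suc n)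
      middle≡ = ≡.sym (≡.trans (≡.cong (λ z → z ℤ.- x ^ suc (suc n) ℤ.- y ^ suc (suc n)) expand)
        (≡.trans (≡.cong₂ (λ u v → u ℤ.+ (middle ℤ.+ v) ℤ.- x ^ suc (suc n) ℤ.- y ^ suc (suc n)) first last)
          (solve 3 (λ u d v → u :+ (d :+ v) :- u :- v := d) ≡.refl (x ^ suc (suc n)) middle (y ^ suc (suc n)))))

    private
      fermat⁺ : ∀ n → p∣ ((+ n) ^ p ℤ.- + n)
      fermat⁺ zero    = p∣-cong (≡.sym (≡.cong (ℤ._- + 0) (≡.subst (λ k → (+ 0) ^ k ≡ + 0) (≡.sym p≡2+p-2) ≡.refl))) p∣0
      fermat⁺ (suc n) = p∣-cong step (∣m∣n⇒∣m+n (frobenius (+ 1) (+ n)) (fermat⁺ n))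
        where
        step : ((+ 1 ℤ.+ + n) ^ p ℤ.- (+ 1) ^ p ℤ.- (+ n) ^ p) ℤ.+ ((+ n) ^ p ℤ.- + n) ≡ (+ suc n) ^ p ℤ.- + suc n
        step = ≡.trans (≡.cong (λ z → ((+ suc n) ^ p ℤ.- z ℤ.- (+ n) ^ p) ℤ.+ ((+ n) ^ p ℤ.- + n)) (Z.1^n≈1 p))
          (solve 3 (λ a b c → (a :- con (+ 1) :- b) :+ (b :- c) := a :- (con (+ 1) :+ c)) ≡.refl ((+ suc n) ^ p) ((+ n) ^ p) (+ n))

    fermat : ∀ x → p∣ (x ^ p ℤ.- x)
    fermat (+ n)      = fermat⁺ n
    fermat ℤ.-[1+ n ] = p∣-cong step (∣m∣n⇒∣m-n (∣m∣n⇒∣m-n (p∣-cong (≡.sym 0^p) p∣0) (frobenius a (ℤ.- a))) (fermat⁺ (suc n)))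
      where
      a : ℤ
      a = + suc n
      0^p : (a ℤ.+ ℤ.- a) ^ p ≡ + 0
      0^p = ≡.trans (≡.cong (_^ p) (ℤ.+-inverseʳ a)) (≡.subst (λ k → (+ 0) ^ k ≡ + 0) (≡.sym p≡2+p-2) ≡.refl)
      step : ((a ℤ.+ ℤ.- a) ^ p ℤ.- ((a ℤ.+ ℤ.- a) ^ p ℤ.- a ^ p ℤ.- (ℤ.- a) ^ p)) ℤ.- (a ^ p ℤ.- a) ≡ (ℤ.- a) ^ p ℤ.- ℤ.- a
      step = solve 4 (λ z u v w → (z :- (z :- u :- v)) :- (u :- w) := v :- (:- w)) ≡.refl ((a ℤ.+ ℤ.- a) ^ p) (a ^ p) ((ℤ.- a) ^ p) a

    fermat′ : ∀ x → ¬ p∣ x → p∣ (x ^ (p ∸ 1) ℤ.- + 1)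
    fermat′ x p∤x = [ (λ p∣x → ⊥-elim (p∤x p∣x)) , id ]′ (p∣-* x (x ^ (p ∸ 1) ℤ.- + 1) (p∣-cong factor (fermat x)))
      where
      factor : x ^ p ℤ.- x ≡ x ℤ.* (x ^ (p ∸ 1) ℤ.- + 1)
      factor = ≡.trans (≡.cong (λ n → x ^ n ℤ.- x) (≡.sym (ℕ.m+[n∸m]≡n {1} {p} (ℕ.<⇒≤ 1<p))))
        (solve 2 (λ a b → b :* a :- b := b :* (a :- con (+ 1))) ≡.refl (x ^ (p ∸ 1)) x)

    p∣-^-cong : ∀ a b n → p∣ (a ℤ.- b) → p∣ (a ^ n ℤ.- b ^ n)
    p∣-^-cong a b zero    _  = p∣-cong (≡.sym (ℤ.+-inverseʳ (+ 1))) p∣0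
    p∣-^-cong a b (suc n) p∣ = p∣-cong step (∣m∣n⇒∣m+n (∣n⇒∣m*n a (p∣-^-cong a b n p∣)) (∣m⇒∣m*n (b ^ n) p∣))
      where
      step : a ℤ.* (a ^ n ℤ.- b ^ n) ℤ.+ (a ℤ.- b) ℤ.* b ^ n ≡ a ℤ.* a ^ n ℤ.- b ℤ.* b ^ n
      step = solve 4 (λ x y a b → a :* (x :- y) :+ (a :- b) :* y := a :* x :- b :* y) ≡.refl (a ^ n) (b ^ n) a b

  module TwoModThree (p m : ℕ) (p-prime : Prime p) (p≡ : p ≡ 3 ℕ.* suc m ℕ.+ 2) where
    open PrimeDivisibility p p-prime

    private
      p-1≡ : p ∸ 1 ≡ 3 ℕ.* suc m ℕ.+ 1
      p-1≡ = ≡.trans (≡.cong (_∸ 1) p≡) (ℕ.+-∸-assoc (3 ℕ.* suc m) {2} {1} (s≤s z≤n))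

      5≤p : 5 ≤ p
      5≤p = ≡.subst (5 ≤_) (≡.sym p≡) (ℕ.+-monoˡ-≤ 2 (ℕ.m≤m*n 3 (suc m)))

      cube-root : ∀ x → x ^ (p ∸ 1) ≡ (x ^ 3) ^ suc m ℤ.* x
      cube-root x = ≡.trans (≡.cong (x ^_) p-1≡)
        (≡.trans (Z.^-homo-* x (3 ℕ.* suc m) 1) (≡.cong₂ ℤ._*_ (≡.sym (Z.^-assocʳ x 3 (suc m))) (ℤ.*-identityʳ x)))

    p∤ : ∀ n → 1 ≤ n → n < 5 → ¬ p∣ (+ n)
    p∤ n 1≤n n<5 = p∤-below n 1≤n (ℕ.<-≤-trans n<5 5≤p)

    -- As 3 ∤ p - 1, cubing is injective modulo p: x^(p-1) = (x³)^(m+1) · x.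
    cube-injective : ∀ u w → p∣ (u ^ 3 ℤ.- w ^ 3) → p∣ (u ℤ.- w)
    cube-injective u w p∣u³-w³ with + p ∣? w
    ... | yes p∣w = ∣m∣n⇒∣m-n (p∣-^ u 3 (p∣-cong (solve 2 (λ a b → (a :- b) :+ b := a) ≡.refl (u ^ 3) (w ^ 3))
                                 (∣m∣n⇒∣m+n p∣u³-w³ (∣m⇒∣m*n (w ^ 2) p∣w)))) p∣w
    ... | no p∤w = [ (λ p∣V → ⊥-elim (p∤ 1 ℕ.≤-refl (s≤s (s≤s z≤n)) (p∣-cong inverse (∣m∣n⇒∣m-n (∣m⇒∣m*n w p∣V) wV≡1))))
                   , id ]′
                     (p∣-* V (u ℤ.- w) (p∣-cong regroup
                       (∣m∣n⇒∣m-n (∣m∣n⇒∣m-n uU≡1 (∣m⇒∣m*n u (p∣-^-cong (u ^ 3) (w ^ 3) (suc m) p∣u³-w³))) wV≡1)))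
      where
      U V : ℤ
      U = (u ^ 3) ^ suc m
      V = (w ^ 3) ^ suc m
      p∤u : ¬ p∣ u
      p∤u p∣u = p∤w (p∣-^ w 3 (p∣-cong (solve 2 (λ a b → a :- (a :- b) := b) ≡.refl (u ^ 3) (w ^ 3))
                      (∣m∣n⇒∣m-n (∣m⇒∣m*n (u ^ 2) p∣u) p∣u³-w³)))
      uU≡1 : p∣ (U ℤ.* u ℤ.- + 1)
      uU≡1 = p∣-cong (≡.cong (ℤ._- + 1) (cube-root u)) (fermat′ u p∤u)
      wV≡1 : p∣ (V ℤ.* w ℤ.- + 1)
      wV≡1 = p∣-cong (≡.cong (ℤ._- + 1) (cube-root w)) (fermat′ w p∤w)
      regroup : (U ℤ.* u ℤ.- + 1) ℤ.- (U ℤ.- V) ℤ.* u ℤ.- (V ℤ.* w ℤ.- + 1) ≡ V ℤ.* (u ℤ.- w)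
      regroup = solve 4 (λ U V u w → (U :* u :- con (+ 1)) :- (U :- V) :* u :- (V :* w :- con (+ 1)) := V :* (u :- w)) ≡.refl U V u w
      inverse : V ℤ.* w ℤ.- (V ℤ.* w ℤ.- + 1) ≡ + 1
      inverse = solve 1 (λ a → a :- (a :- con (+ 1)) := con (+ 1)) ≡.refl (V ℤ.* w)

    p∣x²+3y²⇒p∣y : ∀ x y → p∣ (x ℤ.* x ℤ.+ + 3 ℤ.* (y ℤ.* y)) → p∣ y
    p∣x²+3y²⇒p∣y x y p∣x²+3y² =
      [ [ (λ p∣12 → ⊥-elim ([ p∤3 , p∤4 ]′ (p∣-* (+ 3) (+ 4) p∣12))) , id ]′ ∘ p∣-* (+ 12) y , id ]′
      (p∣-* (+ 12 ℤ.* y) y (p∣-cong twelve (∣m∣n⇒∣m-n p∣x²+3y² (∣m⇒∣m*n (x ℤ.+ + 3 ℤ.* y) x≡3y))))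
      where
      p∤3 : ¬ p∣ (+ 3)
      p∤3 = p∤ 3 (s≤s z≤n) (s≤s (s≤s (s≤s (s≤s z≤n))))
      p∤4 : ¬ p∣ (+ 4)
      p∤4 = p∤ 4 (s≤s z≤n) (s≤s (s≤s (s≤s (s≤s (s≤s z≤n)))))
      cubes : (x ℤ.- + 3 ℤ.* y) ℤ.* (x ℤ.* x ℤ.+ + 3 ℤ.* (y ℤ.* y)) ≡ (x ℤ.- y) ^ 3 ℤ.- (+ 2 ℤ.* y) ^ 3
      cubes = solve 2 (λ x y → (x :- con (+ 3) :* y) :* (x :* x :+ con (+ 3) :* (y :* y))
                 := (x :- y) :* ((x :- y) :* ((x :- y) :* con (+ 1))) :- con (+ 2) :* y :* (con (+ 2) :* y :* (con (+ 2) :* y :* con (+ 1)))) ≡.refl x y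
      x≡3y : p∣ (x ℤ.- + 3 ℤ.* y)
      x≡3y = p∣-cong (solve 2 (λ x y → (x :- y) :- con (+ 2) :* y := x :- con (+ 3) :* y) ≡.refl x y)
        (cube-injective (x ℤ.- y) (+ 2 ℤ.* y) (p∣-cong cubes (∣n⇒∣m*n (x ℤ.- + 3 ℤ.* y) p∣x²+3y²)))
      twelve : x ℤ.* x ℤ.+ + 3 ℤ.* (y ℤ.* y) ℤ.- (x ℤ.- + 3 ℤ.* y) ℤ.* (x ℤ.+ + 3 ℤ.* y) ≡ + 12 ℤ.* y ℤ.* y
      twelve = solve 2 (λ x y → x :* x :+ con (+ 3) :* (y :* y) :- (x :- con (+ 3) :* y) :* (x :+ con (+ 3) :* y) := con (+ 12) :* y :* y) ≡.refl x y

module Sparse where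
  open import Data.Nat as ℕ using (ℕ; zero; suc)
  import Data.Nat.Properties as ℕ
  import Data.Nat.Divisibility as ℕ
  open import Data.Nat.Primality using (Prime)
  open import Data.Integer as ℤ using (ℤ; +_)
  import Data.Integer.Properties as ℤ
  open import Data.Integer.Divisibility.Signed using (∣m⇒∣m*n; ∣n⇒∣m*n; ∣m+n∣m⇒∣n)
  open import Data.Product using (_×_; _,_; proj₁; proj₂)
  open import Data.Nat.Induction using (<-rec)
  open import Data.Nat.Tactic.RingSolver using (solve-∀)
  open import Data.Sum using (_⊎_; inj₁; inj₂)
  open import Data.Empty using (⊥-elim)
  open import Relation.Nullary using (¬_; yes; no)
  open import Relation.Binary.PropositionalEquality as ≡ using (_≡_)
  open PowerSeries
  open Primes

  monomial-coeff : ∀ E c n → (n ≡ E × shift E (C c) n ≡ c) ⊎ shift E (C c) n ≡ + 0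
  monomial-coeff zero    c zero    = inj₁ (≡.refl , ≡.refl)
  monomial-coeff zero    c (suc n) = inj₂ ≡.refl
  monomial-coeff (suc E) c zero    = inj₂ ≡.refl
  monomial-coeff (suc E) c (suc n) with monomial-coeff E c n
  ... | inj₁ (n≡E , coeff≡c) = inj₁ (≡.cong suc n≡E , coeff≡c)
  ... | inj₂ coeff≡0         = inj₂ coeff≡0

  C*q^≈shift : ∀ c E → C c S.* q S.^ E ≈ₛ shift E (C c)
  C*q^≈shift c E = S.trans (S.*-comm (C c) (q S.^ E)) (q^*-shift E (C c))

  qbinom-1≈C : ∀ a b → S.qbinom S.1# a b ≈ₛ C (Z.qbinom (+ 1) a b)
  qbinom-1≈C zero    b       = S.refl
  qbinom-1≈C (suc a) zero    = S.refl
  qbinom-1≈C (suc a) (suc b) = S.trans (S.+-cong (qbinom-1≈C (suc a) b) (S.*-cong (C-^ (+ 1) (suc b)) (qbinom-1≈C a (suc b))))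
    (S.trans (S.+-congˡ {C (Z.qbinom (+ 1) (suc a) b)} (C-* ((+ 1) Z.^ suc b) (Z.qbinom (+ 1) a (suc b))))
    (C-+ (Z.qbinom (+ 1) (suc a) b) ((+ 1) Z.^ suc b ℤ.* Z.qbinom (+ 1) a (suc b))))

  module SparseModulo (p : ℕ) (p-prime : Prime p) where
    open PrimeDivisibility p p-prime

    -- f ≡ g(qᵖ) (mod p) for some series g.
    Sparse : Series → Set
    Sparse f = ∀ n → ¬ p ℕ.∣ n → p∣ f n

    Sparse-cong : ∀ {f g} → f ≈ₛ g → Sparse f → Sparse g
    Sparse-cong f≈g sparse n p∤n = p∣-cong (at f≈g n) (sparse n p∤n)

    Sparse-1 : Sparse S.1#
    Sparse-1 zero    p∤0 = ⊥-elim (p∤0 (p ℕ.∣0))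
    Sparse-1 (suc n) _   = p∣0

    Sparse-* : ∀ {f g} → Sparse f → Sparse g → Sparse (f S.* g)
    Sparse-* {f} {g} sparse-f sparse-g n p∤n = p∣-antidiag n _ term
      where
      term : ∀ a b → a ℕ.+ b ≡ n → p∣ (f a ℤ.* g b)
      term a b a+b≡n with p ℕ.∣? a
      ... | no  p∤a = ∣m⇒∣m*n (g b) (sparse-f a p∤a)
      ... | yes p∣a = ∣n⇒∣m*n (f a) (sparse-g b (λ p∣b → p∤n (≡.subst (p ℕ.∣_) a+b≡n (ℕ.∣m∣n⇒∣m+n p∣a p∣b))))

    Sparse-∏ : ∀ k f → (∀ i → Sparse (f i)) → Sparse (S.∏ k f)
    Sparse-∏ zero    f sparse = Sparse-1
    Sparse-∏ (suc k) f sparse = Sparse-* (Sparse-∏ k f sparse) (sparse k)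

    Sparse-^ : ∀ k {f} → Sparse f → Sparse (f S.^ k)
    Sparse-^ k {f} sparse = Sparse-cong (S.∏-const k f) (Sparse-∏ k (λ _ → f) (λ _ → sparse))

    -- Expand by Rothe's theorem at q = 1; the binomial coefficients strictly inside are divisible by p.
    Sparse-frobenius : ∀ i → Sparse ((S.1# S.- q S.^ i) S.^ p)
    Sparse-frobenius i = Sparse-cong (S.sym expand) sparse-sum
      where
      y : Series
      y = S.- q S.^ i
      sign : ℕ → ℤ
      sign a = ℤ.-1ℤ Z.^ a
      c : ℕ → ℕ → ℤ
      c a b = Z.qbinom (+ 1) a b ℤ.* sign a
      expand : (S.1# S.- q S.^ i) S.^ p ≈ₛ S.antidiag p (λ a b → shift (i ℕ.* a) (C (c a b)))
      expand = S.trans (S.sym (S.∏-const p (S.1# S.- q S.^ i)))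
        (S.trans (S.∏-cong p (λ k _ → S.+-congˡ {S.1#} (S.sym (S.trans (S.*-congˡ {y} (S.1^n≈1 k)) (S.*-identityʳ y)))))
        (S.trans (S.rothe S.1# S.1# y p) (S.antidiag-cong p λ a b _ → term a b)))
        where
        term : ∀ a b → S.rothe-term S.1# S.1# y a b ≈ₛ shift (i ℕ.* a) (C (c a b))
        term a b = S.trans (S.*-cong (S.*-cong (S.*-cong (qbinom-1≈C a b) (S.1^n≈1 (tri a))) y^a) (S.1^n≈1 b))
          (S.trans (S.solve 3 (λ B σ x → B S.:* S.con (+ 1) S.:* (σ S.:* x) S.:* S.con (+ 1) S.:= (B S.:* σ) S.:* x) S.refl
                      (C (Z.qbinom (+ 1) a b)) (C (sign a)) (q S.^ (i ℕ.* a)))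
          (S.trans (S.*-congʳ (C-* (Z.qbinom (+ 1) a b) (sign a))) (C*q^≈shift (c a b) (i ℕ.* a))))
          where
          y^a : y S.^ a ≈ₛ C (sign a) S.* q S.^ (i ℕ.* a)
          y^a = S.trans (S.^-congˡ a (S.trans (S.solve 1 (λ u → S.:- u S.:= (S.:- S.con (+ 1)) S.:* u) S.refl (q S.^ i))
                                              (S.*-congʳ (C-neg (+ 1)))))
                (S.trans (S.^-distrib-* (C (ℤ.- + 1)) (q S.^ i) a) (S.*-cong (C-^ (ℤ.- + 1) a) (S.^-assocʳ q i a)))
      sparse-sum : Sparse (S.antidiag p (λ a b → shift (i ℕ.* a) (C (c a b))))
      sparse-sum n p∤n = p∣-cong (≡.sym (antidiag-coeff p _ n)) (p∣-antidiag p _ term)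
        where
        term : ∀ a b → a ℕ.+ b ≡ p → p∣ shift (i ℕ.* a) (C (c a b)) n
        term a b a+b≡p with monomial-coeff (i ℕ.* a) (c a b) n
        ... | inj₂ coeff≡0          = p∣-cong (≡.sym coeff≡0) p∣0
        ... | inj₁ (n≡ia , coeff≡c) = p∣-cong (≡.sym coeff≡c) (interior a b a+b≡p n≡ia)
          where
          interior : ∀ a b → a ℕ.+ b ≡ p → n ≡ i ℕ.* a → p∣ c a b
          interior zero    b       _      n≡0  = ⊥-elim (p∤n (≡.subst (p ℕ.∣_) (≡.sym (≡.trans n≡0 (ℕ.*-zeroʳ i))) (p ℕ.∣0)))
          interior (suc a) zero    a+0≡p  n≡ip = ⊥-elim (p∤n (≡.subst (p ℕ.∣_)
            (≡.sym (≡.trans n≡ip (≡.cong (i ℕ.*_) (≡.trans (≡.sym (ℕ.+-identityʳ (suc a))) a+0≡p)))) (ℕ.n∣m*n i)))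
          interior (suc a) (suc b) a+b≡p  _    = ∣m⇒∣m*n (sign (suc a)) (p∣binomial a b a+b≡p)

    p∣-monomial-sums-* : ∀ n n′ (e e′ : ℕ → ℕ → ℕ) (c c′ : ℕ → ℕ → ℤ) t →
      (∀ a b a′ b′ → a ℕ.+ b ≡ n → a′ ℕ.+ b′ ≡ n′ → e a b ℕ.+ e′ a′ b′ ≡ t → p∣ c a b) →
      p∣ (S.antidiag n (λ a b → shift (e a b) (C (c a b))) S.* S.antidiag n′ (λ a′ b′ → shift (e′ a′ b′) (C (c′ a′ b′)))) t
    p∣-monomial-sums-* n n′ e e′ c c′ t p∣c = p∣-antidiag t _ λ u v u+v≡t →
      p∣-cong (≡.sym (expand u v)) (p∣-antidiag n _ λ a b a+b≡n → p∣-antidiag n′ _ λ a′ b′ a′+b′≡n′ →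
        term (monomial-coeff (e a b) (c a b) u) (monomial-coeff (e′ a′ b′) (c′ a′ b′) v)
             (λ u≡ v≡ → p∣c a b a′ b′ a+b≡n a′+b′≡n′ (≡.trans (≡.cong₂ ℕ._+_ (≡.sym u≡) (≡.sym v≡)) u+v≡t)))
      where
      F G : ℕ → ℕ → Series
      F a b = shift (e a b) (C (c a b))
      G a′ b′ = shift (e′ a′ b′) (C (c′ a′ b′))
      expand : ∀ u v → S.antidiag n F u ℤ.* S.antidiag n′ G v ≡
                       Z.antidiag n (λ a b → Z.antidiag n′ (λ a′ b′ → F a b u ℤ.* G a′ b′ v))
      expand u v = ≡.trans (≡.cong₂ ℤ._*_ (antidiag-coeff n F u) (antidiag-coeff n′ G v))
        (≡.trans (Z.antidiag-*ʳ n (λ a b → F a b u) (Z.antidiag n′ (λ a′ b′ → G a′ b′ v)))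
                 (Z.antidiag-cong n (λ a b _ → Z.antidiag-*ˡ n′ (λ a′ b′ → G a′ b′ v) (F a b u))))
      term : ∀ {E E′ x x′ u v} → (u ≡ E × shift E (C x) u ≡ x) ⊎ shift E (C x) u ≡ + 0 →
             (v ≡ E′ × shift E′ (C x′) v ≡ x′) ⊎ shift E′ (C x′) v ≡ + 0 →
             (u ≡ E → v ≡ E′ → p∣ x) → p∣ (shift E (C x) u ℤ.* shift E′ (C x′) v)
      term {E′ = E′} {x′ = x′} {v = v} (inj₂ coeff≡0) _ _ = p∣-cong (≡.sym (≡.cong (ℤ._* shift E′ (C x′) v) coeff≡0)) p∣0
      term {E} {x = x} {u = u} (inj₁ _) (inj₂ coeff≡0) _ =
        p∣-cong (≡.sym (≡.trans (≡.cong (shift E (C x) u ℤ.*_) coeff≡0) (ℤ.*-zeroʳ (shift E (C x) u)))) p∣0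
      term (inj₁ (u≡ , coeff≡x)) (inj₁ (v≡ , coeff≡x′)) p∣x =
        p∣-cong (≡.sym (≡.cong₂ ℤ._*_ coeff≡x coeff≡x′)) (∣m⇒∣m*n _ (p∣x u≡ v≡))

    module ResidueClass (r M : ℕ) (r<p : r ℕ.< p) where

      VanishesOn : Series → Set
      VanishesOn F = ∀ w → p ℕ.* w ℕ.+ r ℕ.≤ M → p∣ F (p ℕ.* w ℕ.+ r)

      private
        split : ∀ w u z → u ℕ.+ p ℕ.* z ≡ p ℕ.* w ℕ.+ r → z ℕ.≤ w × u ≡ p ℕ.* (w ℕ.∸ z) ℕ.+ r
        split w u z u+pz≡ = z≤w , u≡
          where
          pz<p[w+1] : p ℕ.* z ℕ.< p ℕ.* suc w
          pz<p[w+1] = ℕ.≤-<-trans (ℕ.m≤n+m (p ℕ.* z) u) (≡.subst (ℕ._< p ℕ.* suc w) (≡.sym u+pz≡)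
            (≡.subst (p ℕ.* w ℕ.+ r ℕ.<_) (≡.trans (ℕ.+-comm (p ℕ.* w) p) (≡.sym (ℕ.*-suc p w))) (ℕ.+-monoʳ-< (p ℕ.* w) r<p)))
          z≤w : z ℕ.≤ w
          z≤w = ℕ.≤-pred (ℕ.*-cancelˡ-< p z (suc w) pz<p[w+1])
          regroup : ∀ p a z r → p ℕ.* (a ℕ.+ z) ℕ.+ r ≡ p ℕ.* a ℕ.+ r ℕ.+ p ℕ.* z
          regroup = solve-∀
          u≡ : u ≡ p ℕ.* (w ℕ.∸ z) ℕ.+ r
          u≡ = ℕ.+-cancelʳ-≡ (p ℕ.* z) u (p ℕ.* (w ℕ.∸ z) ℕ.+ r)
            (≡.trans u+pz≡ (≡.trans (≡.cong (λ x → p ℕ.* x ℕ.+ r) (≡.sym (ℕ.m∸n+n≡m z≤w))) (regroup p (w ℕ.∸ z) z r)))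

      VanishesOn-*-Sparse : ∀ E B → Sparse B → VanishesOn E → VanishesOn (E S.* B)
      VanishesOn-*-Sparse E B sparse-B vanish-E w t≤M = p∣-antidiag (p ℕ.* w ℕ.+ r) _ term
        where
        term : ∀ u v → u ℕ.+ v ≡ p ℕ.* w ℕ.+ r → p∣ (E u ℤ.* B v)
        term u v u+v≡ with p ℕ.∣? v
        ... | no  p∤v = ∣n⇒∣m*n (E u) (sparse-B v p∤v)
        ... | yes (ℕ.divides z v≡zp) =
          ∣m⇒∣m*n (B v) (p∣-cong (≡.cong E (≡.sym u≡)) (vanish-E (w ℕ.∸ z) (≡.subst (ℕ._≤ M) u≡ u≤M)))
          where
          u≡ : u ≡ p ℕ.* (w ℕ.∸ z) ℕ.+ r
          u≡ = proj₂ (split w u z (≡.trans (≡.cong (u ℕ.+_) (≡.trans (ℕ.*-comm p z) (≡.sym v≡zp))) u+v≡))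
          u≤M : u ℕ.≤ M
          u≤M = ℕ.≤-trans (ℕ.m≤m+n u v) (≡.subst (ℕ._≤ M) (≡.sym u+v≡) t≤M)

      VanishesOn-cancel-Sparse : ∀ F A → A 0 ≡ + 1 → Sparse A → VanishesOn (F S.* A) → VanishesOn F
      VanishesOn-cancel-Sparse F A A₀≡1 sparse-A vanish-FA = <-rec _ step
        where
        step : ∀ w → (∀ {w′} → w′ ℕ.< w → p ℕ.* w′ ℕ.+ r ℕ.≤ M → p∣ F (p ℕ.* w′ ℕ.+ r)) →
               p ℕ.* w ℕ.+ r ℕ.≤ M → p∣ F (p ℕ.* w ℕ.+ r)
        step w rec t≤M = peel (p ℕ.* w ℕ.+ r) ≡.refl
          where
          F*1 : ∀ t → p∣ (F t ℤ.* A 0) → p∣ F t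
          F*1 t = p∣-cong (≡.trans (≡.cong (F t ℤ.*_) A₀≡1) (ℤ.*-identityʳ (F t)))
          peel : ∀ t → t ≡ p ℕ.* w ℕ.+ r → p∣ F t
          peel zero    t≡ = F*1 0 (p∣-cong (≡.cong (F S.* A) (≡.sym t≡)) (vanish-FA w t≤M))
          peel (suc t) t≡ = F*1 (suc t) (∣m+n∣m⇒∣n
            (p∣-cong (≡.trans (≡.cong (F S.* A) (≡.sym t≡)) (Z.antidiag-last t (λ u v → F u ℤ.* A v))) (vanish-FA w t≤M))
            (p∣-antidiag t _ earlier))
            where
            earlier : ∀ u v → u ℕ.+ v ≡ t → p∣ (F u ℤ.* A (suc v))
            earlier u v u+v≡t with p ℕ.∣? suc v
            ... | no  p∤v = ∣n⇒∣m*n (F u) (sparse-A (suc v) p∤v)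
            ... | yes (ℕ.divides z v≡zp) =
              ∣m⇒∣m*n (A (suc v)) (p∣-cong (≡.cong F (≡.sym u≡)) (rec w-z<w (≡.subst (ℕ._≤ M) u≡ u≤M)))
              where
              u+pz≡ : u ℕ.+ p ℕ.* z ≡ p ℕ.* w ℕ.+ r
              u+pz≡ = ≡.trans (≡.cong (u ℕ.+_) (≡.trans (ℕ.*-comm p z) (≡.sym v≡zp)))
                        (≡.trans (ℕ.+-suc u v) (≡.trans (≡.cong suc u+v≡t) t≡))
              z≤w : z ℕ.≤ w
              z≤w = proj₁ (split w u z u+pz≡)
              u≡ : u ≡ p ℕ.* (w ℕ.∸ z) ℕ.+ r
              u≡ = proj₂ (split w u z u+pz≡)
              positive : ∀ z → suc v ≡ z ℕ.* p → 1 ℕ.≤ z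
              positive (suc _) _ = ℕ.s≤s ℕ.z≤n
              w-z<w : w ℕ.∸ z ℕ.< w
              w-z<w = ℕ.∸-monoʳ-< (positive z v≡zp) z≤w
              u≤M : u ℕ.≤ M
              u≤M = ℕ.≤-trans (ℕ.≤-trans (ℕ.m≤m+n u (suc v)) (ℕ.≤-reflexive (≡.trans (ℕ.+-suc u v) (≡.cong suc u+v≡t))))
                              (≡.subst (ℕ._≤ M) (≡.sym t≡) t≤M)

module FourthPower where
  open import Data.Nat as ℕ using (ℕ; suc; _<_; _≤_; z≤n; s≤s)
  import Data.Nat.Properties as ℕ
  open import Data.Nat.Tactic.RingSolver using (solve-∀)
  open import Data.Nat.Primality using (Prime)
  import Data.Nat.Divisibility as ℕ
  open import Data.Integer as ℤ using (ℤ; +_)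
  import Data.Integer.Properties as ℤ
  open import Data.Integer.Divisibility.Signed using (∣n⇒∣m*n; ∣ᵤ⇒∣)
  open import Data.Product using (_,_)
  open import Data.Sum using (_⊎_; inj₁; inj₂; [_,_]′)
  open import Data.Empty using (⊥-elim)
  open import Relation.Binary.PropositionalEquality as ≡ using (_≡_)
  open Exponents
  open PowerSeries
  open Truncation
  open TruncatedJacobiEuler
  open Primes
  open Sparse

  module JacobiEulerProduct (N : ℕ) where
    K L : ℕ
    K = suc N
    L = suc (K ℕ.+ K)

    module J = TruncatedJacobi 2 (s≤s z≤n) (K ℕ.+ K) K (ℕ.n≤1+n _)
    module E = TruncatedEuler 2 (s≤s z≤n) (K ℕ.+ K) K ℕ.≤-refl
    open PochhammerTruncation 2 (s≤s z≤n) using (P; P-stable)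

    fourth-power≈[<] : P N S.^ 4 ≈[< 2 ℕ.* K ] J.jacobi-sum S.* E.euler-sum
    fourth-power≈[<] = begin
        P N S.^ 4
      ≈⟨ ≈ₛ⇒≈[<] regroup ⟩
        (sign L S.* (P N S.* P N S.* P N)) S.* (sign L S.* P N)
      ≈⟨ ≈[<]-* (≈[<]-*ˡ (sign L) (≈[<]-* (≈[<]-* (stable L ℕ.≤-refl) (stable L ℕ.≤-refl)) (stable L ℕ.≤-refl)))
                  (≈[<]-*ˡ (sign L) (stable (3 ℕ.* L) (ℕ.m≤n*m L 3))) ⟩
        (sign L S.* (P L S.* P L S.* P L)) S.* (sign L S.* P (3 ℕ.* L))
      ≈⟨ ≈[<]-* J.jacobi-truncated E.euler-truncated ⟩
        J.jacobi-sum S.* E.euler-sum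
      ∎
      where
      open ≈[<]-Reasoning (2 ℕ.* K)
      N≤L : N ≤ L
      N≤L = ℕ.≤-trans (ℕ.n≤1+n N) (ℕ.≤-trans (ℕ.m≤m+n K K) (ℕ.n≤1+n _))
      stable : ∀ j → L ≤ j → P N ≈[< 2 ℕ.* K ] P j
      stable j L≤j = ≈[<]-sym (P-stable N j (ℕ.≤-trans N≤L L≤j))
      sign² : sign L S.* sign L ≈ₛ S.1#
      sign² = S.trans (S.sym (S.^-distrib-* (S.- S.1#) (S.- S.1#) L))
        (S.trans (S.^-congˡ L (S.solve 0 ((S.:- S.con (+ 1)) S.:* (S.:- S.con (+ 1)) S.:= S.con (+ 1)) S.refl)) (S.1^n≈1 L))
      regroup : P N S.^ 4 ≈ₛ (sign L S.* (P N S.* P N S.* P N)) S.* (sign L S.* P N)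
      regroup = S.trans (S.solve 1 (λ p → p S.:* (p S.:* (p S.:* (p S.:* S.con (+ 1)))) S.:= S.con (+ 1) S.:* (p S.:* p S.:* p S.:* p)) S.refl (P N))
        (S.trans (S.*-congʳ (S.sym sign²))
          (S.solve 2 (λ p s → (s S.:* s) S.:* (p S.:* p S.:* p S.:* p) S.:= (s S.:* (p S.:* p S.:* p)) S.:* (s S.:* p)) S.refl (P N) (sign L)))

  zsign : ℕ → ℤ
  zsign a = ℤ.-1ℤ Z.^ a

  sign≈C : ∀ a → sign a ≈ₛ C (zsign a)
  sign≈C a = S.trans (S.^-congˡ a (C-neg (+ 1))) (C-^ ℤ.-1ℤ a)

  zsign-odd : ∀ k → zsign (suc (2 ℕ.* k)) ≡ ℤ.-1ℤ
  zsign-odd k = ≡.cong (ℤ.-1ℤ ℤ.*_) (≡.trans (≡.sym (Z.^-assocʳ ℤ.-1ℤ 2 k)) (Z.1^n≈1 k))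

  module Divisibility (p m : ℕ) (p-prime : Prime p) (p≡ : p ≡ 3 ℕ.* suc m ℕ.+ 2)
                         (r : ℕ) (p∣3r+1 : p ℕ.∣ 3 ℕ.* r ℕ.+ 1) (N : ℕ) where
    open JacobiEulerProduct N
    open PochhammerTruncation 2 (s≤s z≤n) using (P)
    open PrimeDivisibility p p-prime
    open TwoModThree p m p-prime p≡ using (p∣x²+3y²⇒p∣y)
    open SparseModulo p p-prime using (p∣-monomial-sums-*)

    nJ nE : ℕ
    nJ = L ℕ.+ suc L
    nE = L ℕ.+ L

    jacobi-pair : ℕ → ℕ → ℤ
    jacobi-pair a b = zsign a ℤ.* + b ℤ.+ zsign b ℤ.* + a

    private
      jacobi-term : ∀ a b → sign a S.* S.⟦ + b ⟧ ≈ₛ C (zsign a ℤ.* + b)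
      jacobi-term a b = S.trans (S.*-cong (sign≈C a) (⟦+⟧≈C b)) (C-* (zsign a) (+ b))

      reduced-swap : ∀ a b → a ℕ.+ b ≡ nJ → J.reduced b a ≡ J.reduced a b
      reduced-swap a b a+b≡ = ≡.cong (ℕ._∸ jacobi-offset L) (≡.trans exponent-swap (≡.sym exponent))
        where open JacobiTerm (jacobiTerm L a b a+b≡)

    -- Pairing the terms (a, b) and (b, a) turns the coefficients into ±(2k+1).
    symmetrized : J.jacobi-sum S.+ J.jacobi-sum ≈ₛ S.antidiag nJ (λ a b → shift (2 ℕ.* J.reduced a b) (C (jacobi-pair a b)))
    symmetrized = S.trans (S.+-congˡ {J.jacobi-sum} (S.antidiag-swap nJ term))
      (S.trans (S.sym (S.antidiag-distrib-+ nJ term (λ a b → term b a))) (S.antidiag-cong nJ pair))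
      where
      term : ℕ → ℕ → Series
      term a b = (sign a S.* S.⟦ + b ⟧) S.* q S.^ (2 ℕ.* J.reduced a b)
      pair : ∀ a b → a ℕ.+ b ≡ nJ → term a b S.+ term b a ≈ₛ shift (2 ℕ.* J.reduced a b) (C (jacobi-pair a b))
      pair a b a+b≡ = S.trans (S.+-congˡ {term a b} (S.*-congˡ {sign b S.* S.⟦ + a ⟧} (S.^-congʳ q (≡.cong (2 ℕ.*_) (reduced-swap a b a+b≡)))))
        (S.trans (S.sym (S.distribʳ (q S.^ (2 ℕ.* J.reduced a b)) (sign a S.* S.⟦ + b ⟧) (sign b S.* S.⟦ + a ⟧)))
        (S.trans (S.*-congʳ (S.trans (S.+-cong (jacobi-term a b) (jacobi-term b a)) (C-+ (zsign a ℤ.* + b) (zsign b ℤ.* + a))))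
        (C*q^≈shift (jacobi-pair a b) (2 ℕ.* J.reduced a b))))

    euler-monomials : E.euler-sum ≈ₛ S.antidiag nE (λ a b → shift (2 ℕ.* E.reduced a b) (C (zsign a)))
    euler-monomials = S.antidiag-cong nE λ a b _ → S.trans (S.*-congʳ (sign≈C a)) (C*q^≈shift (zsign a) (2 ℕ.* E.reduced a b))

    p∣jacobi-pair : ∀ t w a b a′ b′ → t ≡ p ℕ.* w ℕ.+ r → a ℕ.+ b ≡ nJ → a′ ℕ.+ b′ ≡ nE →
                    2 ℕ.* J.reduced a b ℕ.+ 2 ℕ.* E.reduced a′ b′ ≡ t → p∣ jacobi-pair a b
    p∣jacobi-pair t w a b a′ b′ t≡ a+b≡ a′+b′≡ exponents≡ = from-gap JT.gap
      where
      module JT = JacobiTerm (jacobiTerm L a b a+b≡)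
      module ET = EulerTerm (eulerTerm (K ℕ.+ K) a′ b′ a′+b′≡)
      Y : ℕ
      Y = suc (2 ℕ.* JT.k)
      jacobi-reduced : J.reduced a b ≡ tri (suc JT.k)
      jacobi-reduced = ≡.trans (≡.cong (ℕ._∸ jacobi-offset L) JT.exponent) (ℕ.m+n∸m≡n (jacobi-offset L) _)
      euler-reduced : E.reduced a′ b′ ≡ ET.s
      euler-reduced = ≡.trans (≡.cong (ℕ._∸ euler-offset (K ℕ.+ K)) ET.exponent) (ℕ.m+n∸m≡n (euler-offset (K ℕ.+ K)) _)
      quadratic-form : 12 ℕ.* t ℕ.+ 4 ≡ ET.X ℕ.* ET.X ℕ.+ 3 ℕ.* (Y ℕ.* Y)
      quadratic-form = ≡.trans (≡.cong (λ z → 12 ℕ.* z ℕ.+ 4)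
          (≡.trans (≡.sym exponents≡) (≡.cong₂ (λ u v → 2 ℕ.* u ℕ.+ 2 ℕ.* v) jacobi-reduced euler-reduced)))
        (≡.trans (regroup (tri (suc JT.k)) ET.s) (≡.cong₂ (λ u v → u ℕ.+ 3 ℕ.* v) ET.pentagonal (8*tri+1≡odd² JT.k)))
        where
        regroup : ∀ a b → 12 ℕ.* (2 ℕ.* a ℕ.+ 2 ℕ.* b) ℕ.+ 4 ≡ (24 ℕ.* b ℕ.+ 1) ℕ.+ 3 ℕ.* (8 ℕ.* a ℕ.+ 1)
        regroup = solve-∀
      p∣12t+4 : p ℕ.∣ 12 ℕ.* t ℕ.+ 4
      p∣12t+4 = ≡.subst (p ℕ.∣_) (≡.sym (≡.trans (≡.cong (λ z → 12 ℕ.* z ℕ.+ 4) t≡) (regroup p w r)))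
        (ℕ.∣m∣n⇒∣m+n (ℕ.m∣m*n (12 ℕ.* w)) (ℕ.∣n⇒∣m*n 4 p∣3r+1))
        where
        regroup : ∀ p w r → 12 ℕ.* (p ℕ.* w ℕ.+ r) ℕ.+ 4 ≡ p ℕ.* (12 ℕ.* w) ℕ.+ 4 ℕ.* (3 ℕ.* r ℕ.+ 1)
        regroup = solve-∀
      p∣Y : p∣ (+ Y)
      p∣Y = p∣x²+3y²⇒p∣y (+ ET.X) (+ Y) (p∣-cong embed (∣ᵤ⇒∣ (≡.subst (p ℕ.∣_) quadratic-form p∣12t+4)))
        where
        embed : + (ET.X ℕ.* ET.X ℕ.+ 3 ℕ.* (Y ℕ.* Y)) ≡ + ET.X ℤ.* + ET.X ℤ.+ + 3 ℤ.* (+ Y ℤ.* + Y)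
        embed = ≡.trans (ℤ.pos-+ (ET.X ℕ.* ET.X) (3 ℕ.* (Y ℕ.* Y)))
          (≡.cong₂ ℤ._+_ (ℤ.pos-* ET.X ET.X) (≡.trans (ℤ.pos-* 3 (Y ℕ.* Y)) (≡.cong (+ 3 ℤ.*_) (ℤ.pos-* Y Y))))
      pair-gap : ∀ x y → y ≡ x ℕ.+ Y → jacobi-pair x y ≡ zsign x ℤ.* + Y
      pair-gap x y ≡.refl = ≡.trans (≡.cong₂ (λ u v → zsign x ℤ.* u ℤ.+ v ℤ.* + x) (ℤ.pos-+ x Y)
                               (≡.trans (Z.^-homo-* ℤ.-1ℤ x Y) (≡.cong (zsign x ℤ.*_) (zsign-odd JT.k))))
        (Z.solve 3 (λ s x y → s Z.:* (x Z.:+ y) Z.:+ s Z.:* (Z.:- Z.con (+ 1)) Z.:* x Z.:= s Z.:* y) ≡.refl (zsign x) (+ x) (+ Y))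
      from-gap : b ≡ a ℕ.+ Y ⊎ a ≡ b ℕ.+ Y → p∣ jacobi-pair a b
      from-gap (inj₁ b≡) = p∣-cong (≡.sym (pair-gap a b b≡)) (∣n⇒∣m*n (zsign a) p∣Y)
      from-gap (inj₂ a≡) = p∣-cong (≡.trans (≡.sym (pair-gap b a a≡)) (ℤ.+-comm (zsign b ℤ.* + a) (zsign a ℤ.* + b)))
                                   (∣n⇒∣m*n (zsign b) p∣Y)

    p∣fourth-power : ∀ t w → t < 2 ℕ.* K → t ≡ p ℕ.* w ℕ.+ r → p∣ ((P N S.^ 4) t)
    p∣fourth-power t w t<2K t≡ = [ (λ p∣2 → ⊥-elim (p∤ 2 (s≤s z≤n) (s≤s (s≤s (s≤s z≤n))) p∣2)) ,
                                   (λ p∣x → p∣-cong (≡.sym (fourth-power≈[<] t t<2K)) p∣x) ]′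
      (p∣-* (+ 2) x (p∣-cong doubled (p∣-monomial-sums-* nJ nE (λ a b → 2 ℕ.* J.reduced a b) (λ a b → 2 ℕ.* E.reduced a b)
                                                          jacobi-pair (λ a _ → zsign a) t
        (λ a b a′ b′ a+b≡ a′+b′≡ exponents≡ → p∣jacobi-pair t w a b a′ b′ t≡ a+b≡ a′+b′≡ exponents≡))))
      where
      open TwoModThree p m p-prime p≡ using (p∤)
      x : ℤ
      x = (J.jacobi-sum S.* E.euler-sum) t
      doubled : (S.antidiag nJ (λ a b → shift (2 ℕ.* J.reduced a b) (C (jacobi-pair a b))) S.*
                 S.antidiag nE (λ a b → shift (2 ℕ.* E.reduced a b) (C (zsign a)))) t ≡ + 2 ℤ.* x
      doubled = ≡.trans (at (S.*-cong (S.sym symmetrized) (S.sym euler-monomials)) t)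
        (≡.trans (at (S.distribʳ E.euler-sum J.jacobi-sum J.jacobi-sum) t) (Z.solve 1 (λ y → y Z.:+ y Z.:= Z.con (+ 2) Z.:* y) ≡.refl x))

open import Data.Bool using (Bool; true; false; if_then_else_)
open import Data.Nat as ℕ using (ℕ; zero; suc; _≤_; _<_; s≤s; z≤n; _+_; _*_; _∸_; _%_; _/_)
import Data.Nat.Properties as ℕ
open import Data.Nat.DivMod using ([m+kn]%n≡m%n; m*n%n≡0; m≡m%n+[m/n]*n)
open import Data.Nat.Divisibility using (_∣_)
open import Data.Nat.Primality using (Prime)
open import Data.Nat.Tactic.RingSolver using (solve-∀)
open import Data.Integer as ℤ using (ℤ; +_)
open import Data.Integer.Divisibility.Signed using (∣⇒∣ᵤ)
open import Data.Product using (Σ; _×_; _,_)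
open import Data.Sum using (_⊎_; inj₁; inj₂)
open import Relation.Binary.PropositionalEquality as ≡ using (_≡_)
open import Defs
open PowerSeries
open Truncation
open Partitions
open Sparse
open Primes
open FourthPower

even-factor : ℕ → Series
even-factor i = if (suc i % 2 ℕ.≡ᵇ 0) then factor i else S.1#

private
  even-factor-2h≡1 : ∀ h → even-factor (2 * h) ≡ S.1#
  even-factor-2h≡1 h = ≡.cong (λ b → if (b ℕ.≡ᵇ 0) then factor (2 * h) else S.1#)
    (≡.trans (≡.cong (λ n → suc n % 2) (ℕ.*-comm 2 h)) ([m+kn]%n≡m%n 1 h 2))

  even-factor-2h+1≡factor : ∀ h → even-factor (suc (2 * h)) ≡ factor (suc (2 * h))
  even-factor-2h+1≡factor h = ≡.cong (λ b → if (b ℕ.≡ᵇ 0) then factor (suc (2 * h)) else S.1#)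
    (≡.trans (≡.cong (λ n → suc (suc n) % 2) (ℕ.*-comm 2 h)) (m*n%n≡0 (suc h) 2))

even-product-even : ∀ h → S.∏[ i < 2 * h ] even-factor i ≈ₛ S.poch (q S.^ 2) h
even-product-even zero    = S.refl
even-product-even (suc h) = begin
  S.∏ (2 * suc h) even-factor                                          ≡⟨ ≡.cong (λ n → S.∏ n even-factor) (ℕ.*-suc 2 h) ⟩
  S.∏ (2 * h) even-factor S.* even-factor (2 * h) S.* even-factor (suc (2 * h))
    ≈⟨ S.*-cong (S.*-cong (even-product-even h) (S.reflexive (even-factor-2h≡1 h))) (S.reflexive (even-factor-2h+1≡factor h)) ⟩
  S.poch (q S.^ 2) h S.* S.1# S.* factor (suc (2 * h))                 ≈⟨ S.*-congʳ (S.*-identityʳ (S.poch (q S.^ 2) h)) ⟩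
  S.poch (q S.^ 2) h S.* (S.1# S.- q S.^ (2 ℕ.+ 2 * h))                ≈⟨ S.*-congˡ {S.poch (q S.^ 2) h} (S.+-congˡ {S.1#} (S.-‿cong q²ʰ⁺²)) ⟩
  S.poch (q S.^ 2) (suc h)                                             ∎
  where
  open import Relation.Binary.Reasoning.Setoid S.setoid
  q²ʰ⁺² : q S.^ (2 ℕ.+ 2 * h) ≈ₛ (q S.^ 2) S.^ suc h
  q²ʰ⁺² = S.trans (S.^-congʳ q (≡.sym (ℕ.*-suc 2 h))) (S.sym (S.^-assocʳ q 2 (suc h)))

even-product-odd : ∀ h → S.∏[ i < suc (2 * h) ] even-factor i ≈ₛ S.poch (q S.^ 2) h
even-product-odd h = S.trans (S.*-cong (even-product-even h) (S.reflexive (even-factor-2h≡1 h))) (S.*-identityʳ (S.poch (q S.^ 2) h))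

factor-constant-term : ∀ i → factor i 0 ≡ + 1
factor-constant-term i = ≡.cong (λ z → + 1 ℤ.- z) (at (q^-shift (suc i)) 0)

module Colors (p k j : ℕ) (j≤k : j ≤ k) (4≤p : 4 ≤ p) where
  even-colors odd-colors extra : ℕ
  even-colors = p * (k ∸ j) + (p ∸ 4)
  odd-colors  = p * k + p
  extra       = p * j + 4

  open PartitionSeries even-colors odd-colors public

  private
    even-colors+extra : even-colors + extra ≡ p * suc k
    even-colors+extra = ≡.subst₂ (λ p′ k′ → p′ * (k′ ∸ j) + (p′ ∸ 4) + (p′ * j + 4) ≡ p′ * suc k′)
      (ℕ.m+[n∸m]≡n 4≤p) (ℕ.m+[n∸m]≡n j≤k)
      (≡.trans (≡.cong₂ (λ u v → (4 + (p ∸ 4)) * u + v + ((4 + (p ∸ 4)) * j + 4)) (ℕ.m+n∸m≡n j (k ∸ j)) (ℕ.m+n∸m≡n 4 (p ∸ 4)))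
               (regroup (p ∸ 4) (k ∸ j) j))
      where
      regroup : ∀ p′ d j → (4 + p′) * d + p′ + ((4 + p′) * j + 4) ≡ (4 + p′) * suc (j + d)
      regroup = solve-∀

    fill-colors : ∀ i b → factor i S.^ (if b then even-colors else odd-colors) S.* (if b then factor i else S.1#) S.^ extra
                           ≈ₛ factor i S.^ (p * suc k)
    fill-colors i true  = S.trans (S.sym (S.^-homo-* (factor i) even-colors extra)) (S.^-congʳ (factor i) even-colors+extra)
    fill-colors i false = S.trans (S.*-congˡ {factor i S.^ odd-colors} (S.1^n≈1 extra))
      (S.trans (S.*-identityʳ _) (S.^-congʳ (factor i) (≡.trans (ℕ.+-comm (p * k) p) (≡.sym (ℕ.*-suc p k)))))

  complete-colors : ∀ M → euler-product M S.* S.∏ M even-factor S.^ extra ≈ₛ S.∏ M factor S.^ (p * suc k)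
  complete-colors M = S.trans (S.*-congˡ {euler-product M} (S.∏-^ M even-factor extra))
    (S.trans (S.sym (S.∏-distrib-* M _ _))
    (S.trans (S.∏-cong M (λ i _ → fill-colors i (suc i % 2 ℕ.≡ᵇ 0)))
    (S.sym (S.∏-^ M factor (p * suc k)))))

private
  p≡3[m+1]+2 : ∀ p → p % 12 ≡ 5 ⊎ p % 12 ≡ 11 → Σ ℕ λ m → p ≡ 3 * suc m + 2
  p≡3[m+1]+2 p (inj₁ p%12≡5)  = 4 * (p / 12) ,
    ≡.trans (m≡m%n+[m/n]*n p 12) (≡.trans (≡.cong (_+ (p / 12) * 12) p%12≡5) (regroup (p / 12)))
    where
    regroup : ∀ d → 5 + d * 12 ≡ 3 * suc (4 * d) + 2
    regroup = solve-∀
  p≡3[m+1]+2 p (inj₂ p%12≡11) = 4 * (p / 12) + 2 ,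
    ≡.trans (m≡m%n+[m/n]*n p 12) (≡.trans (≡.cong (_+ (p / 12) * 12) p%12≡11) (regroup (p / 12)))
    where
    regroup : ∀ d → 11 + d * 12 ≡ 3 * suc (4 * d + 2) + 2
    regroup = solve-∀

  parity : ∀ M → Σ ℕ λ h → M ≡ 2 * h ⊎ M ≡ suc (2 * h)
  parity zero = 0 , inj₁ ≡.refl
  parity (suc M) with parity M
  ... | h , inj₁ M≡2h  = h , inj₂ (≡.cong suc M≡2h)
  ... | h , inj₂ M≡2h+1 = suc h , inj₁ (≡.trans (≡.cong suc M≡2h+1) (≡.sym (ℕ.*-suc 2 h)))

  even-product-poch : ∀ M → Σ ℕ λ h → (S.∏ M even-factor ≈ₛ S.poch (q S.^ 2) h) × M < 2 * suc h
  even-product-poch M with parity M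
  ... | h , inj₁ ≡.refl = h , even-product-even h , ℕ.*-monoʳ-< 2 (ℕ.n<1+n h)
  ... | h , inj₂ ≡.refl = h , even-product-odd h , ≡.subst (suc (2 * h) <_) (≡.sym (ℕ.*-suc 2 h)) (ℕ.n<1+n _)

module Congruence (p m : ℕ) (p-prime : Prime p) (p≡ : p ≡ 3 * suc m + 2) (r : ℕ) (r<p : r < p) (p∣3r+1 : p ∣ 3 * r + 1)
                  (k j : ℕ) (j≤k : j ≤ k) (M : ℕ) where
  private
    4≤p : 4 ≤ p
    4≤p = ≡.subst (4 ≤_) (≡.sym p≡) (ℕ.≤-trans (s≤s (s≤s (s≤s (s≤s z≤n)))) (ℕ.+-monoˡ-≤ 2 (ℕ.m≤m*n 3 (suc m))))

  open Colors p k j j≤k 4≤p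
  open SparseModulo p p-prime
  open ResidueClass r M r<p
  open PrimeDivisibility p p-prime using (p∣-cong)

  Ev A B E : Series
  Ev = S.∏ M even-factor
  A  = S.∏ M factor S.^ (p * suc k)
  B  = (Ev S.^ p) S.^ j
  E  = Ev S.^ 4

  A₀≡1 : A 0 ≡ + 1
  A₀≡1 = begin
    A 0                                       ≡⟨ ^-constant-term (S.∏ M factor) (p * suc k) ⟩
    S.∏ M factor 0 Z.^ (p * suc k)            ≡⟨ ≡.cong (Z._^ (p * suc k)) (∏-constant-term M factor) ⟩
    Z.∏ M (λ i → factor i 0) Z.^ (p * suc k)  ≡⟨ ≡.cong (Z._^ (p * suc k)) (Z.∏-cong M (λ i _ → factor-constant-term i)) ⟩
    Z.∏[ i < M ] (+ 1) Z.^ (p * suc k)        ≡⟨ ≡.cong (Z._^ (p * suc k)) (≡.trans (Z.∏-const M (+ 1)) (Z.1^n≈1 M)) ⟩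
    (+ 1) Z.^ (p * suc k)                     ≡⟨ Z.1^n≈1 (p * suc k) ⟩
    + 1                                       ∎
    where open ≡.≡-Reasoning

  sparse-A : Sparse A
  sparse-A = Sparse-cong (S.^-assocʳ (S.∏ M factor) p (suc k))
    (Sparse-^ (suc k) (Sparse-cong (S.sym (S.∏-^ M factor p)) (Sparse-∏ M _ (λ i → Sparse-frobenius (suc i)))))

  sparse-B : Sparse B
  sparse-B = Sparse-^ j (Sparse-cong (S.sym (S.∏-^ M even-factor p)) (Sparse-∏ M _ sparse-even))
    where
    sparse-even : ∀ i → Sparse (even-factor i S.^ p)
    sparse-even i with suc i % 2 ℕ.≡ᵇ 0
    ... | true  = Sparse-frobenius (suc i)
    ... | false = Sparse-cong (S.sym (S.1^n≈1 p)) Sparse-1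

  partitions*A≈E*B : partitions M S.* A ≈ₛ E S.* B
  partitions*A≈E*B = begin
    partitions M S.* A                                   ≈⟨ S.*-congˡ {partitions M} (complete-colors M) ⟨
    partitions M S.* (euler-product M S.* Ev S.^ extra)  ≈⟨ S.solve 3 (λ x y z → x S.:* (y S.:* z) S.:= (y S.:* x) S.:* z) S.refl
                                                              (partitions M) (euler-product M) (Ev S.^ extra) ⟩
    (euler-product M S.* partitions M) S.* Ev S.^ extra  ≈⟨ S.*-congʳ (euler-product*partitions M) ⟩
    S.1# S.* Ev S.^ extra                                ≈⟨ S.*-identityˡ _ ⟩
    Ev S.^ (p * j + 4)                                   ≈⟨ S.^-homo-* Ev (p * j) 4 ⟩
    Ev S.^ (p * j) S.* E                                 ≈⟨ S.*-congʳ (S.^-assocʳ Ev p j) ⟨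
    B S.* E                                              ≈⟨ S.*-comm B E ⟩
    E S.* B                                              ∎
    where open import Relation.Binary.Reasoning.Setoid S.setoid

  vanishes-E : VanishesOn E
  vanishes-E w t≤M with even-product-poch M
  ... | h , Ev≈poch , M<2h+2 = p∣-cong (≡.sym (at (S.^-congˡ 4 Ev≈poch) (p * w + r)))
    (p∣fourth-power (p * w + r) w (ℕ.≤-<-trans t≤M M<2h+2) ≡.refl)
    where open Divisibility p m p-prime p≡ r p∣3r+1 h

  partitions-vanish : VanishesOn (partitions M)
  partitions-vanish = VanishesOn-cancel-Sparse (partitions M) A A₀≡1 sparse-A λ w t≤M →
    p∣-cong (≡.sym (at partitions*A≈E*B (p * w + r))) (VanishesOn-*-Sparse E B sparse-B vanishes-E w t≤M)

theorem1p12 : (p : ℕ) → Prime p → (p % 12 ≡ 5 ⊎ p % 12 ≡ 11) →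
              (r : ℕ) → 1 ≤ r → r ≤ p ∸ 1 → p ∣ 3 * r + 1 →
              (n k j : ℕ) → j ≤ k →
              p ∣ a (p * (k ∸ j) + (p ∸ 4)) (p * k + p) (p * n + r)
theorem1p12 p p-prime p%12 r _ r≤p-1 p∣3r+1 n k j j≤k with p≡3[m+1]+2 p p%12
... | m , p≡ = ∣⇒∣ᵤ (partitions-vanish n ℕ.≤-refl)
  where
  r<p : r < p
  r<p = ≡.subst (r <_) (≡.sym p≡) (s≤s (≡.subst (r ≤_) (≡.cong (_∸ 1) p≡) r≤p-1))
  open Congruence p m p-prime p≡ r r<p p∣3r+1 k j j≤k (p * n + r)
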